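{- Let $n\ge1$. Let $\mathcal A$ be the set of partitions $\lambda$ in which every part occurs at most twice, whose alternating sum type (modulus $3$) satisfies $\Sigma_2(\lambda)=2$, and in which exactly two basic units $(\lambda_{3i-2},\lambda_{3i-1},\lambda_{3i})$ satisfy $\lambda_{3i-1}-\lambda_{3i}=1$. Put $$G_n=\frac{z^{n+1}q^{3n^2+4n+1}}{(zq;q^3)_{n+1}(q^3;q^3)_{n}}.$$ Then $$\sum_{\substack{\lambda\in\mathcal A\\ \lambda\text{ has exactly }3n+1\text{ positive parts}}} z^{\Sigma_1(\lambda)}q^{|\lambda|}=G_n\Bigg[\sum_{k=1}^{n-1}\Big(\frac{1}{z^2q^{3k+1}}+\frac{1-q^{3k}}{zq^{3k}}\Big)+\sum_{d=1}^{n-2}\sum_{k=1}^{n-d-1}\frac{1}{z^2q^{6k+3d+1}}\Bigg],$$ where empty sums are zero.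
   Context: For a partition $\lambda_1\ge\dots\ge\lambda_r>0$, append zero parts so that its length becomes a multiple $3k$ of $3$. Its basic units are the blocks $(\lambda_{3i-2},\lambda_{3i-1},\lambda_{3i})$, $1\le i\le k$, and its alternating sum type (modulus 3) is $(\Sigma_1,\Sigma_2)$ with $\Sigma_1=\sum_{i=1}^k(\lambda_{3i-2}-\lambda_{3i-1})$ and $\Sigma_2=\sum_{i=1}^k(\lambda_{3i-1}-\lambda_{3i})$. $|\lambda|$ is the sum of the parts. $(a;q)_n=\prod_{i=0}^{n-1}(1-aq^i)$, with $(a;q)_0=1$. The identity is one of formal power series in $q$ with coefficients Laurent polynomials in $z$. -}

module Defs where

open import Data.Bool using (Bool; true; false; _∧_; if_then_else_)
open import Data.Nat as ℕ using (ℕ; zero; suc; _≡ᵇ_; _≤ᵇ_)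
open import Data.Integer as ℤ using (ℤ; +_; -[1+_]; -_)
open import Data.List using (List; []; _∷_; [_]; map; concatMap; upTo; _++_; foldr; length)
open import Data.Product using (_×_; _,_)
open import Relation.Nullary.Decidable using (⌊_⌋)

sumℤ : List ℤ → ℤ
sumℤ = foldr ℤ._+_ (+ 0)

sumℕ : List ℕ → ℕ
sumℕ = foldr ℕ._+_ 0

allB : {A : Set} → (A → Bool) → List A → Bool
allB p []       = true
allB p (x ∷ xs) = p x ∧ allB p xs

countB : {A : Set} → (A → Bool) → List A → ℕ
countB p []       = 0
countB p (x ∷ xs) = if p x then suc (countB p xs) else countB p xs

oneTo : ℕ → List ℕ
oneTo N = map suc (upTo N)

nonincreasing : List ℕ → Bool
nonincreasing (x ∷ y ∷ l) = (y ≤ᵇ x) ∧ nonincreasing (y ∷ l)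
nonincreasing _           = true

allPositive : List ℕ → Bool
allPositive = allB (λ x → 1 ≤ᵇ x)

isPartition : List ℕ → Bool
isPartition l = nonincreasing l ∧ allPositive l

atMostTwice : List ℕ → Bool
atMostTwice l = allB (λ x → countB (λ y → x ≡ᵇ y) l ≤ᵇ 2) l

-- basic units: pad with zero parts to a length divisible by 3, then cut
-- into consecutive blocks (λ_{3i-2}, λ_{3i-1}, λ_{3i})
units : List ℕ → List (ℕ × ℕ × ℕ)
units (a ∷ b ∷ c ∷ l) = (a , b , c) ∷ units l
units (a ∷ b ∷ [])    = (a , b , 0) ∷ []
units (a ∷ [])        = (a , 0 , 0) ∷ []
units []              = []

Σ₁ : List ℕ → ℤ
Σ₁ l = sumℤ (map (λ { (a , b , c) → (+ a) ℤ.- (+ b) }) (units l))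

Σ₂ : List ℕ → ℤ
Σ₂ l = sumℤ (map (λ { (a , b , c) → (+ b) ℤ.- (+ c) }) (units l))

unitsDiffOne : List ℕ → ℕ
unitsDiffOne l = countB (λ { (a , b , c) → b ≡ᵇ suc c }) (units l)

inA : List ℕ → Bool
inA l = atMostTwice l ∧ ⌊ Σ₂ l ℤ.≟ + 2 ⌋ ∧ (unitsDiffOne l ≡ᵇ 2)

tuples : ℕ → ℕ → List (List ℕ)
tuples zero    b = [ [] ]
tuples (suc l) b = concatMap (λ x → map (x ∷_) (tuples l b)) (upTo (suc b))

-- Laurent series in z, q with integer coefficients, given by their
-- coefficient function:  f j m = coefficient of z^j q^m.

LSeries : Set
LSeries = ℤ → ℤ → ℤ

-- Coefficient of z^j q^m: the number of such λ with |λ| = m and Σ₁ λ = j.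
-- (A partition of m has all parts ≤ m, so enumerating tuples with
-- entries in {0..m} is exhaustive.)
lhsSeries : ℕ → LSeries
lhsSeries n j (+ m)    =
  + countB (λ l → isPartition l ∧ (sumℕ l ≡ᵇ m) ∧ inA l ∧ ⌊ Σ₁ l ℤ.≟ j ⌋)
           (tuples (suc (3 ℕ.* n)) m)
lhsSeries n j -[1+ m ] = + 0

PSeries : Set
PSeries = ℕ → ℕ → ℤ

oneP : PSeries
oneP zero zero = + 1
oneP _    _    = + 0

_*P_ : PSeries → PSeries → PSeries
(f *P g) j m = sumℤ (concatMap (λ a → map (λ b → f a b ℤ.* g (j ℕ.∸ a) (m ℕ.∸ b))
                                         (upTo (suc m)))
                               (upTo (suc j)))

prodP : List PSeries → PSeries
prodP = foldr _*P_ oneP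

-- 1 / (1 - z^a q^b) = Σ_{t ≥ 0} z^{a t} q^{b t}   (used only with b ≥ 1,
-- in which case every t with q-exponent b t = m satisfies t ≤ m)
geom : ℕ → ℕ → PSeries
geom a b j m = + countB (λ t → (j ≡ᵇ a ℕ.* t) ∧ (m ≡ᵇ b ℕ.* t)) (upTo (suc m))

invPochZ : ℕ → PSeries
invPochZ n = prodP (map (λ i → geom 1 (3 ℕ.* i ℕ.+ 1)) (upTo (suc n)))

invPochQ : ℕ → PSeries
invPochQ n = prodP (map (λ i → geom 0 (3 ℕ.* i ℕ.+ 3)) (upTo n))

-- Laurent polynomials in z, q: finite lists of terms c · z^a q^b

LPoly : Set
LPoly = List (ℤ × ℤ × ℤ)

mono : ℤ → ℤ → ℤ → LPoly
mono c a b = [ (c , a , b) ]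

_+L_ : LPoly → LPoly → LPoly
p +L r = p ++ r

_*L_ : LPoly → LPoly → LPoly
p *L r = concatMap (λ { (c , a , b) →
           map (λ { (c' , a' , b') → (c ℤ.* c' , a ℤ.+ a' , b ℤ.+ b') }) r }) p

sumL : List LPoly → LPoly
sumL = foldr _+L_ []

extP : PSeries → LSeries
extP f (+ j) (+ m) = f j m
extP f _     _     = + 0

mulPL : PSeries → LPoly → LSeries
mulPL f p j m = sumℤ (map (λ { (c , a , b) → c ℤ.* extP f (j ℤ.- a) (m ℤ.- b) }) p)

bracket : ℕ → LPoly
bracket n =
  sumL (map (λ k → mono (+ 1) (- + 2) (- + (3 ℕ.* k ℕ.+ 1))
                   +L ((mono (+ 1) (+ 0) (+ 0) +L mono (- + 1) (+ 0) (+ (3 ℕ.* k)))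
                       *L mono (+ 1) (- + 1) (- + (3 ℕ.* k))))
            (oneTo (n ℕ.∸ 1)))
  +L
  sumL (map (λ d → sumL (map (λ k → mono (+ 1) (- + 2) (- + (6 ℕ.* k ℕ.+ 3 ℕ.* d ℕ.+ 1)))
                             (oneTo (n ℕ.∸ d ℕ.∸ 1))))
            (oneTo (n ℕ.∸ 2)))

rhsSeries : ℕ → LSeries
rhsSeries n =
  mulPL (invPochZ n *P invPochQ n)
        (mono (+ 1) (+ (suc n)) (+ (3 ℕ.* n ℕ.* n ℕ.+ 4 ℕ.* n ℕ.+ 1)) *L bracket n)

-- Encode a partition with 3n+1 positive parts by its differences d_i = λ_i - λ_{i+1}: then |λ| = Σ i d_i,
-- Σ₁ is the sum of the first differences of the units, and "no part three times" says that no two consecutive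
-- differences vanish. Since Σ₂ = 2 and exactly two units have middle difference 1, the middle differences form
-- the pattern 0…010…010…0, with the ones at units k and k + d + 1 (d ≥ 0). For a fixed pattern, a zero middle
-- difference forces its two neighbours to be positive; subtracting these lower bounds leaves free exponents
-- counted by 1/((zq;q³)_{n+1} (q³;q³)_n), times a monomial. For d ≥ 1 this is the summand z⁻² q^{-6k-3d-1}.
-- For adjacent ones one coupling remains (two free exponents are not both zero), and inclusion–exclusion
-- produces z⁻² q^{-3k-1} + (1 - q^{3k}) z⁻¹ q^{-3k}. All series are compared coefficientwise, by counting
-- exponent vectors in the finite boxes enumerated by tuples.

module Submission where

open import Data.Bool using (Bool; true; false; _∧_; not; if_then_else_)
open import Data.Bool.Properties using (∧-zeroʳ; ∧-identityʳ)
open import Data.Empty using (⊥-elim)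
open import Data.Integer as ℤ using (ℤ; -[1+_])
import Data.Integer.Properties as ℤP
import Data.Integer.Tactic.RingSolver as ℤSolver
open import Data.List using (List; []; _∷_; [_]; map; concatMap; upTo; applyUpTo; _++_; length; zipWith; take;
    drop; replicate)
import Data.List.Properties as List
open import Data.List.Relation.Unary.All as All using (All; []; _∷_)
import Data.List.Relation.Unary.All.Properties as All
open import Data.Nat as ℕ using (ℕ; zero; suc; _+_; _*_; _∸_; _≤_; _<_; z≤n; s≤s; _≡ᵇ_; _≤ᵇ_; _<ᵇ_)
open import Data.Nat.Properties
open import Algebra.Properties.CommutativeSemigroup +-commutativeSemigroup using () renaming
    (interchange to +-interchange)
import Data.Nat.Tactic.RingSolver as ℕSolver
open import Data.Product using (_×_; _,_; proj₁; proj₂; Σ)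
open import Data.Sum using (_⊎_; inj₁; inj₂)
open import Function using (_∘_)
open import Relation.Binary.Definitions using (tri<; tri≈; tri>)
open import Relation.Binary.PropositionalEquality hiding ([_])
open import Relation.Nullary using (yes; no)
open import Relation.Nullary.Decidable using (⌊_⌋)

open import Defs

∑ : {A : Set} → List A → (A → ℕ) → ℕ
∑ [] F = 0
∑ (x ∷ l) F = F x + ∑ l F

𝟙 : Bool → ℕ
𝟙 true = 1
𝟙 false = 0

countB≡∑𝟙 : {A : Set} (p : A → Bool) (l : List A) → countB p l ≡ ∑ l (λ x → 𝟙 (p x))
countB≡∑𝟙 p [] = refl
countB≡∑𝟙 p (x ∷ l) with p x
... | true = cong suc (countB≡∑𝟙 p l)
... | false = countB≡∑𝟙 p l

∑-++ : {A : Set} (l₁ l₂ : List A) (F : A → ℕ) → ∑ (l₁ ++ l₂) F ≡ ∑ l₁ F + ∑ l₂ F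
∑-++ [] l₂ F = refl
∑-++ (x ∷ l₁) l₂ F = trans (cong (F x +_) (∑-++ l₁ l₂ F)) (sym (+-assoc (F x) _ _))

∑-map : {A B : Set} (f : A → B) (l : List A) (F : B → ℕ) → ∑ (map f l) F ≡ ∑ l (F ∘ f)
∑-map f [] F = refl
∑-map f (x ∷ l) F = cong (F (f x) +_) (∑-map f l F)

∑-concatMap : {A B : Set} (f : A → List B) (l : List A) (F : B → ℕ) →
  ∑ (concatMap f l) F ≡ ∑ l (λ x → ∑ (f x) F)
∑-concatMap f [] F = refl
∑-concatMap f (x ∷ l) F =
  trans (∑-++ (f x) (concatMap f l) F) (cong (∑ (f x) F +_) (∑-concatMap f l F))

∑-cong : {A : Set} (l : List A) {F G : A → ℕ} → (∀ x → F x ≡ G x) → ∑ l F ≡ ∑ l G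
∑-cong [] h = refl
∑-cong (x ∷ l) h = cong₂ _+_ (h x) (∑-cong l h)

∑-+ : {A : Set} (l : List A) (F G : A → ℕ) → ∑ l (λ x → F x + G x) ≡ ∑ l F + ∑ l G
∑-+ [] F G = refl
∑-+ (x ∷ l) F G rewrite ∑-+ l F G = +-interchange (F x) (G x) (∑ l F) (∑ l G)

∑-*ˡ : {A : Set} (l : List A) (c : ℕ) (F : A → ℕ) → ∑ l (λ x → c * F x) ≡ c * ∑ l F
∑-*ˡ [] c F = sym (*-zeroʳ c)
∑-*ˡ (x ∷ l) c F = trans (cong (c * F x +_) (∑-*ˡ l c F)) (sym (*-distribˡ-+ c (F x) (∑ l F)))

∑-*ʳ : {A : Set} (l : List A) (c : ℕ) (F : A → ℕ) → ∑ l (λ x → F x * c) ≡ ∑ l F * c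
∑-*ʳ l c F = trans (∑-cong l (λ x → *-comm (F x) c)) (trans (∑-*ˡ l c F) (*-comm c (∑ l F)))

∑-0 : {A : Set} (l : List A) → ∑ l (λ _ → 0) ≡ 0
∑-0 [] = refl
∑-0 (x ∷ l) = ∑-0 l

∑-swap : {A B : Set} (l₁ : List A) (l₂ : List B) (F : A → B → ℕ) →
  ∑ l₁ (λ x → ∑ l₂ (F x)) ≡ ∑ l₂ (λ y → ∑ l₁ (λ x → F x y))
∑-swap [] l₂ F = sym (∑-0 l₂)
∑-swap (x ∷ l₁) l₂ F =
  trans (cong (∑ l₂ (F x) +_) (∑-swap l₁ l₂ F)) (sym (∑-+ l₂ (F x) (λ y → ∑ l₁ (λ x' → F x' y))))

∑-cong-applyUpTo : {A : Set} (f : ℕ → A) (N : ℕ) {F G : A → ℕ} →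
  (∀ i → i < N → F (f i) ≡ G (f i)) → ∑ (applyUpTo f N) F ≡ ∑ (applyUpTo f N) G
∑-cong-applyUpTo f zero h = refl
∑-cong-applyUpTo f (suc N) h =
  cong₂ _+_ (h 0 (s≤s z≤n)) (∑-cong-applyUpTo (f ∘ suc) N (λ i i<N → h (suc i) (s≤s i<N)))

∑-cong-upTo : (N : ℕ) {F G : ℕ → ℕ} → (∀ i → i < N → F i ≡ G i) → ∑ (upTo N) F ≡ ∑ (upTo N) G
∑-cong-upTo N h = ∑-cong-applyUpTo (λ i → i) N h

∑-upTo-suc : (N : ℕ) (F : ℕ → ℕ) → ∑ (upTo (suc N)) F ≡ ∑ (upTo N) F + F N
∑-upTo-suc N F = begin
  ∑ (upTo (suc N)) F       ≡⟨ cong (λ l → ∑ l F) (sym (List.upTo-∷ʳ N)) ⟩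
  ∑ (upTo N ++ [ N ]) F    ≡⟨ ∑-++ (upTo N) [ N ] F ⟩
  ∑ (upTo N) F + (F N + 0) ≡⟨ cong (∑ (upTo N) F +_) (+-identityʳ (F N)) ⟩
  ∑ (upTo N) F + F N       ∎
  where open ≡-Reasoning

∑-oneTo : ∀ N (F : ℕ → ℕ) → ∑ (oneTo N) F ≡ ∑ (upTo N) (λ i → F (suc i))
∑-oneTo N F = ∑-map suc (upTo N) F

cong₃ : {A B C D : Set} (f : A → B → C → D) {a a′ : A} {b b′ : B} {c c′ : C} →
  a ≡ a′ → b ≡ b′ → c ≡ c′ → f a b c ≡ f a′ b′ c′
cong₃ f refl refl refl = refl

false≢true : false ≢ true
false≢true ()

∧≡true : ∀ {a b} → (a ∧ b) ≡ true → a ≡ true × b ≡ true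
∧≡true {true} {true} e = refl , refl

≡ᵇ-refl : ∀ n → (n ≡ᵇ n) ≡ true
≡ᵇ-refl zero = refl
≡ᵇ-refl (suc n) = ≡ᵇ-refl n

≡ᵇ⇒≡ᵗ : ∀ m n → (m ≡ᵇ n) ≡ true → m ≡ n
≡ᵇ⇒≡ᵗ m n e = ≡ᵇ⇒≡ m n (subst Data.Bool.T (sym e) _)

≢⇒≡ᵇ≡false : ∀ m n → m ≢ n → (m ≡ᵇ n) ≡ false
≢⇒≡ᵇ≡false zero zero m≢n = ⊥-elim (m≢n refl)
≢⇒≡ᵇ≡false zero (suc n) m≢n = refl
≢⇒≡ᵇ≡false (suc m) zero m≢n = refl
≢⇒≡ᵇ≡false (suc m) (suc n) m≢n = ≢⇒≡ᵇ≡false m n (m≢n ∘ cong suc)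

≡ᵇ-sym : ∀ a b → (a ≡ᵇ b) ≡ (b ≡ᵇ a)
≡ᵇ-sym zero zero = refl
≡ᵇ-sym zero (suc b) = refl
≡ᵇ-sym (suc a) zero = refl
≡ᵇ-sym (suc a) (suc b) = ≡ᵇ-sym a b

≤ᵇ⇒≤ᵗ : ∀ {a b} → (a ≤ᵇ b) ≡ true → a ≤ b
≤ᵇ⇒≤ᵗ {a} {b} e = ≤ᵇ⇒≤ a b (subst Data.Bool.T (sym e) _)

≤⇒≤ᵇᵗ : ∀ {a b} → a ≤ b → (a ≤ᵇ b) ≡ true
≤⇒≤ᵇᵗ {zero} _ = refl
≤⇒≤ᵇᵗ {suc a} {suc b} (s≤s a≤b) = <⇒<ᵇᵗ a≤b
  where
  <⇒<ᵇᵗ : ∀ {a b} → a ≤ b → (a <ᵇ suc b) ≡ true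
  <⇒<ᵇᵗ {zero} _ = refl
  <⇒<ᵇᵗ {suc a} {suc b} (s≤s p) = <⇒<ᵇᵗ p

<ᵇ-≤-false : ∀ x N → N ≤ x → (x <ᵇ N) ≡ false
<ᵇ-≤-false x zero _ = refl
<ᵇ-≤-false (suc x) (suc N) (s≤s p) = <ᵇ-≤-false x N p

+≡ᵇ≡≡ᵇ∸ : ∀ x y j → x ≤ j → ((x + y) ≡ᵇ j) ≡ (y ≡ᵇ (j ∸ x))
+≡ᵇ≡≡ᵇ∸ zero y j _ = refl
+≡ᵇ≡≡ᵇ∸ (suc x) y (suc j) (s≤s p) = +≡ᵇ≡≡ᵇ∸ x y j p

+≡ᵇ-< : ∀ x y j → j < x → ((x + y) ≡ᵇ j) ≡ false
+≡ᵇ-< (suc x) y zero _ = refl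
+≡ᵇ-< (suc x) y (suc j) (s≤s p) = +≡ᵇ-< x y j p

𝟙-∧ : ∀ a b → 𝟙 (a ∧ b) ≡ 𝟙 a * 𝟙 b
𝟙-∧ true b = sym (+-identityʳ (𝟙 b))
𝟙-∧ false b = refl

𝟙-split : ∀ b → 𝟙 b + 𝟙 (not b) ≡ 1
𝟙-split true = refl
𝟙-split false = refl

∑-upTo-𝟙≡ᵇ* : ∀ N x (H : ℕ → ℕ) → ∑ (upTo N) (λ a → 𝟙 (x ≡ᵇ a) * H a) ≡ (if x <ᵇ N then H x else 0)
∑-upTo-𝟙≡ᵇ* zero x H = refl
∑-upTo-𝟙≡ᵇ* (suc N) x H
  rewrite ∑-upTo-suc N (λ a → 𝟙 (x ≡ᵇ a) * H a) | ∑-upTo-𝟙≡ᵇ* N x H with <-cmp x N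
... | tri< x<N _ _ rewrite ≢⇒≡ᵇ≡false x N (<⇒≢ x<N)
      | ≤⇒≤ᵇᵗ x<N | ≤⇒≤ᵇᵗ (m≤n⇒m≤1+n x<N) = +-identityʳ _
... | tri≈ _ refl _ rewrite ≡ᵇ-refl x | <ᵇ-≤-false x x ≤-refl | ≤⇒≤ᵇᵗ (n<1+n x) = +-identityʳ _
... | tri> _ _ N<x rewrite ≢⇒≡ᵇ≡false x N (>⇒≢ N<x)
      | <ᵇ-≤-false x N (<⇒≤ N<x) | <ᵇ-≤-false x (suc N) N<x = refl

∑-upTo-𝟙≡ᵇ : ∀ N h → h < N → ∑ (upTo N) (λ x → 𝟙 (x ≡ᵇ h)) ≡ 1
∑-upTo-𝟙≡ᵇ N h h<N = begin
  ∑ (upTo N) (λ x → 𝟙 (x ≡ᵇ h))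
    ≡⟨ ∑-cong (upTo N) (λ x → sym (trans (*-identityʳ _) (cong 𝟙 (≡ᵇ-sym h x)))) ⟩
  ∑ (upTo N) (λ x → 𝟙 (h ≡ᵇ x) * 1)
    ≡⟨ ∑-upTo-𝟙≡ᵇ* N h (λ _ → 1) ⟩
  (if h <ᵇ N then 1 else 0)
    ≡⟨ cong (λ b → if b then 1 else 0) (≤⇒≤ᵇᵗ h<N) ⟩
  1 ∎
  where open ≡-Reasoning

≡true-ext : ∀ {a b} → (a ≡ true → b ≡ true) → (b ≡ true → a ≡ true) → a ≡ b
≡true-ext {true} a⇒b _ = sym (a⇒b refl)
≡true-ext {false} {false} _ _ = refl
≡true-ext {false} {true} _ b⇒a = b⇒a refl

eqListᵇ : List ℕ → List ℕ → Bool
eqListᵇ [] [] = true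
eqListᵇ [] (_ ∷ _) = false
eqListᵇ (_ ∷ _) [] = false
eqListᵇ (x ∷ xs) (y ∷ ys) = (x ≡ᵇ y) ∧ eqListᵇ xs ys

eqListᵇ-refl : ∀ l → eqListᵇ l l ≡ true
eqListᵇ-refl [] = refl
eqListᵇ-refl (x ∷ l) rewrite ≡ᵇ-refl x = eqListᵇ-refl l

eqListᵇ⇒≡ : ∀ l m → eqListᵇ l m ≡ true → l ≡ m
eqListᵇ⇒≡ [] [] e = refl
eqListᵇ⇒≡ (x ∷ l) (y ∷ m) e with ∧≡true {x ≡ᵇ y} e
... | e₁ , e₂ = cong₂ _∷_ (≡ᵇ⇒≡ᵗ x y e₁) (eqListᵇ⇒≡ l m e₂)

eqListᵇ-≢ : ∀ l m → l ≢ m → eqListᵇ l m ≡ false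
eqListᵇ-≢ l m l≢m with eqListᵇ l m in eq
... | true = ⊥-elim (l≢m (eqListᵇ⇒≡ l m eq))
... | false = refl

-- The range of the enumeration tuples L B, which lists each of its elements exactly once.
InBox : ℕ → ℕ → List ℕ → Set
InBox L B v = length v ≡ L × All (_≤ B) v

∑-tuples-suc : ∀ L B (F : List ℕ → ℕ) →
  ∑ (tuples (suc L) B) F ≡ ∑ (upTo (suc B)) (λ x → ∑ (tuples L B) (λ y → F (x ∷ y)))
∑-tuples-suc L B F =
  trans (∑-concatMap (λ x → map (x ∷_) (tuples L B)) (upTo (suc B)) F)
        (∑-cong (upTo (suc B)) (λ x → ∑-map (x ∷_) (tuples L B) F))

∑-tuples-+ : ∀ L₁ L₂ B (F : List ℕ → ℕ) →
  ∑ (tuples (L₁ + L₂) B) F ≡ ∑ (tuples L₁ B) (λ p → ∑ (tuples L₂ B) (λ s → F (p ++ s)))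
∑-tuples-+ zero L₂ B F = sym (+-identityʳ _)
∑-tuples-+ (suc L₁) L₂ B F =
  trans (∑-tuples-suc (L₁ + L₂) B F)
  (trans (∑-cong (upTo (suc B)) (λ x → ∑-tuples-+ L₁ L₂ B (λ v → F (x ∷ v))))
  (sym (∑-tuples-suc L₁ B (λ p → ∑ (tuples L₂ B) (λ s → F (p ++ s))))))

∑-cong-tuples : ∀ L B {F G : List ℕ → ℕ} → (∀ v → InBox L B v → F v ≡ G v) →
  ∑ (tuples L B) F ≡ ∑ (tuples L B) G
∑-cong-tuples zero B h = cong (_+ 0) (h [] (refl , []))
∑-cong-tuples (suc L) B {F} {G} h =
  trans (∑-tuples-suc L B F)
  (trans (∑-cong-upTo (suc B) (λ x x≤B
      → ∑-cong-tuples L B (λ v (lv , av) → h (x ∷ v) (cong suc lv , (≤-pred x≤B ∷ av)))))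
  (sym (∑-tuples-suc L B G)))

∑-tuples-𝟙eqListᵇ : ∀ L B v → InBox L B v → ∑ (tuples L B) (λ y → 𝟙 (eqListᵇ y v)) ≡ 1
∑-tuples-𝟙eqListᵇ zero B [] _ = refl
∑-tuples-𝟙eqListᵇ (suc L) B (h ∷ t) (lv , (h≤B ∷ t≤B)) = begin
  ∑ (tuples (suc L) B) (λ y → 𝟙 (eqListᵇ y (h ∷ t)))
    ≡⟨ ∑-tuples-suc L B _ ⟩
  ∑ (upTo (suc B)) (λ x → ∑ (tuples L B) (λ y → 𝟙 ((x ≡ᵇ h) ∧ eqListᵇ y t)))
    ≡⟨ ∑-cong (upTo (suc B)) tail ⟩
  ∑ (upTo (suc B)) (λ x → 𝟙 (x ≡ᵇ h))
    ≡⟨ ∑-upTo-𝟙≡ᵇ (suc B) h (s≤s h≤B) ⟩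
  1 ∎
  where
  open ≡-Reasoning
  tail : ∀ x → ∑ (tuples L B) (λ y → 𝟙 ((x ≡ᵇ h) ∧ eqListᵇ y t)) ≡ 𝟙 (x ≡ᵇ h)
  tail x = begin
    ∑ (tuples L B) (λ y → 𝟙 ((x ≡ᵇ h) ∧ eqListᵇ y t))
      ≡⟨ ∑-cong (tuples L B) (λ y → 𝟙-∧ (x ≡ᵇ h) (eqListᵇ y t)) ⟩
    ∑ (tuples L B) (λ y → 𝟙 (x ≡ᵇ h) * 𝟙 (eqListᵇ y t))
      ≡⟨ ∑-*ˡ (tuples L B) (𝟙 (x ≡ᵇ h)) _ ⟩
    𝟙 (x ≡ᵇ h) * ∑ (tuples L B) (λ y → 𝟙 (eqListᵇ y t))
      ≡⟨ cong (𝟙 (x ≡ᵇ h) *_) (∑-tuples-𝟙eqListᵇ L B t (suc-injective lv , t≤B)) ⟩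
    𝟙 (x ≡ᵇ h) * 1
      ≡⟨ *-identityʳ _ ⟩
    𝟙 (x ≡ᵇ h) ∎

module _ (P Q : List ℕ → Bool) (L₁ B₁ L₂ B₂ : ℕ) (f g : List ℕ → List ℕ)
  (f-ok : ∀ x → InBox L₁ B₁ x → P x ≡ true → InBox L₂ B₂ (f x) × Q (f x) ≡ true × g (f x) ≡ x)
  (g-ok : ∀ y → InBox L₂ B₂ y → Q y ≡ true → InBox L₁ B₁ (g y) × P (g y) ≡ true × f (g y) ≡ y)
  where

  private
    T₁ = tuples L₁ B₁
    T₂ = tuples L₂ B₂

    𝟙P≡∑ : ∀ x → InBox L₁ B₁ x → 𝟙 (P x) ≡ ∑ T₂ (λ y → 𝟙 (P x ∧ eqListᵇ y (f x)))
    𝟙P≡∑ x bx with P x in px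
    ... | true = sym (∑-tuples-𝟙eqListᵇ L₂ B₂ (f x) (proj₁ (f-ok x bx px)))
    ... | false = sym (∑-0 T₂)

    𝟙Q≡∑ : ∀ y → InBox L₂ B₂ y → 𝟙 (Q y) ≡ ∑ T₁ (λ x → 𝟙 (Q y ∧ eqListᵇ x (g y)))
    𝟙Q≡∑ y by with Q y in qy
    ... | true = sym (∑-tuples-𝟙eqListᵇ L₁ B₁ (g y) (proj₁ (g-ok y by qy)))
    ... | false = sym (∑-0 T₁)

    graph⇒ : ∀ x → InBox L₁ B₁ x → ∀ y → (P x ∧ eqListᵇ y (f x)) ≡ true → (Q y ∧ eqListᵇ x (g y)) ≡ true
    graph⇒ x bx y h with ∧≡true {P x} h
    ... | px , y≡fx rewrite eqListᵇ⇒≡ y (f x) y≡fx with f-ok x bx px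
    ...   | _ , Qfx , gfx rewrite Qfx | gfx = eqListᵇ-refl x

    graph⇐ : ∀ y → InBox L₂ B₂ y → ∀ x → (Q y ∧ eqListᵇ x (g y)) ≡ true → (P x ∧ eqListᵇ y (f x)) ≡ true
    graph⇐ y by x h with ∧≡true {Q y} h
    ... | qy , x≡gy rewrite eqListᵇ⇒≡ x (g y) x≡gy with g-ok y by qy
    ...   | _ , Pgy , fgy rewrite Pgy | fgy = eqListᵇ-refl y

  countB-tuples-bijection : countB P T₁ ≡ countB Q T₂
  countB-tuples-bijection = begin
    countB P T₁
      ≡⟨ countB≡∑𝟙 P T₁ ⟩
    ∑ T₁ (λ x → 𝟙 (P x))
      ≡⟨ ∑-cong-tuples L₁ B₁ 𝟙P≡∑ ⟩
    ∑ T₁ (λ x → ∑ T₂ (λ y → 𝟙 (P x ∧ eqListᵇ y (f x))))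
      ≡⟨ ∑-swap T₁ T₂ _ ⟩
    ∑ T₂ (λ y → ∑ T₁ (λ x → 𝟙 (P x ∧ eqListᵇ y (f x))))
      ≡⟨ ∑-cong-tuples L₂ B₂ (λ y by → ∑-cong-tuples L₁ B₁
          (λ x bx → cong 𝟙 (≡true-ext (graph⇒ x bx y) (graph⇐ y by x)))) ⟩
    ∑ T₂ (λ y → ∑ T₁ (λ x → 𝟙 (Q y ∧ eqListᵇ x (g y))))
      ≡⟨ ∑-cong-tuples L₂ B₂ 𝟙Q≡∑ ⟨
    ∑ T₂ (λ y → 𝟙 (Q y))
      ≡⟨ countB≡∑𝟙 Q T₂ ⟨
    countB Q T₂ ∎
    where open ≡-Reasoning

zDeg : List (ℕ × ℕ) → List ℕ → ℕ
zDeg ((a , b) ∷ ws) (t ∷ ts) = a * t + zDeg ws ts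
zDeg _ _ = 0

qDeg : List (ℕ × ℕ) → List ℕ → ℕ
qDeg ((a , b) ∷ ws) (t ∷ ts) = b * t + qDeg ws ts
qDeg _ _ = 0

IsSolution : List (ℕ × ℕ) → ℕ → ℕ → List ℕ → Bool
IsSolution ws j m t = (zDeg ws t ≡ᵇ j) ∧ (qDeg ws t ≡ᵇ m)

-- The coefficient of z^j q^m in Π_{(a,b) ∈ ws} 1/(1 - z^a q^b): exponent vectors t with
-- Σ a t = j and Σ b t = m; when every b ≥ 1 all entries of such a t are at most m.
solutionCount : List (ℕ × ℕ) → ℕ → ℕ → ℕ
solutionCount ws j m = countB (IsSolution ws j m) (tuples (length ws) m)

solutionSeries : List (ℕ × ℕ) → PSeries
solutionSeries ws j m = ℤ.+ solutionCount ws j m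

QPositive : List (ℕ × ℕ) → Set
QPositive = All (λ w → 1 ≤ proj₂ w)

QPositive-map : ∀ (L : List ℕ) (α β : ℕ → ℕ) → (∀ i → 1 ≤ β i) → QPositive (map (λ i → (α i , β i)) L)
QPositive-map [] α β h = []
QPositive-map (i ∷ L) α β h = h i ∷ QPositive-map L α β h

All≤qDeg : ∀ ws t → QPositive ws → length t ≡ length ws → All (_≤ qDeg ws t) t
All≤qDeg [] [] _ _ = []
All≤qDeg ((a , b) ∷ ws) (x ∷ t) (b≥1 ∷ pw) lt =
  ≤-trans (≤-trans (≤-reflexive (sym (*-identityˡ x))) (*-monoˡ-≤ x b≥1)) (m≤m+n (b * x) _)
  ∷ All.map (λ p → ≤-trans p (m≤n+m _ (b * x))) (All≤qDeg ws t pw (suc-injective lt))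

All-≤-weaken : ∀ {l : List ℕ} {a b} → a ≤ b → All (_≤ a) l → All (_≤ b) l
All-≤-weaken a≤b = All.map (λ p → ≤-trans p a≤b)

countB-tuples-rebound : ∀ (P : List ℕ → Bool) L B₁ B₂ →
  (∀ x → length x ≡ L → P x ≡ true → All (_≤ B₁) x × All (_≤ B₂) x) →
  countB P (tuples L B₁) ≡ countB P (tuples L B₂)
countB-tuples-rebound P L B₁ B₂ h = countB-tuples-bijection P P L B₁ L B₂ (λ x → x) (λ x → x)
  (λ x (lx , _) px → (lx , proj₂ (h x lx px)) , px , refl)
  (λ x (lx , _) px → (lx , proj₁ (h x lx px)) , px , refl)

countB-cong-tuples : ∀ L B (P Q : List ℕ → Bool) → (∀ v → InBox L B v → P v ≡ Q v) →
  countB P (tuples L B) ≡ countB Q (tuples L B)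
countB-cong-tuples L B P Q h =
  trans (countB≡∑𝟙 P (tuples L B))
  (trans (∑-cong-tuples L B (λ v bv → cong 𝟙 (h v bv))) (sym (countB≡∑𝟙 Q (tuples L B))))

countB-false : {X : Set} (p : X → Bool) (l : List X) → (∀ x → p x ≡ false) → countB p l ≡ 0
countB-false p [] h = refl
countB-false p (x ∷ l) h rewrite h x = countB-false p l h

sumℤ-++ : ∀ l₁ l₂ → sumℤ (l₁ ++ l₂) ≡ sumℤ l₁ ℤ.+ sumℤ l₂
sumℤ-++ [] l₂ = sym (ℤP.+-identityˡ _)
sumℤ-++ (x ∷ l₁) l₂ = trans (cong (λ y → x ℤ.+ y) (sumℤ-++ l₁ l₂)) (sym (ℤP.+-assoc x _ _))

sumℤ-map-+ : {A : Set} (l : List A) (F : A → ℤ) (h : A → ℕ) → (∀ x → F x ≡ ℤ.+ h x) →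
  sumℤ (map F l) ≡ ℤ.+ ∑ l h
sumℤ-map-+ [] F h e = refl
sumℤ-map-+ (x ∷ l) F h e = trans (cong₂ ℤ._+_ (e x) (sumℤ-map-+ l F h e)) (sym (ℤP.pos-+ (h x) _))

sumℤ-concatMap-+ : {A B : Set} (l₁ : List A) (l₂ : List B) (F : A → B → ℤ) (h : A → B → ℕ) →
  (∀ x y → F x y ≡ ℤ.+ h x y) → sumℤ (concatMap (λ a → map (F a) l₂) l₁) ≡ ℤ.+ ∑ l₁ (λ a → ∑ l₂ (h a))
sumℤ-concatMap-+ [] l₂ F h e = refl
sumℤ-concatMap-+ (x ∷ l₁) l₂ F h e =
  trans (sumℤ-++ (map (F x) l₂) _)
  (trans (cong₂ ℤ._+_ (sumℤ-map-+ l₂ (F x) (h x) (e x)) (sumℤ-concatMap-+ l₁ l₂ F h e))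
         (sym (ℤP.pos-+ (∑ l₂ (h x)) (∑ l₁ (λ a → ∑ l₂ (h a))))))

solutionCount-rebound : ∀ ws → QPositive ws → ∀ j m B → m ≤ B →
  solutionCount ws j m ≡ countB (IsSolution ws j m) (tuples (length ws) B)
solutionCount-rebound ws pw j m B m≤B = countB-tuples-rebound _ (length ws) m B bounds
  where
  bounds : ∀ x → length x ≡ length ws → IsSolution ws j m x ≡ true → All (_≤ m) x × All (_≤ B) x
  bounds x lx sol rewrite sym (≡ᵇ⇒≡ᵗ (qDeg ws x) m (proj₂ (∧≡true {zDeg ws x ≡ᵇ j} sol))) =
    All≤qDeg ws x pw lx , All-≤-weaken m≤B (All≤qDeg ws x pw lx)

zDeg-++ : ∀ ws₁ ws₂ p s → length p ≡ length ws₁ → zDeg (ws₁ ++ ws₂) (p ++ s) ≡ zDeg ws₁ p + zDeg ws₂ s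
zDeg-++ [] ws₂ [] s e = refl
zDeg-++ ((a , b) ∷ ws₁) ws₂ (x ∷ p) s e =
  trans (cong (a * x +_) (zDeg-++ ws₁ ws₂ p s (suc-injective e))) (sym (+-assoc (a * x) _ _))

qDeg-++ : ∀ ws₁ ws₂ p s → length p ≡ length ws₁ → qDeg (ws₁ ++ ws₂) (p ++ s) ≡ qDeg ws₁ p + qDeg ws₂ s
qDeg-++ [] ws₂ [] s e = refl
qDeg-++ ((a , b) ∷ ws₁) ws₂ (x ∷ p) s e =
  trans (cong (b * x +_) (qDeg-++ ws₁ ws₂ p s (suc-injective e))) (sym (+-assoc (b * x) _ _))

IsSolution-++ : ∀ ws₁ ws₂ j m p s → length p ≡ length ws₁ →
  IsSolution (ws₁ ++ ws₂) j m (p ++ s) ≡ (zDeg ws₁ p + zDeg ws₂ s ≡ᵇ j) ∧ (qDeg ws₁ p + qDeg ws₂ s ≡ᵇ m)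
IsSolution-++ ws₁ ws₂ j m p s lp =
  cong₂ (λ u v → (u ≡ᵇ j) ∧ (v ≡ᵇ m)) (zDeg-++ ws₁ ws₂ p s lp) (qDeg-++ ws₁ ws₂ p s lp)

module _ (ws₁ ws₂ : List (ℕ × ℕ)) (pw₁ : QPositive ws₁) (pw₂ : QPositive ws₂) (j m : ℕ) where

  private
    T₁ = tuples (length ws₁) m
    T₂ = tuples (length ws₂) m

    restCount : ℕ → ℕ → ℕ
    restCount a b = ∑ T₂ (λ s → 𝟙 (IsSolution ws₂ (j ∸ a) (m ∸ b) s))

    restCount-at : List ℕ → ℕ
    restCount-at p =
      if zDeg ws₁ p <ᵇ suc j then (if qDeg ws₁ p <ᵇ suc m then restCount (zDeg ws₁ p) (qDeg ws₁ p) else 0) else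
          0

    -- In the convolution only the degree (a, b) of the first factor's vector p survives.
    convolution-collapse : ∀ p →
      ∑ (upTo (suc j)) (λ a → ∑ (upTo (suc m))
          (λ b → 𝟙 (zDeg ws₁ p ≡ᵇ a) * 𝟙 (qDeg ws₁ p ≡ᵇ b) * restCount a b))
      ≡ restCount-at p
    convolution-collapse p =
      trans (∑-cong (upTo (suc j)) (λ a →
        trans (∑-cong (upTo (suc m)) (λ b
            → *-assoc (𝟙 (zDeg ws₁ p ≡ᵇ a)) (𝟙 (qDeg ws₁ p ≡ᵇ b)) (restCount a b)))
        (trans (∑-*ˡ (upTo (suc m)) (𝟙 (zDeg ws₁ p ≡ᵇ a)) (λ b → 𝟙 (qDeg ws₁ p ≡ᵇ b) * restCount a b))
               (cong (𝟙 (zDeg ws₁ p ≡ᵇ a) *_) (∑-upTo-𝟙≡ᵇ* (suc m) (qDeg ws₁ p) (restCount a))))))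
      (∑-upTo-𝟙≡ᵇ* (suc j) (zDeg ws₁ p) (λ a → if qDeg ws₁ p <ᵇ suc m then restCount a (qDeg ws₁ p) else 0))

    restCount-at≡ : ∀ p → InBox (length ws₁) m p →
      restCount-at p ≡ ∑ T₂ (λ s → 𝟙 (IsSolution (ws₁ ++ ws₂) j m (p ++ s)))
    restCount-at≡ p (lp , _) with zDeg ws₁ p ℕ.≤? j | qDeg ws₁ p ℕ.≤? m
    ... | yes a≤j | yes b≤m rewrite ≤⇒≤ᵇᵗ (s≤s a≤j) | ≤⇒≤ᵇᵗ (s≤s b≤m) =
      ∑-cong T₂ (λ s → cong 𝟙 (sym (trans (IsSolution-++ ws₁ ws₂ j m p s lp)
        (cong₂ _∧_ (+≡ᵇ≡≡ᵇ∸ (zDeg ws₁ p) (zDeg ws₂ s) j a≤j) (+≡ᵇ≡≡ᵇ∸ (qDeg ws₁ p) (qDeg ws₂ s) m b≤m)))))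
    ... | no a≰j | _ rewrite <ᵇ-≤-false (zDeg ws₁ p) (suc j) (≰⇒> a≰j) =
      sym (trans (∑-cong T₂ (λ s → cong 𝟙 (trans (IsSolution-++ ws₁ ws₂ j m p s lp)
        (cong (_∧ (qDeg ws₁ p + qDeg ws₂ s ≡ᵇ m)) (+≡ᵇ-< (zDeg ws₁ p) (zDeg ws₂ s) j (≰⇒> a≰j)))))) (∑-0 T₂))
    ... | yes a≤j | no b≰m rewrite ≤⇒≤ᵇᵗ (s≤s a≤j) | <ᵇ-≤-false (qDeg ws₁ p) (suc m) (≰⇒> b≰m) =
      sym (trans (∑-cong T₂ (λ s → cong 𝟙 (trans (IsSolution-++ ws₁ ws₂ j m p s lp)
        (trans (cong ((zDeg ws₁ p + zDeg ws₂ s ≡ᵇ j) ∧_) (+≡ᵇ-< (qDeg ws₁ p) (qDeg ws₂ s) m (≰⇒> b≰m)))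
            (∧-zeroʳ _))))) (∑-0 T₂))

  solutionSeries-*P : (solutionSeries ws₁ *P solutionSeries ws₂) j m ≡ solutionSeries (ws₁ ++ ws₂) j m
  solutionSeries-*P =
    trans (sumℤ-concatMap-+ (upTo (suc j)) (upTo (suc m)) _
        (λ a b → solutionCount ws₁ a b * solutionCount ws₂ (j ∸ a) (m ∸ b))
                            (λ a b → sym (ℤP.pos-* (solutionCount ws₁ a b)
                                (solutionCount ws₂ (j ∸ a) (m ∸ b)))))
          (cong ℤ.+_ convolution)
    where
    open ≡-Reasoning
    Δ : List ℕ → ℕ → ℕ → ℕ
    Δ p a b = 𝟙 (zDeg ws₁ p ≡ᵇ a) * 𝟙 (qDeg ws₁ p ≡ᵇ b)
    first : ∀ a b → b ≤ m → solutionCount ws₁ a b ≡ ∑ T₁ (λ p → Δ p a b)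
    first a b b≤m = trans (solutionCount-rebound ws₁ pw₁ a b m b≤m)
                          (trans (countB≡∑𝟙 _ T₁) (∑-cong T₁ (λ p → 𝟙-∧ (zDeg ws₁ p ≡ᵇ a) (qDeg ws₁ p ≡ᵇ b))))
    second : ∀ a b → solutionCount ws₂ (j ∸ a) (m ∸ b) ≡ restCount a b
    second a b = trans (solutionCount-rebound ws₂ pw₂ (j ∸ a) (m ∸ b) m (m∸n≤m m b)) (countB≡∑𝟙 _ T₂)
    convolution : ∑ (upTo (suc j)) (λ a
        → ∑ (upTo (suc m)) (λ b → solutionCount ws₁ a b * solutionCount ws₂ (j ∸ a) (m ∸ b)))
                ≡ solutionCount (ws₁ ++ ws₂) j m
    convolution = begin
      ∑ (upTo (suc j)) (λ a → ∑ (upTo (suc m))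
          (λ b → solutionCount ws₁ a b * solutionCount ws₂ (j ∸ a) (m ∸ b)))
        ≡⟨ ∑-cong (upTo (suc j)) (λ a
            → ∑-cong-upTo (suc m) (λ b b≤m → cong₂ _*_ (first a b (≤-pred b≤m)) (second a b))) ⟩
      ∑ (upTo (suc j)) (λ a → ∑ (upTo (suc m)) (λ b → ∑ T₁ (λ p → Δ p a b) * restCount a b))
        ≡⟨ ∑-cong (upTo (suc j)) (λ a
            → ∑-cong (upTo (suc m)) (λ b → sym (∑-*ʳ T₁ (restCount a b) (λ p → Δ p a b)))) ⟩
      ∑ (upTo (suc j)) (λ a → ∑ (upTo (suc m)) (λ b → ∑ T₁ (λ p → Δ p a b * restCount a b)))
        ≡⟨ ∑-cong (upTo (suc j)) (λ a → ∑-swap (upTo (suc m)) T₁ _) ⟩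
      ∑ (upTo (suc j)) (λ a → ∑ T₁ (λ p → ∑ (upTo (suc m)) (λ b → Δ p a b * restCount a b)))
        ≡⟨ ∑-swap (upTo (suc j)) T₁ _ ⟩
      ∑ T₁ (λ p → ∑ (upTo (suc j)) (λ a → ∑ (upTo (suc m)) (λ b → Δ p a b * restCount a b)))
        ≡⟨ ∑-cong T₁ convolution-collapse ⟩
      ∑ T₁ restCount-at
        ≡⟨ ∑-cong-tuples (length ws₁) m restCount-at≡ ⟩
      ∑ T₁ (λ p → ∑ T₂ (λ s → 𝟙 (IsSolution (ws₁ ++ ws₂) j m (p ++ s))))
        ≡⟨ ∑-tuples-+ (length ws₁) (length ws₂) m _ ⟨
      ∑ (tuples (length ws₁ + length ws₂) m) (λ t → 𝟙 (IsSolution (ws₁ ++ ws₂) j m t))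
        ≡⟨ cong (λ L → ∑ (tuples L m) (λ t → 𝟙 (IsSolution (ws₁ ++ ws₂) j m t))) (List.length-++ ws₁) ⟨
      ∑ (tuples (length (ws₁ ++ ws₂)) m) (λ t → 𝟙 (IsSolution (ws₁ ++ ws₂) j m t))
        ≡⟨ countB≡∑𝟙 (IsSolution (ws₁ ++ ws₂) j m) (tuples (length (ws₁ ++ ws₂)) m) ⟨
      solutionCount (ws₁ ++ ws₂) j m ∎

geom≡solutionSeries : ∀ a b j m → geom a b j m ≡ solutionSeries [ (a , b) ] j m
geom≡solutionSeries a b j m = cong ℤ.+_ (begin
  countB (λ t → (j ≡ᵇ a * t) ∧ (m ≡ᵇ b * t)) (upTo (suc m))
    ≡⟨ countB≡∑𝟙 _ (upTo (suc m)) ⟩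
  ∑ (upTo (suc m)) (λ t → 𝟙 ((j ≡ᵇ a * t) ∧ (m ≡ᵇ b * t)))
    ≡⟨ ∑-cong (upTo (suc m)) (λ t → trans (cong 𝟙 (cong₂ _∧_ (flip j (a * t)) (flip m (b * t))))
        (sym (+-identityʳ _))) ⟩
  ∑ (upTo (suc m)) (λ t → ∑ (tuples 0 m) (λ ts → 𝟙 (IsSolution [ (a , b) ] j m (t ∷ ts))))
    ≡⟨ ∑-tuples-suc 0 m (λ t → 𝟙 (IsSolution [ (a , b) ] j m t)) ⟨
  ∑ (tuples 1 m) (λ t → 𝟙 (IsSolution [ (a , b) ] j m t))
    ≡⟨ countB≡∑𝟙 _ (tuples 1 m) ⟨
  solutionCount [ (a , b) ] j m ∎)
  where
  open ≡-Reasoning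
  flip : ∀ k x → (k ≡ᵇ x) ≡ (x + 0 ≡ᵇ k)
  flip k x = trans (≡ᵇ-sym k x) (cong (_≡ᵇ k) (sym (+-identityʳ x)))

oneP≡solutionSeries : ∀ j m → oneP j m ≡ solutionSeries [] j m
oneP≡solutionSeries zero zero = refl
oneP≡solutionSeries zero (suc m) = refl
oneP≡solutionSeries (suc j) zero = refl
oneP≡solutionSeries (suc j) (suc m) = refl

*P-cong : ∀ {f f' g g' : PSeries} → (∀ j m → f j m ≡ f' j m) → (∀ j m → g j m ≡ g' j m) →
  ∀ j m → (f *P g) j m ≡ (f' *P g') j m
*P-cong ef eg j m = cong sumℤ (List.concatMap-cong
  (λ a → List.map-cong (λ b → cong₂ ℤ._*_ (ef a b) (eg (j ∸ a) (m ∸ b))) (upTo (suc m))) (upTo (suc j)))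

prodP-geom≡solutionSeries : ∀ (L : List ℕ) (α β : ℕ → ℕ) → (∀ i → 1 ≤ β i) → ∀ j m →
  prodP (map (λ i → geom (α i) (β i)) L) j m ≡ solutionSeries (map (λ i → (α i , β i)) L) j m
prodP-geom≡solutionSeries [] α β β≥1 j m = oneP≡solutionSeries j m
prodP-geom≡solutionSeries (i ∷ L) α β β≥1 j m =
  trans (*P-cong (geom≡solutionSeries (α i) (β i)) (prodP-geom≡solutionSeries L α β β≥1) j m)
        (solutionSeries-*P [ (α i , β i) ] (map (λ i → (α i , β i)) L) (β≥1 i ∷ []) (QPositive-map L α β β≥1) j
            m)

pochZWeights : ℕ → List (ℕ × ℕ)
pochZWeights n = map (λ i → (1 , 3 * i + 1)) (upTo (suc n))

pochQWeights : ℕ → List (ℕ × ℕ)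
pochQWeights n = map (λ i → (0 , 3 * i + 3)) (upTo n)

pochWeights : ℕ → List (ℕ × ℕ)
pochWeights n = pochZWeights n ++ pochQWeights n

QPositive-pochWeights : ∀ n → QPositive (pochWeights n)
QPositive-pochWeights n =
  All.++⁺ (QPositive-map (upTo (suc n)) (λ _ → 1) (λ i → 3 * i + 1) (λ i → m≤n+m 1 (3 * i)))
          (QPositive-map (upTo n) (λ _ → 0) (λ i → 3 * i + 3) (λ i → ≤-trans (s≤s z≤n) (m≤n+m 3 (3 * i))))

pochSeries≡solutionSeries : ∀ n j m → (invPochZ n *P invPochQ n) j m ≡ solutionSeries (pochWeights n) j m
pochSeries≡solutionSeries n j m =
  trans (*P-cong (prodP-geom≡solutionSeries (upTo (suc n)) (λ _ → 1) (λ i → 3 * i + 1) (λ i → m≤n+m 1 (3 * i)))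
                 (prodP-geom≡solutionSeries (upTo n) (λ _ → 0) (λ i → 3 * i + 3)
                     (λ i → ≤-trans (s≤s z≤n) (m≤n+m 3 (3 * i)))) j m)
        (solutionSeries-*P (pochZWeights n) (pochQWeights n)
            (All.++⁻ˡ (pochZWeights n) (QPositive-pochWeights n))
                           (All.++⁻ʳ (pochZWeights n) (QPositive-pochWeights n)) j m)

ℕ≡ᵇℤ : ℕ → ℤ → Bool
ℕ≡ᵇℤ a (ℤ.+ j) = a ≡ᵇ j
ℕ≡ᵇℤ a -[1+ j ] = false

⌊≟⌋≡ℕ≡ᵇℤ : ∀ a j → ⌊ ℤ.+ a ℤP.≟ j ⌋ ≡ ℕ≡ᵇℤ a j
⌊≟⌋≡ℕ≡ᵇℤ a -[1+ j ] = refl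
⌊≟⌋≡ℕ≡ᵇℤ a (ℤ.+ j) with ℤ.+ a ℤP.≟ ℤ.+ j
... | yes a≡j rewrite ℤP.+-injective a≡j = sym (≡ᵇ-refl j)
... | no a≢j = sym (≢⇒≡ᵇ≡false a j (λ e → a≢j (cong ℤ.+_ e)))

IsShiftedSolution : List (ℕ × ℕ) → ℕ → ℕ → ℤ → ℕ → List ℕ → Bool
IsShiftedSolution ws A B j m t = ℕ≡ᵇℤ (zDeg ws t + A) j ∧ (qDeg ws t + B ≡ᵇ m)

-- The coefficient of z^j q^m in z^A q^B Π 1/(1 - z^a q^b).
shiftedCount : List (ℕ × ℕ) → ℕ → ℕ → ℤ → ℤ → ℕ
shiftedCount ws A B j (ℤ.+ m) = countB (IsShiftedSolution ws A B j m) (tuples (length ws) m)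
shiftedCount ws A B j -[1+ m ] = 0

+≡ᵇ≡false : ∀ x A m → m < A → (x + A ≡ᵇ m) ≡ false
+≡ᵇ≡false x A m m<A = ≢⇒≡ᵇ≡false (x + A) m (>⇒≢ (<-≤-trans m<A (m≤n+m A x)))

-[1+]-ℤ- : ∀ m B → Σ ℕ (λ k → -[1+ m ] ℤ.- ℤ.+ B ≡ -[1+ k ])
-[1+]-ℤ- m zero = m , refl
-[1+]-ℤ- m (suc B) = suc (m + B) , refl

extP-negativeʳ : ∀ (f : PSeries) x k → extP f x -[1+ k ] ≡ ℤ.+ 0
extP-negativeʳ f (ℤ.+ x) k = refl
extP-negativeʳ f -[1+ x ] k = refl

ℤ-≤-+ : ∀ m B → m < B → Σ ℕ (λ k → ℤ.+ m ℤ.- ℤ.+ B ≡ -[1+ k ])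
ℤ-≤-+ m B m<B = B ∸ m ∸ 1 , trans (ℤP.m-n≡m⊖n m B) (trans (ℤP.⊖-< m<B) (cong ℤ.-_ (cong ℤ.+_ (pred-∸ m<B))))
  where
  pred-∸ : ∀ {m B} → m < B → B ∸ m ≡ suc (B ∸ m ∸ 1)
  pred-∸ {zero} {suc B} _ = refl
  pred-∸ {suc m} {suc B} (s≤s p) = pred-∸ p

extP-solutionSeries-shift : ∀ ws → QPositive ws → ∀ A B j m →
  extP (solutionSeries ws) (j ℤ.- ℤ.+ A) (m ℤ.- ℤ.+ B) ≡ ℤ.+ shiftedCount ws A B j m
extP-solutionSeries-shift ws pw A B j -[1+ m ] with -[1+]-ℤ- m B
... | k , e rewrite e = extP-negativeʳ (solutionSeries ws) (j ℤ.- ℤ.+ A) k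
extP-solutionSeries-shift ws pw A B j (ℤ.+ m) with B ℕ.≤? m
... | no B≰m with ℤ-≤-+ m B (≰⇒> B≰m)
...   | k , e rewrite e = trans (extP-negativeʳ (solutionSeries ws) (j ℤ.- ℤ.+ A) k) (sym (cong ℤ.+_
          (countB-false _ (tuples (length ws) m)
            (λ t → trans (cong (ℕ≡ᵇℤ (zDeg ws t + A) j ∧_) (+≡ᵇ≡false (qDeg ws t) B m (≰⇒> B≰m)))
                (∧-zeroʳ _)))))
extP-solutionSeries-shift ws pw A B (ℤ.+ j) (ℤ.+ m) | yes B≤m with A ℕ.≤? j
... | no A≰j with ℤ-≤-+ j A (≰⇒> A≰j)
...   | k , e rewrite e = sym (cong ℤ.+_ (countB-false _ (tuples (length ws) m)
          (λ t → cong (_∧ (qDeg ws t + B ≡ᵇ m)) (+≡ᵇ≡false (zDeg ws t) A j (≰⇒> A≰j)))))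
extP-solutionSeries-shift ws pw A B (ℤ.+ j) (ℤ.+ m) | yes B≤m | yes A≤j
  rewrite ℤP.m-n≡m⊖n m B | ℤP.⊖-≥ B≤m | ℤP.m-n≡m⊖n j A | ℤP.⊖-≥ A≤j = cong ℤ.+_ (trans
    (solutionCount-rebound ws pw (j ∸ A) (m ∸ B) m (m∸n≤m m B))
    (countB-cong-tuples (length ws) m _ _ (λ t _ → cong₂ _∧_
      (sym (trans (cong (_≡ᵇ j) (+-comm (zDeg ws t) A)) (+≡ᵇ≡≡ᵇ∸ A (zDeg ws t) j A≤j)))
      (sym (trans (cong (_≡ᵇ m) (+-comm (qDeg ws t) B)) (+≡ᵇ≡≡ᵇ∸ B (qDeg ws t) m B≤m))))))
extP-solutionSeries-shift ws pw A B -[1+ j ] (ℤ.+ m) | yes B≤m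
  rewrite ℤP.m-n≡m⊖n m B | ℤP.⊖-≥ B≤m with -[1+]-ℤ- j A
... | k , e rewrite e = sym (cong ℤ.+_ (countB-false _ (tuples (length ws) m) (λ t → refl)))

extP-solutionSeries-at : ∀ ws → QPositive ws → ∀ A B j m {x y} → x ≡ j ℤ.- ℤ.+ A → y ≡ m ℤ.- ℤ.+ B →
  extP (solutionSeries ws) x y ≡ ℤ.+ shiftedCount ws A B j m
extP-solutionSeries-at ws pw A B j m refl refl = extP-solutionSeries-shift ws pw A B j m

extP-cong : ∀ {F G : PSeries} → (∀ a b → F a b ≡ G a b) → ∀ x y → extP F x y ≡ extP G x y
extP-cong e (ℤ.+ x) (ℤ.+ y) = e x y
extP-cong e (ℤ.+ x) -[1+ y ] = refl
extP-cong e -[1+ x ] y = refl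

mulPL-cong : ∀ {F G : PSeries} → (∀ a b → F a b ≡ G a b) → ∀ p j m → mulPL F p j m ≡ mulPL G p j m
mulPL-cong e [] j m = refl
mulPL-cong e ((c , a , b) ∷ p) j m =
  cong₂ ℤ._+_ (cong (c ℤ.*_) (extP-cong e (j ℤ.- a) (m ℤ.- b))) (mulPL-cong e p j m)

mulPL-++ : ∀ F p r j m → mulPL F (p ++ r) j m ≡ mulPL F p j m ℤ.+ mulPL F r j m
mulPL-++ F [] r j m = sym (ℤP.+-identityˡ _)
mulPL-++ F ((c , a , b) ∷ p) r j m =
  trans (cong (λ z → c ℤ.* extP F (j ℤ.- a) (m ℤ.- b) ℤ.+ z) (mulPL-++ F p r j m))
        (sym (ℤP.+-assoc (c ℤ.* extP F (j ℤ.- a) (m ℤ.- b)) (mulPL F p j m) (mulPL F r j m)))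

mulPL-monomial-*L : ∀ F A B r j m → mulPL F (mono (ℤ.+ 1) A B *L r) j m ≡ mulPL F r (j ℤ.- A) (m ℤ.- B)
mulPL-monomial-*L F A B [] j m = refl
mulPL-monomial-*L F A B ((c , a , b) ∷ r) j m =
  cong₂ ℤ._+_ (cong₂ ℤ._*_ (ℤP.*-identityˡ c) (cong₂ (extP F) (sub-+ j A a) (sub-+ m B b)))
              (mulPL-monomial-*L F A B r j m)
  where
  sub-+ : ∀ (j A a : ℤ) → j ℤ.- (A ℤ.+ a) ≡ (j ℤ.- A) ℤ.- a
  sub-+ = ℤSolver.solve-∀

mulPL-sumL : ∀ F ls j m → mulPL F (sumL ls) j m ≡ sumℤ (map (λ p → mulPL F p j m) ls)
mulPL-sumL F [] j m = refl
mulPL-sumL F (p ∷ ls) j m =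
  trans (mulPL-++ F p (sumL ls) j m) (cong (λ z → mulPL F p j m ℤ.+ z) (mulPL-sumL F ls j m))

mulPL-sumL-map : ∀ F (h : ℕ → LPoly) ks j m
    → mulPL F (sumL (map h ks)) j m ≡ sumℤ (map (λ k → mulPL F (h k) j m) ks)
mulPL-sumL-map F h ks j m = trans (mulPL-sumL F (map h ks) j m) (cong sumℤ (sym (List.map-∘ ks)))

adjacentSummand : ℕ → LPoly
adjacentSummand k =
  mono (ℤ.+ 1) (ℤ.- ℤ.+ 2) (ℤ.- ℤ.+ (3 * k + 1))
  +L ((mono (ℤ.+ 1) (ℤ.+ 0) (ℤ.+ 0) +L mono (ℤ.- ℤ.+ 1) (ℤ.+ 0) (ℤ.+ (3 * k))) *L mono (ℤ.+ 1) (ℤ.- ℤ.+ 1)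
      (ℤ.- ℤ.+ (3 * k)))

separatedSummand : ℕ → ℕ → LPoly
separatedSummand d k = mono (ℤ.+ 1) (ℤ.- ℤ.+ 2) (ℤ.- ℤ.+ (6 * k + 3 * d + 1))

gExponent : ℕ → ℕ
gExponent n = 3 * n * n + 4 * n + 1

coeffG : ℕ → LPoly → ℤ → ℤ → ℤ
coeffG n p j m = mulPL (invPochZ n *P invPochQ n) p (j ℤ.- ℤ.+ suc n) (m ℤ.- ℤ.+ gExponent n)

rhsSeries-split : ∀ n j m → rhsSeries n j m ≡
  sumℤ (map (λ k → coeffG n (adjacentSummand k) j m) (oneTo (n ∸ 1)))
  ℤ.+ sumℤ (map (λ d → sumℤ (map (λ k → coeffG n (separatedSummand d k) j m) (oneTo (n ∸ d ∸ 1))))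
      (oneTo (n ∸ 2)))
rhsSeries-split n j m = begin
  rhsSeries n j m
    ≡⟨ mulPL-monomial-*L F (ℤ.+ suc n) (ℤ.+ gExponent n) (bracket n) j m ⟩
  mulPL F (bracket n) j′ m′
    ≡⟨ mulPL-++ F (sumL (map adjacentSummand (oneTo (n ∸ 1)))) _ j′ m′ ⟩
  mulPL F (sumL (map adjacentSummand (oneTo (n ∸ 1)))) j′ m′
      ℤ.+ mulPL F (sumL (map separated (oneTo (n ∸ 2)))) j′ m′
    ≡⟨ cong₂ ℤ._+_ (mulPL-sumL-map F adjacentSummand (oneTo (n ∸ 1)) j′ m′)
                   (trans (mulPL-sumL-map F separated (oneTo (n ∸ 2)) j′ m′)
                          (cong sumℤ (List.map-cong
                              (λ d → mulPL-sumL-map F (separatedSummand d) (oneTo (n ∸ d ∸ 1)) j′ m′)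
                              (oneTo (n ∸ 2))))) ⟩
  sumℤ (map (λ k → coeffG n (adjacentSummand k) j m) (oneTo (n ∸ 1)))
  ℤ.+ sumℤ (map (λ d → sumℤ (map (λ k → coeffG n (separatedSummand d k) j m) (oneTo (n ∸ d ∸ 1))))
      (oneTo (n ∸ 2))) ∎
  where
  open ≡-Reasoning
  F = invPochZ n *P invPochQ n
  j′ = j ℤ.- ℤ.+ suc n
  m′ = m ℤ.- ℤ.+ gExponent n
  separated : ℕ → LPoly
  separated d = sumL (map (separatedSummand d) (oneTo (n ∸ d ∸ 1)))

adjacentSummand-coeff : ∀ n k j m B₁ B₂ → gExponent (suc n) ≡ B₁ + (3 * k + 1) → gExponent (suc n) ≡ B₂ + 3 * k
    →
  coeffG (suc n) (adjacentSummand k) j m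
  ≡ ℤ.+ shiftedCount (pochWeights (suc n)) n B₁ j m
    ℤ.+ (ℤ.+ shiftedCount (pochWeights (suc n)) (suc n) B₂ j m
         ℤ.- ℤ.+ shiftedCount (pochWeights (suc n)) (suc n) (gExponent (suc n)) j m)
adjacentSummand-coeff n k j m B₁ B₂ e₁ e₂ =
  trans (mulPL-cong (pochSeries≡solutionSeries (suc n)) (adjacentSummand k) j′ m′)
  (trans (expand X₁ X₂ X₃)
  (cong₂ ℤ._+_ (at n B₁ (cancel j (ℤ.+ n) (ℤ.+ 2))
      (trans (cong (λ E → (m ℤ.- ℤ.+ E) ℤ.- (ℤ.- ℤ.+ (3 * k + 1))) e₁) (cancel′ m (ℤ.+ B₁) (ℤ.+ (3 * k + 1)))))
    (cong₂ ℤ._-_ (at (suc n) B₂ (cancel₀ j (ℤ.+ suc n) (ℤ.+ 1))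
        (trans (cong (λ E → (m ℤ.- ℤ.+ E) ℤ.- (ℤ.+ 0 ℤ.+ ℤ.- ℤ.+ (3 * k))) e₂)
        (cancel₀′ m (ℤ.+ B₂) (ℤ.+ (3 * k)))))
                 (at (suc n) (gExponent (suc n)) (cancel₀ j (ℤ.+ suc n) (ℤ.+ 1))
                     (zero-shift m′ (ℤ.+ (3 * k)))))))
  where
  ws = pochWeights (suc n)
  j′ = j ℤ.- ℤ.+ suc (suc n)
  m′ = m ℤ.- ℤ.+ gExponent (suc n)
  X₁ = extP (solutionSeries ws) (j′ ℤ.- (ℤ.- ℤ.+ 2)) (m′ ℤ.- (ℤ.- ℤ.+ (3 * k + 1)))
  X₂ = extP (solutionSeries ws) (j′ ℤ.- (ℤ.+ 0 ℤ.+ ℤ.- ℤ.+ 1)) (m′ ℤ.- (ℤ.+ 0 ℤ.+ ℤ.- ℤ.+ (3 * k)))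
  X₃ = extP (solutionSeries ws) (j′ ℤ.- (ℤ.+ 0 ℤ.+ ℤ.- ℤ.+ 1)) (m′ ℤ.- (ℤ.+ (3 * k) ℤ.+ ℤ.- ℤ.+ (3 * k)))
  at : ∀ A B {x y} → x ≡ j ℤ.- ℤ.+ A → y ≡ m ℤ.- ℤ.+ B
      → extP (solutionSeries ws) x y ≡ ℤ.+ shiftedCount ws A B j m
  at A B = extP-solutionSeries-at ws (QPositive-pochWeights (suc n)) A B j m
  expand : ∀ (a b c : ℤ) → ℤ.+ 1 ℤ.* a ℤ.+ ((ℤ.+ 1 ℤ.* ℤ.+ 1) ℤ.* b ℤ.+ ((ℤ.- ℤ.+ 1 ℤ.* ℤ.+ 1) ℤ.* c ℤ.+ ℤ.+ 0))
      ≡ a ℤ.+ (b ℤ.- c)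
  expand = ℤSolver.solve-∀
  cancel : ∀ (j a c : ℤ) → (j ℤ.- (c ℤ.+ a)) ℤ.- (ℤ.- c) ≡ j ℤ.- a
  cancel = ℤSolver.solve-∀
  cancel′ : ∀ (j a c : ℤ) → (j ℤ.- (a ℤ.+ c)) ℤ.- (ℤ.- c) ≡ j ℤ.- a
  cancel′ = ℤSolver.solve-∀
  cancel₀ : ∀ (j a c : ℤ) → (j ℤ.- (c ℤ.+ a)) ℤ.- (ℤ.+ 0 ℤ.+ ℤ.- c) ≡ j ℤ.- a
  cancel₀ = ℤSolver.solve-∀
  cancel₀′ : ∀ (j a c : ℤ) → (j ℤ.- (a ℤ.+ c)) ℤ.- (ℤ.+ 0 ℤ.+ ℤ.- c) ≡ j ℤ.- a
  cancel₀′ = ℤSolver.solve-∀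
  zero-shift : ∀ (x c : ℤ) → x ℤ.- (c ℤ.+ ℤ.- c) ≡ x
  zero-shift = ℤSolver.solve-∀

separatedSummand-coeff : ∀ n d k j m B → gExponent (suc n) ≡ B + (6 * k + 3 * d + 1) →
  coeffG (suc n) (separatedSummand d k) j m ≡ ℤ.+ shiftedCount (pochWeights (suc n)) n B j m
separatedSummand-coeff n d k j m B e =
  trans (mulPL-cong (pochSeries≡solutionSeries (suc n)) (separatedSummand d k) j′ m′)
  (trans (one-term _)
         (extP-solutionSeries-at (pochWeights (suc n)) (QPositive-pochWeights (suc n)) n B j m
             (cancel j (ℤ.+ n) (ℤ.+ 2))
           (trans (cong (λ E → (m ℤ.- ℤ.+ E) ℤ.- (ℤ.- ℤ.+ (6 * k + 3 * d + 1))) e)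
               (cancel′ m (ℤ.+ B) (ℤ.+ (6 * k + 3 * d + 1))))))
  where
  j′ = j ℤ.- ℤ.+ suc (suc n)
  m′ = m ℤ.- ℤ.+ gExponent (suc n)
  one-term : ∀ (a : ℤ) → ℤ.+ 1 ℤ.* a ℤ.+ ℤ.+ 0 ≡ a
  one-term = ℤSolver.solve-∀
  cancel : ∀ (j a c : ℤ) → (j ℤ.- (c ℤ.+ a)) ℤ.- (ℤ.- c) ≡ j ℤ.- a
  cancel = ℤSolver.solve-∀
  cancel′ : ∀ (j a c : ℤ) → (j ℤ.- (a ℤ.+ c)) ℤ.- (ℤ.- c) ≡ j ℤ.- a
  cancel′ = ℤSolver.solve-∀

-- A partition λ₁ ≥ … ≥ λ_r is encoded by its differences d_i = λ_i - λ_{i+1} (λ_{r+1} = 0).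
fromDiffs : List ℕ → List ℕ
fromDiffs [] = []
fromDiffs (d ∷ l) = (d + sumℕ l) ∷ fromDiffs l

toDiffs : List ℕ → List ℕ
toDiffs [] = []
toDiffs (a ∷ []) = a ∷ []
toDiffs (a ∷ b ∷ l) = (a ∸ b) ∷ toDiffs (b ∷ l)

lastPositive : List ℕ → Bool
lastPositive [] = true
lastPositive (x ∷ []) = 1 ≤ᵇ x
lastPositive (x ∷ y ∷ l) = lastPositive (y ∷ l)

weightFrom : ℕ → List ℕ → ℕ
weightFrom o [] = 0
weightFrom o (x ∷ l) = o * x + weightFrom (suc o) l

weight : List ℕ → ℕ
weight = weightFrom 1

Σ₁ᵈ : List ℕ → ℕ
Σ₁ᵈ (x ∷ y ∷ w ∷ l) = x + Σ₁ᵈ l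
Σ₁ᵈ (x ∷ y ∷ []) = x
Σ₁ᵈ (x ∷ []) = x
Σ₁ᵈ [] = 0

Σ₂ᵈ : List ℕ → ℕ
Σ₂ᵈ (x ∷ y ∷ w ∷ l) = y + Σ₂ᵈ l
Σ₂ᵈ (x ∷ y ∷ []) = y
Σ₂ᵈ (x ∷ []) = 0
Σ₂ᵈ [] = 0

onesᵈ : List ℕ → ℕ
onesᵈ (x ∷ y ∷ w ∷ l) = if y ≡ᵇ 1 then suc (onesᵈ l) else onesᵈ l
onesᵈ (x ∷ y ∷ []) = if y ≡ᵇ 1 then 1 else 0
onesᵈ (x ∷ []) = 0
onesᵈ [] = 0

noTwoZeros : List ℕ → Bool
noTwoZeros (x ∷ y ∷ z ∷ l) = not ((x ≡ᵇ 0) ∧ (y ≡ᵇ 0)) ∧ noTwoZeros (y ∷ z ∷ l)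
noTwoZeros _ = true

noThreeEqual : List ℕ → Bool
noThreeEqual (x ∷ y ∷ z ∷ l) = not ((x ≡ᵇ y) ∧ (y ≡ᵇ z)) ∧ noThreeEqual (y ∷ z ∷ l)
noThreeEqual _ = true

length-fromDiffs : ∀ d → length (fromDiffs d) ≡ length d
length-fromDiffs [] = refl
length-fromDiffs (x ∷ d) = cong suc (length-fromDiffs d)

length-toDiffs : ∀ l → length (toDiffs l) ≡ length l
length-toDiffs [] = refl
length-toDiffs (a ∷ []) = refl
length-toDiffs (a ∷ b ∷ l) = cong suc (length-toDiffs (b ∷ l))

toDiffs-fromDiffs : ∀ d → toDiffs (fromDiffs d) ≡ d
toDiffs-fromDiffs [] = refl
toDiffs-fromDiffs (x ∷ []) = cong [_] (+-identityʳ x)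
toDiffs-fromDiffs (x ∷ y ∷ l) = cong₂ _∷_ (m+n∸n≡m x (y + sumℕ l)) (toDiffs-fromDiffs (y ∷ l))

nonincreasing-head : ∀ a b l → nonincreasing (a ∷ b ∷ l) ≡ true → b ≤ a
nonincreasing-head a b l e = ≤ᵇ⇒≤ᵗ (proj₁ (∧≡true {b ≤ᵇ a} e))

nonincreasing-tail : ∀ a t → nonincreasing (a ∷ t) ≡ true → nonincreasing t ≡ true
nonincreasing-tail a [] e = refl
nonincreasing-tail a (b ∷ t) e = proj₂ (∧≡true {b ≤ᵇ a} e)

sum-toDiffs : ∀ b l → nonincreasing (b ∷ l) ≡ true → sumℕ (toDiffs (b ∷ l)) ≡ b
sum-toDiffs b [] _ = +-identityʳ b
sum-toDiffs b (c ∷ l) e =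
  trans (cong ((b ∸ c) +_) (sum-toDiffs c l (nonincreasing-tail b (c ∷ l) e)))
      (m∸n+n≡m (nonincreasing-head b c l e))

fromDiffs-toDiffs : ∀ l → nonincreasing l ≡ true → fromDiffs (toDiffs l) ≡ l
fromDiffs-toDiffs [] e = refl
fromDiffs-toDiffs (a ∷ []) e = cong [_] (+-identityʳ a)
fromDiffs-toDiffs (a ∷ b ∷ l) e =
  cong₂ _∷_ (trans (cong ((a ∸ b) +_) (sum-toDiffs b l (nonincreasing-tail a (b ∷ l) e)))
      (m∸n+n≡m (nonincreasing-head a b l e)))
            (fromDiffs-toDiffs (b ∷ l) (nonincreasing-tail a (b ∷ l) e))

nonincreasing-fromDiffs : ∀ d → nonincreasing (fromDiffs d) ≡ true
nonincreasing-fromDiffs [] = refl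
nonincreasing-fromDiffs (x ∷ []) = refl
nonincreasing-fromDiffs (x ∷ y ∷ l) =
  trans (cong (_∧ nonincreasing (fromDiffs (y ∷ l))) (≤⇒≤ᵇᵗ (m≤n+m (y + sumℕ l) x)))
      (nonincreasing-fromDiffs (y ∷ l))

allPositive-fromDiffs : ∀ d → allPositive (fromDiffs d) ≡ lastPositive d
allPositive-fromDiffs [] = refl
allPositive-fromDiffs (x ∷ []) = trans (∧-identityʳ _) (cong (1 ≤ᵇ_) (+-identityʳ x))
allPositive-fromDiffs (x ∷ y ∷ l) = trans (head-redundant _ refl) (allPositive-fromDiffs (y ∷ l))
  where
  head-redundant : ∀ b → allPositive (fromDiffs (y ∷ l)) ≡ b →
    ((1 ≤ᵇ (x + (y + sumℕ l))) ∧ allPositive (fromDiffs (y ∷ l))) ≡ b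
  head-redundant false e rewrite e = ∧-zeroʳ _
  head-redundant true e rewrite e =
    trans (∧-identityʳ _) (≤⇒≤ᵇᵗ (≤-trans (≤ᵇ⇒≤ᵗ (proj₁ (∧≡true {1 ≤ᵇ (y + sumℕ l)} e))) (m≤n+m _ x)))

weightFrom-suc : ∀ o l → weightFrom (suc o) l ≡ sumℕ l + weightFrom o l
weightFrom-suc o [] = refl
weightFrom-suc o (x ∷ l) =
  trans (cong (suc o * x +_) (weightFrom-suc (suc o) l))
      (+-interchange x (o * x) (sumℕ l) (weightFrom (suc o) l))

sum-fromDiffs : ∀ d → sumℕ (fromDiffs d) ≡ weight d
sum-fromDiffs [] = refl
sum-fromDiffs (x ∷ l) = begin
  x + sumℕ l + sumℕ (fromDiffs l)   ≡⟨ cong (x + sumℕ l +_) (sum-fromDiffs l) ⟩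
  x + sumℕ l + weight l             ≡⟨ +-assoc x (sumℕ l) (weight l) ⟩
  x + (sumℕ l + weight l)           ≡⟨ cong₂ _+_ (*-identityˡ x) (weightFrom-suc 1 l) ⟨
  1 * x + weightFrom 2 l            ∎
  where open ≡-Reasoning

ℤ-+-∸-cancel : ∀ (x s : ℤ) → (x ℤ.+ s) ℤ.- s ≡ x
ℤ-+-∸-cancel = ℤSolver.solve-∀

Σ₁-fromDiffs : ∀ d → Σ₁ (fromDiffs d) ≡ ℤ.+ Σ₁ᵈ d
Σ₁-fromDiffs [] = refl
Σ₁-fromDiffs (x ∷ []) = trans (ℤP.+-identityʳ _) (ℤ-+-∸-cancel (ℤ.+ x) (ℤ.+ 0))
Σ₁-fromDiffs (x ∷ y ∷ []) = trans (ℤP.+-identityʳ _) (ℤ-+-∸-cancel (ℤ.+ x) (ℤ.+ (y + 0)))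
Σ₁-fromDiffs (x ∷ y ∷ w ∷ l) = cong₂ ℤ._+_ (ℤ-+-∸-cancel (ℤ.+ x) (ℤ.+ (y + (w + sumℕ l)))) (Σ₁-fromDiffs l)

Σ₂-fromDiffs : ∀ d → Σ₂ (fromDiffs d) ≡ ℤ.+ Σ₂ᵈ d
Σ₂-fromDiffs [] = refl
Σ₂-fromDiffs (x ∷ []) = refl
Σ₂-fromDiffs (x ∷ y ∷ []) = cong ℤ.+_ (trans (+-identityʳ _) (trans (+-identityʳ _) (+-identityʳ y)))
Σ₂-fromDiffs (x ∷ y ∷ w ∷ l) = cong₂ ℤ._+_ (ℤ-+-∸-cancel (ℤ.+ y) (ℤ.+ (w + sumℕ l))) (Σ₂-fromDiffs l)

+-cancel-≡ᵇ : ∀ a b s → ((a + s) ≡ᵇ (b + s)) ≡ (a ≡ᵇ b)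
+-cancel-≡ᵇ a b zero = cong₂ _≡ᵇ_ (+-identityʳ a) (+-identityʳ b)
+-cancel-≡ᵇ a b (suc s) = trans (cong₂ _≡ᵇ_ (+-suc a s) (+-suc b s)) (+-cancel-≡ᵇ a b s)

unitsDiffOne-fromDiffs : ∀ d → unitsDiffOne (fromDiffs d) ≡ onesᵈ d
unitsDiffOne-fromDiffs [] = refl
unitsDiffOne-fromDiffs (x ∷ []) = refl
unitsDiffOne-fromDiffs (x ∷ y ∷ []) rewrite +-cancel-≡ᵇ y 1 0 = refl
unitsDiffOne-fromDiffs (x ∷ y ∷ w ∷ l) rewrite +-cancel-≡ᵇ y 1 (w + sumℕ l) with y ≡ᵇ 1
... | true = cong suc (unitsDiffOne-fromDiffs l)
... | false = unitsDiffOne-fromDiffs l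

noThreeEqual-fromDiffs : ∀ d → noThreeEqual (fromDiffs d) ≡ noTwoZeros d
noThreeEqual-fromDiffs [] = refl
noThreeEqual-fromDiffs (x ∷ []) = refl
noThreeEqual-fromDiffs (x ∷ y ∷ []) = refl
noThreeEqual-fromDiffs (x ∷ y ∷ z ∷ l) =
  cong₂ _∧_ (cong not (cong₂ _∧_ (+-cancel-≡ᵇ x 0 (y + (z + sumℕ l))) (+-cancel-≡ᵇ y 0 (z + sumℕ l))))
            (noThreeEqual-fromDiffs (y ∷ z ∷ l))

count : ℕ → List ℕ → ℕ
count x = countB (x ≡ᵇ_)

count-∷-≤ : ∀ x a t → count x t ≤ count x (a ∷ t)
count-∷-≤ x a t with x ≡ᵇ a
... | true = n≤1+n _
... | false = ≤-refl

count-skip : ∀ x b t → (x ≡ᵇ b) ≡ false → count x (b ∷ t) ≡ count x t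
count-skip x b t e rewrite e = refl

noThreeEqual-tail : ∀ a t → noThreeEqual (a ∷ t) ≡ true → noThreeEqual t ≡ true
noThreeEqual-tail a [] e = refl
noThreeEqual-tail a (b ∷ []) e = refl
noThreeEqual-tail a (b ∷ c ∷ t) e = proj₂ (∧≡true {not ((a ≡ᵇ b) ∧ (b ≡ᵇ c))} e)

count-below : ∀ x b t → nonincreasing (b ∷ t) ≡ true → b < x → count x (b ∷ t) ≡ 0
count-below x b [] e b<x rewrite ≢⇒≡ᵇ≡false x b (>⇒≢ b<x) = refl
count-below x b (c ∷ t) e b<x rewrite ≢⇒≡ᵇ≡false x b (>⇒≢ b<x) =
  count-below x c t (nonincreasing-tail b (c ∷ t) e) (≤-<-trans (nonincreasing-head b c t e) b<x)

count-after : ∀ x b t → nonincreasing (x ∷ b ∷ t) ≡ true → (x ≡ᵇ b) ≡ false → count x t ≡ 0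
count-after x b t ni x≢b =
  trans (sym (count-skip x b t x≢b))
        (count-below x b t (nonincreasing-tail x (b ∷ t) ni)
            (≤∧≢⇒< (nonincreasing-head x b t ni) (λ b≡x → x≢b′ (sym b≡x))))
  where x≢b′ : x ≢ b
        x≢b′ x≡b = false≢true (trans (sym x≢b) (trans (cong (x ≡ᵇ_) (sym x≡b)) (≡ᵇ-refl x)))

count-after-pair : ∀ x t → nonincreasing (x ∷ t) ≡ true → noThreeEqual (x ∷ x ∷ t) ≡ true → count x t ≡ 0
count-after-pair x [] _ _ = refl
count-after-pair x (c ∷ t) ni nt with x ≡ᵇ c in x≡c
... | false = count-after x c t ni x≡c
... | true rewrite ≡ᵇ⇒≡ᵗ x c x≡c = ⊥-elim
      (false≢true (trans (sym triple) (proj₁ (∧≡true {not ((c ≡ᵇ c) ∧ true)} nt))))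
  where triple : not ((c ≡ᵇ c) ∧ true) ≡ false
        triple rewrite ≡ᵇ-refl c = refl

count-after-head : ∀ x t → nonincreasing (x ∷ t) ≡ true → noThreeEqual (x ∷ t) ≡ true → count x t ≤ 1
count-after-head x [] _ _ = z≤n
count-after-head x (b ∷ t) ni nt with x ≡ᵇ b in x≡b
... | false = ≤-trans (≤-reflexive (count-after x b t ni x≡b)) z≤n
... | true rewrite ≡ᵇ⇒≡ᵗ x b x≡b = s≤s (≤-reflexive (count-after-pair b t (nonincreasing-tail b (b ∷ t) ni) nt))

noThreeEqual⇒count≤2 : ∀ l → nonincreasing l ≡ true → noThreeEqual l ≡ true → ∀ x → count x l ≤ 2
noThreeEqual⇒count≤2 [] ni nt x = z≤n
noThreeEqual⇒count≤2 (a ∷ t) ni nt x with x ≡ᵇ a in x≡a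
... | false = noThreeEqual⇒count≤2 t (nonincreasing-tail a t ni) (noThreeEqual-tail a t nt) x
... | true rewrite ≡ᵇ⇒≡ᵗ x a x≡a = s≤s (count-after-head a t ni nt)

allB-intro : {X : Set} (p : X → Bool) (l : List X) → (∀ x → p x ≡ true) → allB p l ≡ true
allB-intro p [] h = refl
allB-intro p (x ∷ l) h rewrite h x = allB-intro p l h

count≤2⇒noTriple : ∀ L₀ a b c r → (∀ x → count x (a ∷ b ∷ c ∷ r) ≤ count x L₀) → (count a L₀ ≤ᵇ 2) ≡ true →
  not ((a ≡ᵇ b) ∧ (b ≡ᵇ c)) ≡ true
count≤2⇒noTriple L₀ a b c r sub a≤2 with a ≡ᵇ b in a≡b | b ≡ᵇ c in b≡c
... | true | false = refl
... | false | _ = refl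
... | true | true rewrite ≡ᵇ⇒≡ᵗ a b a≡b | ≡ᵇ⇒≡ᵗ b c b≡c
      = ⊥-elim (≤⇒≯ (≤ᵇ⇒≤ᵗ {count c L₀} {2} a≤2) (≤-trans three (sub c)))
  where three : 3 ≤ count c (c ∷ c ∷ c ∷ r)
        three rewrite ≡ᵇ-refl c = s≤s (s≤s (s≤s z≤n))

atMostTwice⇒noThreeEqual : ∀ L₀ l → (∀ x → count x l ≤ count x L₀) → allB (λ x → count x L₀ ≤ᵇ 2) l ≡ true →
  noThreeEqual l ≡ true
atMostTwice⇒noThreeEqual L₀ [] sub e = refl
atMostTwice⇒noThreeEqual L₀ (a ∷ []) sub e = refl
atMostTwice⇒noThreeEqual L₀ (a ∷ b ∷ []) sub e = refl
atMostTwice⇒noThreeEqual L₀ (a ∷ b ∷ c ∷ r) sub e =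
  cong₂ _∧_ (count≤2⇒noTriple L₀ a b c r sub (proj₁ (∧≡true {count a L₀ ≤ᵇ 2} e)))
            (atMostTwice⇒noThreeEqual L₀ (b ∷ c ∷ r) (λ x → ≤-trans (count-∷-≤ x a (b ∷ c ∷ r)) (sub x))
                                      (proj₂ (∧≡true {count a L₀ ≤ᵇ 2} e)))

atMostTwice≡noThreeEqual : ∀ l → nonincreasing l ≡ true → atMostTwice l ≡ noThreeEqual l
atMostTwice≡noThreeEqual l ni = ≡true-ext
  (atMostTwice⇒noThreeEqual l l (λ x → ≤-refl))
  (λ nt → allB-intro _ l (λ x → ≤⇒≤ᵇᵗ (noThreeEqual⇒count≤2 l ni nt x)))

atMostTwice-fromDiffs : ∀ d → atMostTwice (fromDiffs d) ≡ noTwoZeros d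
atMostTwice-fromDiffs d =
  trans (atMostTwice≡noThreeEqual (fromDiffs d) (nonincreasing-fromDiffs d)) (noThreeEqual-fromDiffs d)

IsCountedPartition : ℕ → ℤ → List ℕ → Bool
IsCountedPartition m j l = isPartition l ∧ (sumℕ l ≡ᵇ m) ∧ inA l ∧ ⌊ Σ₁ l ℤ.≟ j ⌋

IsCountedDiffs : ℕ → ℤ → List ℕ → Bool
IsCountedDiffs m j d =
  lastPositive d ∧ (weight d ≡ᵇ m) ∧ (noTwoZeros d ∧ (Σ₂ᵈ d ≡ᵇ 2) ∧ (onesᵈ d ≡ᵇ 2)) ∧ ℕ≡ᵇℤ (Σ₁ᵈ d) j

IsCountedPartition-fromDiffs : ∀ m j d → IsCountedPartition m j (fromDiffs d) ≡ IsCountedDiffs m j d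
IsCountedPartition-fromDiffs m j d
  rewrite nonincreasing-fromDiffs d | allPositive-fromDiffs d | sum-fromDiffs d | atMostTwice-fromDiffs d
        | Σ₂-fromDiffs d | unitsDiffOne-fromDiffs d | Σ₁-fromDiffs d
        | ⌊≟⌋≡ℕ≡ᵇℤ (Σ₂ᵈ d) (ℤ.+ 2) | ⌊≟⌋≡ℕ≡ᵇℤ (Σ₁ᵈ d) j = refl

IsCountedDiffs⇒weight : ∀ m j d → IsCountedDiffs m j d ≡ true → weight d ≡ m
IsCountedDiffs⇒weight m j d e = ≡ᵇ⇒≡ᵗ _ m (proj₁ (∧≡true {weight d ≡ᵇ m} (proj₂ (∧≡true {lastPositive d} e))))

All≤-toDiffs : ∀ {m} l → All (_≤ m) l → All (_≤ m) (toDiffs l)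
All≤-toDiffs [] [] = []
All≤-toDiffs (a ∷ []) (p ∷ []) = p ∷ []
All≤-toDiffs (a ∷ b ∷ l) (p ∷ q ∷ ps) = ≤-trans (m∸n≤m a b) p ∷ All≤-toDiffs (b ∷ l) (q ∷ ps)

All≤sum : ∀ l → All (_≤ sumℕ l) l
All≤sum [] = []
All≤sum (x ∷ l) = m≤m+n x (sumℕ l) ∷ All.map (λ p → ≤-trans p (m≤n+m (sumℕ l) x)) (All≤sum l)

countPartitions≡countDiffs : ∀ L m j →
  countB (IsCountedPartition m j) (tuples L m) ≡ countB (IsCountedDiffs m j) (tuples L m)
countPartitions≡countDiffs L m j =
  countB-tuples-bijection (IsCountedPartition m j) (IsCountedDiffs m j) L m L m toDiffs fromDiffs to-ok from-ok
  where
  to-ok : ∀ x → InBox L m x → IsCountedPartition m j x ≡ true →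
    InBox L m (toDiffs x) × IsCountedDiffs m j (toDiffs x) ≡ true × fromDiffs (toDiffs x) ≡ x
  to-ok x (lx , x≤m) px =
    (trans (length-toDiffs x) lx , All≤-toDiffs x x≤m) ,
    trans (sym (IsCountedPartition-fromDiffs m j (toDiffs x)))
        (trans (cong (IsCountedPartition m j) inverse) px) ,
    inverse
    where
    inverse = fromDiffs-toDiffs x (proj₁ (∧≡true {nonincreasing x} (proj₁ (∧≡true {isPartition x} px))))
  from-ok : ∀ d → InBox L m d → IsCountedDiffs m j d ≡ true →
    InBox L m (fromDiffs d) × IsCountedPartition m j (fromDiffs d) ≡ true × toDiffs (fromDiffs d) ≡ d
  from-ok d (ld , _) pd =
    (trans (length-fromDiffs d) ld ,
     subst (λ z → All (_≤ z) (fromDiffs d)) (trans (sum-fromDiffs d) (IsCountedDiffs⇒weight m j d pd))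
         (All≤sum (fromDiffs d))) ,
    trans (IsCountedPartition-fromDiffs m j d) pd ,
    toDiffs-fromDiffs d

unitFirsts : List ℕ → List ℕ
unitFirsts (x ∷ y ∷ w ∷ l) = x ∷ unitFirsts l
unitFirsts l = l

unitSeconds : List ℕ → List ℕ
unitSeconds (x ∷ y ∷ w ∷ l) = y ∷ unitSeconds l
unitSeconds _ = []

unitThirds : List ℕ → List ℕ
unitThirds (x ∷ y ∷ w ∷ l) = w ∷ unitThirds l
unitThirds _ = []

interleave : List ℕ → List ℕ → List ℕ → List ℕ
interleave (x ∷ X) (y ∷ Y) (w ∷ W) = x ∷ y ∷ w ∷ interleave X Y W
interleave X _ _ = X

-- A unit (x, y, w) of differences with y = 0 forces x, w ≥ 1 (no part occurs three times), and the last
-- difference is the smallest part; for binary middle entries Y these are the lower bounds below.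
lowerFirsts : List ℕ → List ℕ
lowerFirsts Y = map (1 ∸_) Y ++ [ 1 ]

lowerThirds : List ℕ → List ℕ
lowerThirds Y = map (1 ∸_) Y

pointwise≥ᵇ : List ℕ → List ℕ → Bool
pointwise≥ᵇ (x ∷ X) (l ∷ L) = (l ≤ᵇ x) ∧ pointwise≥ᵇ X L
pointwise≥ᵇ _ _ = true

isBinary : List ℕ → Bool
isBinary = allB (λ y → y ≤ᵇ 1)

notBothZero : ℕ → ℕ → Bool
notBothZero a b = not ((a ≡ᵇ 0) ∧ (b ≡ᵇ 0))

head0 : List ℕ → ℕ
head0 [] = 0
head0 (x ∷ _) = x

-- The constraint left over by the lower bounds: between consecutive units whose middle entries are both 1,
-- the third entry of the first and the first entry of the second are not both 0.
adjacencyOK : List ℕ → List ℕ → List ℕ → Bool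
adjacencyOK (x ∷ X) (y ∷ Y) (w ∷ W) = not ((y ≡ᵇ 1) ∧ (head0 Y ≡ᵇ 1) ∧ (w ≡ᵇ 0) ∧ (head0 X ≡ᵇ 0))
    ∧ adjacencyOK X Y W
adjacencyOK _ _ _ = true


unitDecomposition : ∀ n d → length d ≡ suc (3 * n) →
  interleave (unitFirsts d) (unitSeconds d) (unitThirds d) ≡ d × length (unitFirsts d) ≡ suc n
      × length (unitSeconds d) ≡ n × length (unitThirds d) ≡ n
unitDecomposition zero (a ∷ []) e = refl , refl , refl , refl
unitDecomposition (suc n) (x ∷ y ∷ w ∷ l) e with unitDecomposition n l
    (suc-injective (suc-injective (suc-injective (trans e (cong suc (lem n))))))
  where lem : ∀ n → 3 * suc n ≡ suc (suc (suc (3 * n)))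
        lem n = trans (*-suc 3 n) refl
... | e1 , e2 , e3 , e4 = cong (λ z → x ∷ y ∷ w ∷ z) e1 , cong suc e2 , cong suc e3 , cong suc e4
unitDecomposition (suc n) (x ∷ y ∷ []) e
    = ⊥-elim (0≢1+n (suc-injective (suc-injective (trans e (cong suc (*-suc 3 n))))))

length-interleave : ∀ X Y W → length X ≡ suc (length Y) → length W ≡ length Y
    → length (interleave X Y W) ≡ suc (3 * length Y)
length-interleave (a ∷ []) [] [] e1 e2 = refl
length-interleave (x ∷ X) (y ∷ Y) (w ∷ W) e1 e2
    = trans (cong (λ z → suc (suc (suc z))) (length-interleave X Y W (suc-injective e1) (suc-injective e2)))
    (cong suc (sym (*-suc 3 (length Y))))

interleave-components : ∀ X Y W → length X ≡ suc (length Y) → length W ≡ length Y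
    → unitFirsts (interleave X Y W) ≡ X × unitSeconds (interleave X Y W) ≡ Y × unitThirds (interleave X Y W) ≡ W
interleave-components (a ∷ []) [] [] e1 e2 = refl , refl , refl
interleave-components (x ∷ X) (y ∷ Y) (w ∷ W) e1 e2 with interleave-components X Y W (suc-injective e1)
    (suc-injective e2)
... | p1 , p2 , p3 = cong (x ∷_) p1 , cong (y ∷_) p2 , cong (w ∷_) p3

noTwoZeros-tail : ∀ a l → noTwoZeros (a ∷ l) ≡ true → noTwoZeros l ≡ true
noTwoZeros-tail a [] e = refl
noTwoZeros-tail a (b ∷ []) e = refl
noTwoZeros-tail a (b ∷ c ∷ l) e = proj₂ (∧≡true {notBothZero a b} e)

notZero⇒1≤ᵇ : ∀ x → not (x ≡ᵇ 0) ≡ true → (1 ≤ᵇ x) ≡ true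
notZero⇒1≤ᵇ (suc x) e = refl

notBothZero-0⇒1≤ᵇ : ∀ x → notBothZero x 0 ≡ true → (1 ≤ᵇ x) ≡ true
notBothZero-0⇒1≤ᵇ (suc x) e = refl

binary-cases : ∀ y → (y ≤ᵇ 1) ≡ true → (y ≡ 0) ⊎ (y ≡ 1)
binary-cases zero e = inj₁ refl
binary-cases (suc zero) e = inj₂ refl
binary-cases (suc (suc y)) ()

lastPositive-skip : ∀ w x X Y W → lastPositive (w ∷ interleave (x ∷ X) Y W)
    ≡ lastPositive (interleave (x ∷ X) Y W)
lastPositive-skip w x X [] W = refl
lastPositive-skip w x X (y ∷ Y) [] = refl
lastPositive-skip w x X (y ∷ Y) (w' ∷ W) = refl

noTwoZeros-unfold : ∀ a b x X Y W → noTwoZeros (a ∷ b ∷ interleave (x ∷ X) Y W)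
    ≡ notBothZero a b ∧ noTwoZeros (b ∷ interleave (x ∷ X) Y W)
noTwoZeros-unfold a b x X [] W = refl
noTwoZeros-unfold a b x X (y ∷ Y) [] = refl
noTwoZeros-unfold a b x X (y ∷ Y) (w' ∷ W) = refl

lowerBounds-from-conditions : ∀ X Y W → isBinary Y ≡ true → length X ≡ suc (length Y) → length W ≡ length Y →
  lastPositive (interleave X Y W) ≡ true → noTwoZeros (interleave X Y W) ≡ true
      → pointwise≥ᵇ X (lowerFirsts Y) ≡ true × pointwise≥ᵇ W (lowerThirds Y) ≡ true
lowerBounds-from-conditions (a ∷ []) [] [] b e1 e2 lp nzz = trans (∧-identityʳ _) lp , refl
lowerBounds-from-conditions (x ∷ x' ∷ X) (y ∷ Y) (w ∷ W) b e1 e2 lp nzz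
  with lowerBounds-from-conditions (x' ∷ X) Y W (proj₂ (∧≡true {y ≤ᵇ 1} b)) (suc-injective e1)
      (suc-injective e2) (trans (sym (lastPositive-skip w x' X Y W)) lp)
          (noTwoZeros-tail w (interleave (x' ∷ X) Y W)
              (proj₂ (∧≡true {notBothZero y w}
              (trans (sym (noTwoZeros-unfold y w x' X Y W)) (proj₂ (∧≡true {notBothZero x y} nzz))))))
... | g1 , g2 with binary-cases y (proj₁ (∧≡true {y ≤ᵇ 1} b))
...   | inj₂ refl = g1 , g2
...   | inj₁ refl = trans (cong (_∧ pointwise≥ᵇ (x' ∷ X) (lowerFirsts Y))
      (notBothZero-0⇒1≤ᵇ x (proj₁ (∧≡true {notBothZero x 0} nzz)))) g1 ,
                             trans (cong (_∧ pointwise≥ᵇ W (lowerThirds Y))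
                                 (notZero⇒1≤ᵇ w
                                 (proj₁ (∧≡true {notBothZero 0 w}
                                 (trans (sym (noTwoZeros-unfold 0 w x' X Y W))
                                 (proj₂ (∧≡true {notBothZero x 0} nzz))))))) g2

1≤ᵇ⇒≢0 : ∀ x → (1 ≤ᵇ x) ≡ true → (x ≡ᵇ 0) ≡ false
1≤ᵇ⇒≢0 (suc x) e = refl

unitHead-notBothZero : ∀ x y w → (y ≤ᵇ 1) ≡ true → ((1 ∸ y) ≤ᵇ x) ≡ true → ((1 ∸ y) ≤ᵇ w) ≡ true
    → notBothZero x y ≡ true × notBothZero y w ≡ true
unitHead-notBothZero x zero w _ hx hw rewrite 1≤ᵇ⇒≢0 x hx
    = refl , trans (cong (λ z → not (true ∧ z)) (1≤ᵇ⇒≢0 w hw)) refl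
unitHead-notBothZero x (suc zero) w _ hx hw = cong not (∧-zeroʳ (x ≡ᵇ 0)) , refl

unitJoin-notBothZero : ∀ y y' w x' → (y ≤ᵇ 1) ≡ true → (y' ≤ᵇ 1) ≡ true → ((1 ∸ y) ≤ᵇ w) ≡ true
    → ((1 ∸ y') ≤ᵇ x') ≡ true →
  notBothZero w x' ≡ not ((y ≡ᵇ 1) ∧ (y' ≡ᵇ 1) ∧ (w ≡ᵇ 0) ∧ (x' ≡ᵇ 0))
unitJoin-notBothZero zero y' w x' _ _ hw _ rewrite 1≤ᵇ⇒≢0 w hw = refl
unitJoin-notBothZero (suc zero) zero w x' _ _ _ hx rewrite 1≤ᵇ⇒≢0 x' hx = cong not (∧-zeroʳ (w ≡ᵇ 0))
unitJoin-notBothZero (suc zero) (suc zero) w x' _ _ _ _ = refl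

∧-swap-middle : ∀ a c b → (a ∧ (c ∧ b)) ≡ (c ∧ (a ∧ b))
∧-swap-middle a true b = refl
∧-swap-middle a false b = ∧-zeroʳ a

conditions≡adjacencyOK : ∀ X Y W → isBinary Y ≡ true → length X ≡ suc (length Y) → length W ≡ length Y →
  pointwise≥ᵇ X (lowerFirsts Y) ≡ true → pointwise≥ᵇ W (lowerThirds Y) ≡ true
      → (lastPositive (interleave X Y W) ∧ noTwoZeros (interleave X Y W)) ≡ adjacencyOK X Y W
conditions≡adjacencyOK (a ∷ []) [] [] _ _ _ g1 g2 = g1
conditions≡adjacencyOK (x ∷ x' ∷ X) (y ∷ Y) (w ∷ W) b e1 e2 g1 g2 =
  trans (cong₂ _∧_ (lastPositive-skip w x' X Y W) (cong (notBothZero x y ∧_) (noTwoZeros-unfold y w x' X Y W)))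
  (trans (cong₂ (λ u v → lastPositive (interleave (x' ∷ X) Y W)
      ∧ (u ∧ (v ∧ noTwoZeros (w ∷ interleave (x' ∷ X) Y W)))) (proj₁ hf) (proj₂ hf))
   (tailEq X Y W (proj₂ (∧≡true {y ≤ᵇ 1} b)) (suc-injective e1) (suc-injective e2) gx' gw'))
  where
  by = proj₁ (∧≡true {y ≤ᵇ 1} b)
  hf = unitHead-notBothZero x y w by (proj₁ (∧≡true {(1 ∸ y) ≤ᵇ x} g1)) (proj₁ (∧≡true {(1 ∸ y) ≤ᵇ w} g2))
  gx' = proj₂ (∧≡true {(1 ∸ y) ≤ᵇ x} g1)
  gw' = proj₂ (∧≡true {(1 ∸ y) ≤ᵇ w} g2)
  tailEq : ∀ X Y W → isBinary Y ≡ true → length (x' ∷ X) ≡ suc (length Y) → length W ≡ length Y →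
    pointwise≥ᵇ (x' ∷ X) (lowerFirsts Y) ≡ true → pointwise≥ᵇ W (lowerThirds Y) ≡ true →
    (lastPositive (interleave (x' ∷ X) Y W) ∧ noTwoZeros (w ∷ interleave (x' ∷ X) Y W))
        ≡ (not ((y ≡ᵇ 1) ∧ (head0 Y ≡ᵇ 1) ∧ (w ≡ᵇ 0) ∧ (x' ≡ᵇ 0)) ∧ adjacencyOK (x' ∷ X) Y W)
  tailEq [] [] [] b' _ _ gx gw = trans gx (sym (cong (λ z → not z ∧ true) (∧-zeroʳ (y ≡ᵇ 1))))
  tailEq (x'' ∷ X) (y' ∷ Y) (w' ∷ W) b' e1' e2' gx gw =
    trans (cong (lastPositive R ∧_) (cong (_∧ noTwoZeros R)
        (unitJoin-notBothZero y y' w x' by (proj₁ (∧≡true {y' ≤ᵇ 1} b')) (proj₁ (∧≡true {(1 ∸ y) ≤ᵇ w} g2))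
        (proj₁ (∧≡true {(1 ∸ y') ≤ᵇ x'} gx)))))
    (trans (∧-swap-middle (lastPositive R) (not ((y ≡ᵇ 1) ∧ (y' ≡ᵇ 1) ∧ (w ≡ᵇ 0) ∧ (x' ≡ᵇ 0))) (noTwoZeros R))
      (cong (not ((y ≡ᵇ 1) ∧ (y' ≡ᵇ 1) ∧ (w ≡ᵇ 0) ∧ (x' ≡ᵇ 0)) ∧_)
          (conditions≡adjacencyOK (x' ∷ x'' ∷ X) (y' ∷ Y) (w' ∷ W) b' e1' e2' gx gw)))
    where R = interleave (x' ∷ x'' ∷ X) (y' ∷ Y) (w' ∷ W)


weightStep : ℕ → List ℕ → ℕ
weightStep o [] = 0
weightStep o (x ∷ L) = o * x + weightStep (3 + o) L

rearrange6 : ∀ a b c A B C → a + (b + (c + (A + B + C))) ≡ a + A + (b + B) + (c + C)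
rearrange6 = ℕSolver.solve-∀

weightFrom-interleave : ∀ o X Y W → length X ≡ suc (length Y) → length W ≡ length Y →
  weightFrom o (interleave X Y W) ≡ weightStep o X + weightStep (suc o) Y + weightStep (2 + o) W
weightFrom-interleave o (a ∷ []) [] [] _ _ = sym (+-identityʳ _ ⊙ +-identityʳ _)
  where _⊙_ : ∀ {p q r : ℕ} → p ≡ q → q ≡ r → p ≡ r
        _⊙_ = trans
weightFrom-interleave o (x ∷ X) (y ∷ Y) (w ∷ W) e1 e2 =
  trans (cong (λ z → o * x + (suc o * y + (suc (suc o) * w + z)))
      (weightFrom-interleave (3 + o) X Y W (suc-injective e1) (suc-injective e2)))
        (rearrange6 (o * x) (suc o * y) (suc (suc o) * w) (weightStep (3 + o) X) (weightStep (suc (3 + o)) Y)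
            (weightStep (2 + (3 + o)) W))

Σ₁ᵈ-interleave : ∀ X Y W → length X ≡ suc (length Y) → length W ≡ length Y → Σ₁ᵈ (interleave X Y W) ≡ sumℕ X
Σ₁ᵈ-interleave (a ∷ []) [] [] _ _ = sym (+-identityʳ a)
Σ₁ᵈ-interleave (x ∷ X) (y ∷ Y) (w ∷ W) e1 e2
    = cong (x +_) (Σ₁ᵈ-interleave X Y W (suc-injective e1) (suc-injective e2))

Σ₂ᵈ-interleave : ∀ X Y W → length X ≡ suc (length Y) → length W ≡ length Y → Σ₂ᵈ (interleave X Y W) ≡ sumℕ Y
Σ₂ᵈ-interleave (a ∷ []) [] [] _ _ = refl
Σ₂ᵈ-interleave (x ∷ X) (y ∷ Y) (w ∷ W) e1 e2
    = cong (y +_) (Σ₂ᵈ-interleave X Y W (suc-injective e1) (suc-injective e2))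

countOnes : List ℕ → ℕ
countOnes = countB (λ y → y ≡ᵇ 1)

onesᵈ-interleave : ∀ X Y W → length X ≡ suc (length Y) → length W ≡ length Y
    → onesᵈ (interleave X Y W) ≡ countOnes Y
onesᵈ-interleave (a ∷ []) [] [] _ _ = refl
onesᵈ-interleave (x ∷ X) (y ∷ Y) (w ∷ W) e1 e2 rewrite onesᵈ-interleave X Y W (suc-injective e1)
    (suc-injective e2) = refl

sum-zipWith-+ : ∀ u L → length u ≡ length L → sumℕ (zipWith _+_ u L) ≡ sumℕ u + sumℕ L
sum-zipWith-+ [] [] _ = refl
sum-zipWith-+ (x ∷ u) (l ∷ L) e = trans (cong (x + l +_) (sum-zipWith-+ u L (suc-injective e)))
    (+-interchange x l (sumℕ u) (sumℕ L))

weightStep-zipWith-+ : ∀ o u L → length u ≡ length L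
    → weightStep o (zipWith _+_ u L) ≡ weightStep o u + weightStep o L
weightStep-zipWith-+ o [] [] _ = refl
weightStep-zipWith-+ o (x ∷ u) (l ∷ L) e
    = trans (cong₂ _+_ (*-distribˡ-+ o x l) (weightStep-zipWith-+ (3 + o) u L (suc-injective e)))
    (+-interchange (o * x) (o * l) _ _)

All≤weightFrom : ∀ o l → All (_≤ weightFrom (suc o) l) l
All≤weightFrom o [] = []
All≤weightFrom o (x ∷ l) = ≤-trans (m≤m+n x (o * x)) (m≤m+n (suc o * x) _) ∷ All.map
    (λ p → ≤-trans p (≤-trans (≤-reflexive refl) (m≤n+m _ (suc o * x)))) (All≤weightFrom (suc o) l)


length-zipWith′ : ∀ (f : ℕ → ℕ → ℕ) a b → length a ≡ length b → length (zipWith f a b) ≡ length a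
length-zipWith′ f [] [] _ = refl
length-zipWith′ f (x ∷ a) (y ∷ b) e = cong suc (length-zipWith′ f a b (suc-injective e))

zipWith-+-∸ : ∀ u L → length u ≡ length L → zipWith _∸_ (zipWith _+_ u L) L ≡ u
zipWith-+-∸ [] [] _ = refl
zipWith-+-∸ (x ∷ u) (l ∷ L) e = cong₂ _∷_ (m+n∸n≡m x l) (zipWith-+-∸ u L (suc-injective e))

zipWith-∸-+ : ∀ X L → length X ≡ length L → pointwise≥ᵇ X L ≡ true → zipWith _+_ (zipWith _∸_ X L) L ≡ X
zipWith-∸-+ [] [] _ _ = refl
zipWith-∸-+ (x ∷ X) (l ∷ L) e g = cong₂ _∷_ (m∸n+n≡m (≤ᵇ⇒≤ᵗ {l} {x} (proj₁ (∧≡true {l ≤ᵇ x} g))))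
    (zipWith-∸-+ X L (suc-injective e) (proj₂ (∧≡true {l ≤ᵇ x} g)))

All≤-zipWith-∸ : ∀ {m} X L → All (_≤ m) X → All (_≤ m) (zipWith _∸_ X L)
All≤-zipWith-∸ [] L _ = []
All≤-zipWith-∸ (x ∷ X) [] _ = []
All≤-zipWith-∸ (x ∷ X) (l ∷ L) (p ∷ ps) = ≤-trans (m∸n≤m x l) p ∷ All≤-zipWith-∸ X L ps

take-++-length : ∀ k (U V : List ℕ) → length U ≡ k → take k (U ++ V) ≡ U
take-++-length zero [] V _ = refl
take-++-length (suc k) (x ∷ U) V e = cong (x ∷_) (take-++-length k U V (suc-injective e))

drop-++-length : ∀ k (U V : List ℕ) → length U ≡ k → drop k (U ++ V) ≡ V
drop-++-length zero [] V _ = refl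
drop-++-length (suc k) (x ∷ U) V e = drop-++-length k U V (suc-injective e)

length-take′ : ∀ k n (t : List ℕ) → length t ≡ k + n → length (take k t) ≡ k
length-take′ zero n t e = refl
length-take′ (suc k) n (x ∷ t) e = cong suc (length-take′ k n t (suc-injective e))

length-drop′ : ∀ k n (t : List ℕ) → length t ≡ k + n → length (drop k t) ≡ n
length-drop′ zero n t e = e
length-drop′ (suc k) n (x ∷ t) e = length-drop′ k n t (suc-injective e)

length-lowerFirsts : ∀ Y → length (lowerFirsts Y) ≡ suc (length Y)
length-lowerFirsts [] = refl
length-lowerFirsts (y ∷ Y) = cong suc (length-lowerFirsts Y)

length-lowerThirds : ∀ Y → length (lowerThirds Y) ≡ length Y
length-lowerThirds [] = refl
length-lowerThirds (y ∷ Y) = cong suc (length-lowerThirds Y)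

All-unitFirsts : ∀ {P : ℕ → Set} l → All P l → All P (unitFirsts l)
All-unitFirsts (x ∷ y ∷ w ∷ l) (p ∷ q ∷ r ∷ ps) = p ∷ All-unitFirsts l ps
All-unitFirsts [] ps = ps
All-unitFirsts (x ∷ []) ps = ps
All-unitFirsts (x ∷ y ∷ []) ps = ps

All-unitThirds : ∀ {P : ℕ → Set} l → All P l → All P (unitThirds l)
All-unitThirds (x ∷ y ∷ w ∷ l) (p ∷ q ∷ r ∷ ps) = r ∷ All-unitThirds l ps
All-unitThirds [] ps = []
All-unitThirds (x ∷ []) ps = []
All-unitThirds (x ∷ y ∷ []) ps = []

IsCountedDiffs⇒noTwoZeros : ∀ m j d → IsCountedDiffs m j d ≡ true → noTwoZeros d ≡ true
IsCountedDiffs⇒noTwoZeros m j d e = proj₁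
    (∧≡true {noTwoZeros d} (proj₁ (∧≡true {noTwoZeros d ∧ (Σ₂ᵈ d ≡ᵇ 2) ∧ (onesᵈ d ≡ᵇ 2)}
    (proj₂ (∧≡true {weight d ≡ᵇ m} (proj₂ (∧≡true {lastPositive d} e)))))))

toFree : List ℕ → List ℕ → List ℕ
toFree Y d = zipWith _∸_ (unitFirsts d) (lowerFirsts Y) ++ zipWith _∸_ (unitThirds d) (lowerThirds Y)

fromFree : List ℕ → List ℕ → List ℕ
fromFree Y t = interleave (zipWith _+_ (take (suc (length Y)) t) (lowerFirsts Y)) Y
    (zipWith _+_ (drop (suc (length Y)) t) (lowerThirds Y))

IsCountedDiffsWith : ℕ → ℤ → List ℕ → List ℕ → Bool
IsCountedDiffsWith m j Y d = IsCountedDiffs m j d ∧ eqListᵇ (unitSeconds d) Y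

module _ (Y : List ℕ) where

  private
    n = length Y

  fromFree-toFree : ∀ d → isBinary Y ≡ true → length d ≡ suc (3 * n) → unitSeconds d ≡ Y →
    lastPositive d ≡ true → noTwoZeros d ≡ true → fromFree Y (toFree Y d) ≡ d
  fromFree-toFree d bY ld d₂≡Y lp nzz = begin
    fromFree Y (toFree Y d)
      ≡⟨ cong₂ (λ a b → interleave (zipWith _+_ a (lowerFirsts Y)) Y (zipWith _+_ b (lowerThirds Y)))
               (take-++-length (suc n) X′ W′ lX′) (drop-++-length (suc n) X′ W′ lX′) ⟩
    interleave (zipWith _+_ X′ (lowerFirsts Y)) Y (zipWith _+_ W′ (lowerThirds Y))
      ≡⟨ cong₂ (λ a b → interleave a Y b) (zipWith-∸-+ X (lowerFirsts Y) lXL (proj₁ bounds))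
          (zipWith-∸-+ W (lowerThirds Y) lWL (proj₂ bounds)) ⟩
    interleave X Y W
      ≡⟨ d≡XYW ⟨
    d ∎
    where
    open ≡-Reasoning
    decomposition = unitDecomposition n d ld
    X = unitFirsts d
    W = unitThirds d
    X′ = zipWith _∸_ X (lowerFirsts Y)
    W′ = zipWith _∸_ W (lowerThirds Y)
    d≡XYW : d ≡ interleave X Y W
    d≡XYW = sym (trans (cong (λ z → interleave X z W) (sym d₂≡Y)) (proj₁ decomposition))
    lX = proj₁ (proj₂ decomposition)
    lW = proj₂ (proj₂ (proj₂ decomposition))
    lXL = trans lX (sym (length-lowerFirsts Y))
    lWL = trans lW (sym (length-lowerThirds Y))
    lX′ : length X′ ≡ suc n
    lX′ = trans (length-zipWith′ _∸_ X (lowerFirsts Y) lXL) lX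
    bounds = lowerBounds-from-conditions X Y W bY lX lW (subst (λ e → lastPositive e ≡ true) d≡XYW lp)
                                         (subst (λ e → noTwoZeros e ≡ true) d≡XYW nzz)

  InBox-toFree : ∀ d m → InBox (suc (3 * n)) m d → InBox (suc n + n) m (toFree Y d)
  InBox-toFree d m (ld , d≤m) =
    trans (List.length-++ (zipWith _∸_ X (lowerFirsts Y)))
          (cong₂ _+_ (trans (length-zipWith′ _∸_ X (lowerFirsts Y) (trans lX (sym (length-lowerFirsts Y)))) lX)
                     (trans (length-zipWith′ _∸_ W (lowerThirds Y) (trans lW (sym (length-lowerThirds Y)))) lW))
                         ,
    All.++⁺ (All≤-zipWith-∸ X (lowerFirsts Y) (All-unitFirsts d d≤m))
        (All≤-zipWith-∸ W (lowerThirds Y) (All-unitThirds d d≤m))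
    where
    decomposition = unitDecomposition n d ld
    X = unitFirsts d
    W = unitThirds d
    lX = proj₁ (proj₂ decomposition)
    lW = proj₂ (proj₂ (proj₂ decomposition))

  module _ (t : List ℕ) (lt : length t ≡ suc n + n) where

    private
      u = take (suc n) t
      v = drop (suc n) t
      luL : length u ≡ length (lowerFirsts Y)
      luL = trans (length-take′ (suc n) n t lt) (sym (length-lowerFirsts Y))
      lvL : length v ≡ length (lowerThirds Y)
      lvL = trans (length-drop′ (suc n) n t lt) (sym (length-lowerThirds Y))
      lX : length (zipWith _+_ u (lowerFirsts Y)) ≡ suc n
      lX = trans (length-zipWith′ _+_ u (lowerFirsts Y) luL) (length-take′ (suc n) n t lt)
      lW : length (zipWith _+_ v (lowerThirds Y)) ≡ n
      lW = trans (length-zipWith′ _+_ v (lowerThirds Y) lvL) (length-drop′ (suc n) n t lt)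

    length-fromFree : length (fromFree Y t) ≡ suc (3 * n)
    length-fromFree = length-interleave (zipWith _+_ u (lowerFirsts Y)) Y (zipWith _+_ v (lowerThirds Y)) lX lW

    toFree-fromFree : toFree Y (fromFree Y t) ≡ t
    toFree-fromFree = begin
      toFree Y (fromFree Y t)
        ≡⟨ cong₂ (λ a b → zipWith _∸_ a (lowerFirsts Y) ++ zipWith _∸_ b (lowerThirds Y)) (proj₁ components)
            (proj₂ (proj₂ components)) ⟩
      zipWith _∸_ (zipWith _+_ u (lowerFirsts Y)) (lowerFirsts Y) ++ zipWith _∸_ (zipWith _+_ v (lowerThirds Y))
          (lowerThirds Y)
        ≡⟨ cong₂ _++_ (zipWith-+-∸ u (lowerFirsts Y) luL) (zipWith-+-∸ v (lowerThirds Y) lvL) ⟩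
      u ++ v
        ≡⟨ List.take++drop≡id (suc n) t ⟩
      t ∎
      where
      open ≡-Reasoning
      components = interleave-components (zipWith _+_ u (lowerFirsts Y)) Y (zipWith _+_ v (lowerThirds Y)) lX lW

  countDiffsWith≡countFree : ∀ m j → isBinary Y ≡ true →
    countB (IsCountedDiffsWith m j Y) (tuples (suc (3 * n)) m)
    ≡ countB (λ t → IsCountedDiffsWith m j Y (fromFree Y t)) (tuples (suc n + n) m)
  countDiffsWith≡countFree m j bY =
    countB-tuples-bijection (IsCountedDiffsWith m j Y) (λ t → IsCountedDiffsWith m j Y (fromFree Y t))
                            (suc (3 * n)) m (suc n + n) m (toFree Y) (fromFree Y) to-ok from-ok
    where
    to-ok : ∀ d → InBox (suc (3 * n)) m d → IsCountedDiffsWith m j Y d ≡ true →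
      InBox (suc n + n) m (toFree Y d) × IsCountedDiffsWith m j Y (fromFree Y (toFree Y d)) ≡ true
          × fromFree Y (toFree Y d) ≡ d
    to-ok d bd pd = InBox-toFree d m bd , trans (cong (IsCountedDiffsWith m j Y) inverse) pd , inverse
      where
      counted = proj₁ (∧≡true {IsCountedDiffs m j d} pd)
      inverse = fromFree-toFree d bY (proj₁ bd)
          (eqListᵇ⇒≡ (unitSeconds d) Y (proj₂ (∧≡true {IsCountedDiffs m j d} pd)))
                  (proj₁ (∧≡true {lastPositive d} counted)) (IsCountedDiffs⇒noTwoZeros m j d counted)
    from-ok : ∀ t → InBox (suc n + n) m t → IsCountedDiffsWith m j Y (fromFree Y t) ≡ true →
      InBox (suc (3 * n)) m (fromFree Y t) × IsCountedDiffsWith m j Y (fromFree Y t) ≡ true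
          × toFree Y (fromFree Y t) ≡ t
    from-ok t (lt , _) qt = (length-fromFree t lt , bounded) , qt , toFree-fromFree t lt
      where
      bounded = subst (λ z → All (_≤ z) (fromFree Y t))
                      (IsCountedDiffs⇒weight m j (fromFree Y t)
                          (proj₁ (∧≡true {IsCountedDiffs m j (fromFree Y t)} qt)))
                      (All≤weightFrom 0 (fromFree Y t))

qDeg-applyUpTo : ∀ (α β : ℕ → ℕ) (f : ℕ → ℕ) N U o → (∀ i → β (f i) ≡ o + 3 * i) → length U ≡ N →
  qDeg (map (λ i → (α i , β i)) (applyUpTo f N)) U ≡ weightStep o U
qDeg-applyUpTo α β f zero [] o h e = refl
qDeg-applyUpTo α β f (suc N) (x ∷ U) o h e =
  cong₂ _+_ (cong (_* x) (trans (h 0) (+-identityʳ o)))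
           (qDeg-applyUpTo α β (f ∘ suc) N U (3 + o) (λ i → trans (h (suc i)) (lem o i)) (suc-injective e))
  where lem : ∀ o i → o + 3 * suc i ≡ 3 + o + 3 * i
        lem = ℕSolver.solve-∀

zDeg-applyUpTo : ∀ (α β : ℕ → ℕ) (f : ℕ → ℕ) N U c → (∀ i → α (f i) ≡ c) → length U ≡ N →
  zDeg (map (λ i → (α i , β i)) (applyUpTo f N)) U ≡ c * sumℕ U
zDeg-applyUpTo α β f zero [] c h e = sym (*-zeroʳ c)
zDeg-applyUpTo α β f (suc N) (x ∷ U) c h e =
  trans (cong₂ _+_ (cong (_* x) (h 0)) (zDeg-applyUpTo α β (f ∘ suc) N U c (λ i → h (suc i)) (suc-injective e)))
      (sym (*-distribˡ-+ c x (sumℕ U)))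

length-pochZWeights : ∀ n → length (pochZWeights n) ≡ suc n
length-pochZWeights n = trans (List.length-map _ (upTo (suc n))) (List.length-upTo (suc n))

length-pochWeights : ∀ n → length (pochWeights n) ≡ suc n + n
length-pochWeights n = trans (List.length-++ (pochZWeights n))
    (cong₂ _+_ (length-pochZWeights n) (trans (List.length-map _ (upTo n)) (List.length-upTo n)))

qDeg-pochWeights : ∀ n u v → length u ≡ suc n → length v ≡ n
    → qDeg (pochWeights n) (u ++ v) ≡ weightStep 1 u + weightStep 3 v
qDeg-pochWeights n u v lu lv = trans (qDeg-++ (pochZWeights n) (pochQWeights n) u v
    (trans lu (sym (length-pochZWeights n))))
  (cong₂ _+_ (qDeg-applyUpTo (λ _ → 1) (λ i → 3 * i + 1) (λ i → i) (suc n) u 1 (λ i → +-comm (3 * i) 1) lu)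
             (qDeg-applyUpTo (λ _ → 0) (λ i → 3 * i + 3) (λ i → i) n v 3 (λ i → +-comm (3 * i) 3) lv))

zDeg-pochWeights : ∀ n u v → length u ≡ suc n → length v ≡ n → zDeg (pochWeights n) (u ++ v) ≡ sumℕ u
zDeg-pochWeights n u v lu lv = trans (zDeg-++ (pochZWeights n) (pochQWeights n) u v
    (trans lu (sym (length-pochZWeights n))))
  (trans (cong₂ _+_ (zDeg-applyUpTo (λ _ → 1) (λ i → 3 * i + 1) (λ i → i) (suc n) u 1 (λ i → refl) lu)
             (zDeg-applyUpTo (λ _ → 0) (λ i → 3 * i + 3) (λ i → i) n v 0 (λ i → refl) lv))
         (trans (+-identityʳ _) (*-identityˡ _)))

pointwise≥ᵇ-zipWith-+ : ∀ u L → length u ≡ length L → pointwise≥ᵇ (zipWith _+_ u L) L ≡ true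
pointwise≥ᵇ-zipWith-+ [] [] _ = refl
pointwise≥ᵇ-zipWith-+ (x ∷ u) (l ∷ L) e
    = trans (cong (_∧ pointwise≥ᵇ (zipWith _+_ u L) L) (≤⇒≤ᵇᵗ (m≤n+m l x)))
    (pointwise≥ᵇ-zipWith-+ u L (suc-injective e))

∧-rearrange : ∀ a b c d → (a ∧ (b ∧ ((c ∧ true ∧ true) ∧ d))) ∧ true ≡ (a ∧ c) ∧ (d ∧ b)
∧-rearrange true true true true = refl
∧-rearrange true true true false = refl
∧-rearrange true true false d = refl
∧-rearrange true false true true = refl
∧-rearrange true false true false = refl
∧-rearrange true false false d = refl
∧-rearrange false b c d = refl

zOffset : List ℕ → ℕ
zOffset Y = sumℕ (lowerFirsts Y)

-- The least weight of an interleaving with middle entries Y, where the first entry has index o.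
qOffsetFrom : ℕ → List ℕ → ℕ
qOffsetFrom o Y = weightStep o (lowerFirsts Y) + weightStep (suc o) Y + weightStep (2 + o) (lowerThirds Y)

qOffset : List ℕ → ℕ
qOffset = qOffsetFrom 1

IsFreeSolution : List ℕ → ℕ → ℤ → List ℕ → Bool
IsFreeSolution Y m j t = adjacencyOK (zipWith _+_ (take (suc (length Y)) t) (lowerFirsts Y)) Y
    (zipWith _+_ (drop (suc (length Y)) t) (lowerThirds Y))
           ∧ (ℕ≡ᵇℤ (zDeg (pochWeights (length Y)) t + zOffset Y) j
               ∧ (qDeg (pochWeights (length Y)) t + qOffset Y ≡ᵇ m))

module _ (Y t : List ℕ) (lt : length t ≡ suc (length Y) + length Y) where

  private
    n = length Y
    u = take (suc n) t
    v = drop (suc n) t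
    lu : length u ≡ suc n
    lu = length-take′ (suc n) n t lt
    lv : length v ≡ n
    lv = length-drop′ (suc n) n t lt
    luL : length u ≡ length (lowerFirsts Y)
    luL = trans lu (sym (length-lowerFirsts Y))
    lvL : length v ≡ length (lowerThirds Y)
    lvL = trans lv (sym (length-lowerThirds Y))
    X = zipWith _+_ u (lowerFirsts Y)
    W = zipWith _+_ v (lowerThirds Y)
    lX : length X ≡ suc n
    lX = trans (length-zipWith′ _+_ u (lowerFirsts Y) luL) lu
    lW : length W ≡ n
    lW = trans (length-zipWith′ _+_ v (lowerThirds Y) lvL) lv
    t≡u++v : t ≡ u ++ v
    t≡u++v = sym (List.take++drop≡id (suc n) t)

  Σ₁ᵈ-fromFree : Σ₁ᵈ (fromFree Y t) ≡ zDeg (pochWeights n) t + zOffset Y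
  Σ₁ᵈ-fromFree = begin
    Σ₁ᵈ (interleave X Y W)                   ≡⟨ Σ₁ᵈ-interleave X Y W lX lW ⟩
    sumℕ X                                   ≡⟨ sum-zipWith-+ u (lowerFirsts Y) luL ⟩
    sumℕ u + zOffset Y                       ≡⟨ cong (_+ zOffset Y) (zDeg-pochWeights n u v lu lv) ⟨
    zDeg (pochWeights n) (u ++ v) + zOffset Y ≡⟨ cong (λ t′ → zDeg (pochWeights n) t′ + zOffset Y) t≡u++v ⟨
    zDeg (pochWeights n) t + zOffset Y       ∎
    where open ≡-Reasoning

  weight-fromFree : weight (fromFree Y t) ≡ qDeg (pochWeights n) t + qOffset Y
  weight-fromFree = begin
    weight (interleave X Y W)
      ≡⟨ weightFrom-interleave 1 X Y W lX lW ⟩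
    weightStep 1 X + weightStep 2 Y + weightStep 3 W
      ≡⟨ cong₂ (λ a b → a + weightStep 2 Y + b) (weightStep-zipWith-+ 1 u (lowerFirsts Y) luL)
                                                (weightStep-zipWith-+ 3 v (lowerThirds Y) lvL) ⟩
    weightStep 1 u + weightStep 1 (lowerFirsts Y) + weightStep 2 Y
        + (weightStep 3 v + weightStep 3 (lowerThirds Y))
      ≡⟨ regroup (weightStep 1 u) (weightStep 1 (lowerFirsts Y)) (weightStep 2 Y) (weightStep 3 v)
          (weightStep 3 (lowerThirds Y)) ⟩
    weightStep 1 u + weightStep 3 v + qOffset Y
      ≡⟨ cong (_+ qOffset Y) (qDeg-pochWeights n u v lu lv) ⟨
    qDeg (pochWeights n) (u ++ v) + qOffset Y
      ≡⟨ cong (λ t′ → qDeg (pochWeights n) t′ + qOffset Y) t≡u++v ⟨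
    qDeg (pochWeights n) t + qOffset Y ∎
    where
    open ≡-Reasoning
    regroup : ∀ a b c d e → a + b + c + (d + e) ≡ a + d + (b + c + e)
    regroup = ℕSolver.solve-∀

  IsCountedDiffsWith-fromFree : ∀ m j → isBinary Y ≡ true → sumℕ Y ≡ 2 → countOnes Y ≡ 2 →
    IsCountedDiffsWith m j Y (fromFree Y t) ≡ IsFreeSolution Y m j t
  IsCountedDiffsWith-fromFree m j bY sY cY = begin
    (lastPositive G ∧ ((weight G ≡ᵇ m) ∧ ((noTwoZeros G ∧ (Σ₂ᵈ G ≡ᵇ 2) ∧ (onesᵈ G ≡ᵇ 2)) ∧ ℕ≡ᵇℤ (Σ₁ᵈ G) j)))
        ∧ eqListᵇ (unitSeconds G) Y
      ≡⟨ cong₃ (λ p q r → (lastPositive G ∧ ((weight G ≡ᵇ m) ∧ ((noTwoZeros G ∧ p ∧ q) ∧ ℕ≡ᵇℤ (Σ₁ᵈ G) j))) ∧ r)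
               (cong (_≡ᵇ 2) (trans (Σ₂ᵈ-interleave X Y W lX lW) sY))
                   (cong (_≡ᵇ 2) (trans (onesᵈ-interleave X Y W lX lW) cY))
               (trans (cong (λ z → eqListᵇ z Y) (proj₁ (proj₂ (interleave-components X Y W lX lW))))
                   (eqListᵇ-refl Y)) ⟩
    (lastPositive G ∧ ((weight G ≡ᵇ m) ∧ ((noTwoZeros G ∧ true ∧ true) ∧ ℕ≡ᵇℤ (Σ₁ᵈ G) j))) ∧ true
      ≡⟨ ∧-rearrange (lastPositive G) (weight G ≡ᵇ m) (noTwoZeros G) (ℕ≡ᵇℤ (Σ₁ᵈ G) j) ⟩
    (lastPositive G ∧ noTwoZeros G) ∧ (ℕ≡ᵇℤ (Σ₁ᵈ G) j ∧ (weight G ≡ᵇ m))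
      ≡⟨ cong₃ (λ p a b → p ∧ (ℕ≡ᵇℤ a j ∧ (b ≡ᵇ m)))
               (conditions≡adjacencyOK X Y W bY lX lW (pointwise≥ᵇ-zipWith-+ u (lowerFirsts Y) luL)
                   (pointwise≥ᵇ-zipWith-+ v (lowerThirds Y) lvL))
               Σ₁ᵈ-fromFree weight-fromFree ⟩
    IsFreeSolution Y m j t ∎
    where
    open ≡-Reasoning
    G = interleave X Y W

zeros : ℕ → List ℕ
zeros r = replicate r 0

twoOnes : ℕ → ℕ → ℕ → List ℕ
twoOnes r1 r2 r3 = zeros r1 ++ 1 ∷ zeros r2 ++ 1 ∷ zeros r3

length-zeros-++ : ∀ r L → length (zeros r ++ L) ≡ r + length L
length-zeros-++ zero L = refl
length-zeros-++ (suc r) L = cong suc (length-zeros-++ r L)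

twoOnes-length-arith : ∀ r1 r2 r3 → r1 + suc (r2 + suc r3) ≡ r1 + r2 + r3 + 2
twoOnes-length-arith = ℕSolver.solve-∀

length-twoOnes : ∀ r1 r2 r3 → length (twoOnes r1 r2 r3) ≡ r1 + r2 + r3 + 2
length-twoOnes r1 r2 r3 = trans (length-zeros-++ r1 _)
    (trans (cong (r1 +_) (trans (cong suc (length-zeros-++ r2 _))
    (cong (λ z → suc (r2 + suc z)) (List.length-replicate r3)))) (twoOnes-length-arith r1 r2 r3))

isBinary-zeros-++ : ∀ r L → isBinary (zeros r ++ L) ≡ isBinary L
isBinary-zeros-++ zero L = refl
isBinary-zeros-++ (suc r) L = isBinary-zeros-++ r L

isBinary-twoOnes : ∀ r1 r2 r3 → isBinary (twoOnes r1 r2 r3) ≡ true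
isBinary-twoOnes r1 r2 r3 = trans (isBinary-zeros-++ r1 _) (trans (isBinary-zeros-++ r2 _) (bz r3))
  where bz : ∀ r → isBinary (zeros r) ≡ true
        bz zero = refl
        bz (suc r) = bz r

sum-zeros-++ : ∀ r L → sumℕ (zeros r ++ L) ≡ sumℕ L
sum-zeros-++ zero L = refl
sum-zeros-++ (suc r) L = sum-zeros-++ r L

sum-twoOnes : ∀ r1 r2 r3 → sumℕ (twoOnes r1 r2 r3) ≡ 2
sum-twoOnes r1 r2 r3 = trans (sum-zeros-++ r1 _) (cong suc (trans (sum-zeros-++ r2 _) (cong suc (sz r3))))
  where sz : ∀ r → sumℕ (zeros r) ≡ 0
        sz zero = refl
        sz (suc r) = sz r

countOnes-zeros-++ : ∀ r L → countOnes (zeros r ++ L) ≡ countOnes L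
countOnes-zeros-++ zero L = refl
countOnes-zeros-++ (suc r) L = countOnes-zeros-++ r L

countOnes-twoOnes : ∀ r1 r2 r3 → countOnes (twoOnes r1 r2 r3) ≡ 2
countOnes-twoOnes r1 r2 r3 = trans (countOnes-zeros-++ r1 _)
    (cong suc (trans (countOnes-zeros-++ r2 _) (cong suc (cz r3))))
  where cz : ∀ r → countOnes (zeros r) ≡ 0
        cz zero = refl
        cz (suc r) = cz r

twoOnes-injective : ∀ a b c a' b' c' → twoOnes a b c ≡ twoOnes a' b' c' → a ≡ a' × b ≡ b' × c ≡ c'
twoOnes-injective (suc a) b c (suc a') b' c' e with twoOnes-injective a b c a' b' c' (List.∷-injectiveʳ e)
... | p , q , r = cong suc p , q , r
twoOnes-injective zero b c zero b' c' e = refl , zeros-1∷zeros-injective b c b' c' (List.∷-injectiveʳ e)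
  where
  zeros-1∷zeros-injective : ∀ b c b' c' → zeros b ++ 1 ∷ zeros c ≡ zeros b' ++ 1 ∷ zeros c' → b ≡ b' × c ≡ c'
  zeros-1∷zeros-injective zero c zero c' e
      = refl , trans (sym (List.length-replicate c))
      (trans (cong length (List.∷-injectiveʳ e)) (List.length-replicate c'))
  zeros-1∷zeros-injective (suc b) c (suc b') c' e with zeros-1∷zeros-injective b c b' c' (List.∷-injectiveʳ e)
  ... | p , q = cong suc p , q
  zeros-1∷zeros-injective zero c (suc b') c' ()
  zeros-1∷zeros-injective (suc b) c zero c' ()
twoOnes-injective zero b c (suc a') b' c' ()
twoOnes-injective (suc a) b c zero b' c' ()

zOffset-zeros-++ : ∀ r L → zOffset (zeros r ++ L) ≡ r + zOffset L
zOffset-zeros-++ zero L = refl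
zOffset-zeros-++ (suc r) L = cong suc (zOffset-zeros-++ r L)

zOffset-zeros : ∀ r → zOffset (zeros r) ≡ r + 1
zOffset-zeros zero = refl
zOffset-zeros (suc r) = cong suc (zOffset-zeros r)

zOffset-twoOnes : ∀ r1 r2 r3 → zOffset (twoOnes r1 r2 r3) ≡ r1 + r2 + r3 + 1
zOffset-twoOnes r1 r2 r3 = trans (zOffset-zeros-++ r1 _)
    (trans (cong (r1 +_) (trans (zOffset-zeros-++ r2 _) (cong (r2 +_) (zOffset-zeros r3)))) (ar r1 r2 r3))
  where ar : ∀ r1 r2 r3 → r1 + (r2 + (r3 + 1)) ≡ r1 + r2 + r3 + 1
        ar = ℕSolver.solve-∀

qOffsetFrom-0∷ : ∀ o Y → qOffsetFrom o (0 ∷ Y) ≡ 2 * o + 2 + qOffsetFrom (3 + o) Y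
qOffsetFrom-0∷ o Y = step o (weightStep (3 + o) (lowerFirsts Y)) (weightStep (3 + suc o) Y)
    (weightStep (3 + (2 + o)) (lowerThirds Y))
  where
  step : ∀ o a b c → o * 1 + a + (suc o * 0 + b) + ((2 + o) * 1 + c) ≡ 2 * o + 2 + (a + b + c)
  step = ℕSolver.solve-∀

qOffsetFrom-1∷ : ∀ o Y → qOffsetFrom o (1 ∷ Y) ≡ suc o + qOffsetFrom (3 + o) Y
qOffsetFrom-1∷ o Y = step o (weightStep (3 + o) (lowerFirsts Y)) (weightStep (3 + suc o) Y)
    (weightStep (3 + (2 + o)) (lowerThirds Y))
  where
  step : ∀ o a b c → o * 0 + a + (suc o * 1 + b) + ((2 + o) * 0 + c) ≡ suc o + (a + b + c)
  step = ℕSolver.solve-∀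

qOffsetFrom-[] : ∀ o → qOffsetFrom o [] ≡ o
qOffsetFrom-[] o = trans (+-identityʳ _) (trans (+-identityʳ _) (trans (+-identityʳ _) (*-identityʳ o)))

-- Stated with r added to the left-hand side so that no subtraction occurs.
qOffsetFrom-zeros-++ : ∀ o r Y → qOffsetFrom o (zeros r ++ Y) + r
    ≡ 2 * o * r + 3 * r * r + qOffsetFrom (o + 3 * r) Y
qOffsetFrom-zeros-++ o zero Y =
  trans (+-identityʳ _) (sym (cong₂ _+_ (vanish o) (cong (λ o′ → qOffsetFrom o′ Y) (+-identityʳ o))))
  where
  vanish : ∀ o → 2 * o * 0 + 3 * 0 * 0 ≡ 0
  vanish = ℕSolver.solve-∀
qOffsetFrom-zeros-++ o (suc r) Y = begin
  qOffsetFrom o (0 ∷ zeros r ++ Y) + suc r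
    ≡⟨ cong (_+ suc r) (qOffsetFrom-0∷ o (zeros r ++ Y)) ⟩
  2 * o + 2 + qOffsetFrom (3 + o) (zeros r ++ Y) + suc r
    ≡⟨ regroup o (qOffsetFrom (3 + o) (zeros r ++ Y)) r ⟩
  2 * o + 3 + (qOffsetFrom (3 + o) (zeros r ++ Y) + r)
    ≡⟨ cong (2 * o + 3 +_) (qOffsetFrom-zeros-++ (3 + o) r Y) ⟩
  2 * o + 3 + (2 * (3 + o) * r + 3 * r * r + qOffsetFrom (3 + o + 3 * r) Y)
    ≡⟨ +-assoc (2 * o + 3) _ _ ⟨
  2 * o + 3 + (2 * (3 + o) * r + 3 * r * r) + qOffsetFrom (3 + o + 3 * r) Y
    ≡⟨ cong₂ _+_ (expand o r) (cong (λ o′ → qOffsetFrom o′ Y) (offset o r)) ⟩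
  2 * o * suc r + 3 * suc r * suc r + qOffsetFrom (o + 3 * suc r) Y ∎
  where
  open ≡-Reasoning
  regroup : ∀ o q r → 2 * o + 2 + q + suc r ≡ 2 * o + 3 + (q + r)
  regroup = ℕSolver.solve-∀
  expand : ∀ o r → 2 * o + 3 + (2 * (3 + o) * r + 3 * r * r) ≡ 2 * o * suc r + 3 * suc r * suc r
  expand = ℕSolver.solve-∀
  offset : ∀ o r → 3 + o + 3 * r ≡ o + 3 * suc r
  offset = ℕSolver.solve-∀


+-chain : ∀ a b c d e r s → a + r ≡ c + b → b + s ≡ d + e → a + (r + s) ≡ c + d + e
+-chain a b c d e r s p q = begin
  a + (r + s)   ≡⟨ +-assoc a r s ⟨
  a + r + s     ≡⟨ cong (_+ s) p ⟩
  c + b + s     ≡⟨ +-assoc c b s ⟩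
  c + (b + s)   ≡⟨ cong (c +_) q ⟩
  c + (d + e)   ≡⟨ +-assoc c d e ⟨
  c + d + e     ∎
  where open ≡-Reasoning

qOffsetFrom-1∷zeros-++ : ∀ o r Y →
  qOffsetFrom o (1 ∷ zeros r ++ Y) + r ≡ suc o + 2 * (3 + o) * r + 3 * r * r + qOffsetFrom (3 + o + 3 * r) Y
qOffsetFrom-1∷zeros-++ o r Y = begin
  qOffsetFrom o (1 ∷ zeros r ++ Y) + r
    ≡⟨ cong (_+ r) (qOffsetFrom-1∷ o (zeros r ++ Y)) ⟩
  suc o + qOffsetFrom (3 + o) (zeros r ++ Y) + r
    ≡⟨ +-assoc (suc o) _ r ⟩
  suc o + (qOffsetFrom (3 + o) (zeros r ++ Y) + r)
    ≡⟨ cong (suc o +_) (qOffsetFrom-zeros-++ (3 + o) r Y) ⟩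
  suc o + (2 * (3 + o) * r + 3 * r * r + qOffsetFrom (3 + o + 3 * r) Y)
    ≡⟨ +-assoc (suc o) (2 * (3 + o) * r + 3 * r * r) _ ⟨
  suc o + (2 * (3 + o) * r + 3 * r * r) + qOffsetFrom (3 + o + 3 * r) Y
    ≡⟨ cong (_+ qOffsetFrom (3 + o + 3 * r) Y) (+-assoc (suc o) (2 * (3 + o) * r) (3 * r * r)) ⟨
  suc o + 2 * (3 + o) * r + 3 * r * r + qOffsetFrom (3 + o + 3 * r) Y ∎
  where open ≡-Reasoning

qOffset-twoOnes : ∀ r₁ r₂ r₃ → qOffset (twoOnes r₁ r₂ r₃) + (6 * r₁ + 3 * r₂ + 7) ≡ gExponent (r₁ + r₂ + r₃ + 2)
qOffset-twoOnes r₁ r₂ r₃ = +-cancelʳ-≡ (r₁ + (r₂ + r₃)) _ _ (begin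
  qOffset Y + (6 * r₁ + 3 * r₂ + 7) + (r₁ + (r₂ + r₃))
    ≡⟨ +-shuffle (qOffset Y) (6 * r₁ + 3 * r₂ + 7) (r₁ + (r₂ + r₃)) ⟩
  qOffset Y + (r₁ + (r₂ + r₃)) + (6 * r₁ + 3 * r₂ + 7)
    ≡⟨ cong (_+ (6 * r₁ + 3 * r₂ + 7)) blocks ⟩
  c₁ + (c₂ + c₃) + o₃ + (6 * r₁ + 3 * r₂ + 7)
    ≡⟨ closed-form r₁ r₂ r₃ ⟩
  gExponent (r₁ + r₂ + r₃ + 2) + (r₁ + (r₂ + r₃)) ∎)
  where
  open ≡-Reasoning
  Y = twoOnes r₁ r₂ r₃
  o₁ = 1 + 3 * r₁
  o₂ = 3 + o₁ + 3 * r₂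
  o₃ = 3 + o₂ + 3 * r₃
  c₁ = 2 * 1 * r₁ + 3 * r₁ * r₁
  c₂ = suc o₁ + 2 * (3 + o₁) * r₂ + 3 * r₂ * r₂
  c₃ = suc o₂ + 2 * (3 + o₂) * r₃ + 3 * r₃ * r₃
  blocks : qOffset Y + (r₁ + (r₂ + r₃)) ≡ c₁ + (c₂ + c₃) + o₃
  blocks =
    +-chain (qOffset Y) (qOffsetFrom o₁ (1 ∷ zeros r₂ ++ 1 ∷ zeros r₃)) c₁ (c₂ + c₃) o₃ r₁ (r₂ + r₃)
      (qOffsetFrom-zeros-++ 1 r₁ (1 ∷ zeros r₂ ++ 1 ∷ zeros r₃))
      (+-chain (qOffsetFrom o₁ (1 ∷ zeros r₂ ++ 1 ∷ zeros r₃)) (qOffsetFrom o₂ (1 ∷ zeros r₃)) c₂ c₃ o₃ r₂ r₃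
        (qOffsetFrom-1∷zeros-++ o₁ r₂ (1 ∷ zeros r₃))
        (trans (cong (λ l → qOffsetFrom o₂ (1 ∷ l) + r₃) (sym (List.++-identityʳ (zeros r₃))))
          (trans (qOffsetFrom-1∷zeros-++ o₂ r₃ []) (cong (c₃ +_) (qOffsetFrom-[] o₃)))))
  +-shuffle : ∀ a b c → a + b + c ≡ a + c + b
  +-shuffle = ℕSolver.solve-∀
  closed-form : ∀ r₁ r₂ r₃ →
    2 * 1 * r₁ + 3 * r₁ * r₁ + ((1 + (1 + 3 * r₁) + 2 * (3 + (1 + 3 * r₁)) * r₂ + 3 * r₂ * r₂)
      + (1 + (3 + (1 + 3 * r₁) + 3 * r₂) + 2 * (3 + (3 + (1 + 3 * r₁) + 3 * r₂)) * r₃ + 3 * r₃ * r₃))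
          + (3 + (3 + (1 + 3 * r₁) + 3 * r₂) + 3 * r₃) + (6 * r₁ + 3 * r₂ + 7)
    ≡ 3 * (r₁ + r₂ + r₃ + 2) * (r₁ + r₂ + r₃ + 2) + 4 * (r₁ + r₂ + r₃ + 2) + 1 + (r₁ + (r₂ + r₃))
  closed-form = ℕSolver.solve-∀

noAdjacentOnes : List ℕ → Bool
noAdjacentOnes [] = true
noAdjacentOnes (y ∷ Y) = not ((y ≡ᵇ 1) ∧ (head0 Y ≡ᵇ 1)) ∧ noAdjacentOnes Y

noAdjacentOnes⇒adjacencyOK : ∀ X Y W → noAdjacentOnes Y ≡ true → adjacencyOK X Y W ≡ true
noAdjacentOnes⇒adjacencyOK [] Y W e = refl
noAdjacentOnes⇒adjacencyOK (x ∷ X) [] W e = refl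
noAdjacentOnes⇒adjacencyOK (x ∷ X) (y ∷ Y) [] e = refl
noAdjacentOnes⇒adjacencyOK (x ∷ X) (y ∷ Y) (w ∷ W) e with y ≡ᵇ 1 | head0 Y ≡ᵇ 1
... | false | _ = noAdjacentOnes⇒adjacencyOK X Y W e
... | true | false = noAdjacentOnes⇒adjacencyOK X Y W e
... | true | true = ⊥-elim (false≢true e)

noAdjacentOnes-zeros-++ : ∀ r L → noAdjacentOnes (zeros r ++ L) ≡ noAdjacentOnes L
noAdjacentOnes-zeros-++ zero L = refl
noAdjacentOnes-zeros-++ (suc r) L = noAdjacentOnes-zeros-++ r L

noAdjacentOnes-zeros : ∀ r → noAdjacentOnes (zeros r) ≡ true
noAdjacentOnes-zeros zero = refl
noAdjacentOnes-zeros (suc r) = noAdjacentOnes-zeros r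

noAdjacentOnes-1∷zeros : ∀ r → noAdjacentOnes (1 ∷ zeros r) ≡ true
noAdjacentOnes-1∷zeros zero = refl
noAdjacentOnes-1∷zeros (suc r) = noAdjacentOnes-zeros r

noAdjacentOnes-twoOnes : ∀ r1 r2 r3 → noAdjacentOnes (twoOnes r1 (suc r2) r3) ≡ true
noAdjacentOnes-twoOnes r1 r2 r3 = trans (noAdjacentOnes-zeros-++ r1 _)
    (trans (noAdjacentOnes-zeros-++ r2 (1 ∷ zeros r3)) (noAdjacentOnes-1∷zeros r3))

lookup0 : List ℕ → ℕ → ℕ
lookup0 [] _ = 0
lookup0 (x ∷ l) zero = x
lookup0 (x ∷ l) (suc i) = lookup0 l i

adjacencyOK-adjacent : ∀ r1 r3 X W → length X ≡ suc (length (twoOnes r1 0 r3))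
    → length W ≡ length (twoOnes r1 0 r3) →
  adjacencyOK X (twoOnes r1 0 r3) W ≡ not ((lookup0 W r1 ≡ᵇ 0) ∧ (lookup0 X (suc r1) ≡ᵇ 0))
adjacencyOK-adjacent (suc r) r3 (x ∷ X) (w ∷ W) e1 e2
    = adjacencyOK-adjacent r r3 X W (suc-injective e1) (suc-injective e2)
adjacencyOK-adjacent zero r3 (x ∷ x' ∷ X) (w ∷ w' ∷ W) e1 e2 =
  trans (cong (not ((w ≡ᵇ 0) ∧ (x' ≡ᵇ 0)) ∧_)
      (trans (cong (_∧ adjacencyOK X (zeros r3) W) (hdz r3))
      (noAdjacentOnes⇒adjacencyOK X (zeros r3) W (noAdjacentOnes-zeros r3)))) (∧-identityʳ _)
  where hdz : ∀ r3 → not (true ∧ (head0 (zeros r3) ≡ᵇ 1) ∧ (w' ≡ᵇ 0) ∧ (head0 X ≡ᵇ 0)) ≡ true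
        hdz zero = refl
        hdz (suc r) = refl
adjacencyOK-adjacent zero r3 (x ∷ []) (w ∷ w' ∷ W) () e2
adjacencyOK-adjacent zero r3 (x ∷ x' ∷ X) (w ∷ []) e1 ()

lookup0-zipWith-+ : ∀ u L i → length u ≡ length L → lookup0 (zipWith _+_ u L) i ≡ lookup0 u i + lookup0 L i
lookup0-zipWith-+ [] [] i e = refl
lookup0-zipWith-+ (x ∷ u) (l ∷ L) zero e = refl
lookup0-zipWith-+ (x ∷ u) (l ∷ L) (suc i) e = lookup0-zipWith-+ u L i (suc-injective e)

lookup0-take : ∀ k (t : List ℕ) i → i < k → lookup0 (take k t) i ≡ lookup0 t i
lookup0-take (suc k) [] i p = refl
lookup0-take (suc k) (x ∷ t) zero p = refl
lookup0-take (suc k) (x ∷ t) (suc i) (s≤s p) = lookup0-take k t i p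

lookup0-drop : ∀ k (t : List ℕ) i → lookup0 (drop k t) i ≡ lookup0 t (k + i)
lookup0-drop zero t i = refl
lookup0-drop (suc k) [] i = refl
lookup0-drop (suc k) (x ∷ t) i = lookup0-drop k t i

lookup0-lowerFirsts-adjacent : ∀ r1 r3 → lookup0 (lowerFirsts (twoOnes r1 0 r3)) (suc r1) ≡ 0
lookup0-lowerFirsts-adjacent zero r3 = refl
lookup0-lowerFirsts-adjacent (suc r) r3 = lookup0-lowerFirsts-adjacent r r3

lookup0-lowerThirds-adjacent : ∀ r1 r3 → lookup0 (lowerThirds (twoOnes r1 0 r3)) r1 ≡ 0
lookup0-lowerThirds-adjacent zero r3 = refl
lookup0-lowerThirds-adjacent (suc r) r3 = lookup0-lowerThirds-adjacent r r3




incAt : ℕ → List ℕ → List ℕ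
incAt p [] = []
incAt zero (x ∷ l) = suc x ∷ l
incAt (suc p) (x ∷ l) = x ∷ incAt p l

decAt : ℕ → List ℕ → List ℕ
decAt p [] = []
decAt zero (x ∷ l) = ℕ.pred x ∷ l
decAt (suc p) (x ∷ l) = x ∷ decAt p l

lookupWeight : List (ℕ × ℕ) → ℕ → ℕ × ℕ
lookupWeight [] _ = 0 , 0
lookupWeight (w ∷ ws) zero = w
lookupWeight (w ∷ ws) (suc i) = lookupWeight ws i

length-incAt : ∀ p t → length (incAt p t) ≡ length t
length-incAt p [] = refl
length-incAt zero (x ∷ t) = refl
length-incAt (suc p) (x ∷ t) = cong suc (length-incAt p t)

length-decAt : ∀ p t → length (decAt p t) ≡ length t
length-decAt p [] = refl
length-decAt zero (x ∷ t) = refl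
length-decAt (suc p) (x ∷ t) = cong suc (length-decAt p t)

decAt-incAt : ∀ p t → decAt p (incAt p t) ≡ t
decAt-incAt p [] = refl
decAt-incAt zero (x ∷ t) = refl
decAt-incAt (suc p) (x ∷ t) = cong (x ∷_) (decAt-incAt p t)

incAt-decAt : ∀ p t → (lookup0 t p ≡ᵇ 0) ≡ false → incAt p (decAt p t) ≡ t
incAt-decAt p [] e = refl
incAt-decAt zero (suc x ∷ t) e = refl
incAt-decAt (suc p) (x ∷ t) e = cong (x ∷_) (incAt-decAt p t e)

lookup0-incAt-same : ∀ p t → p < length t → lookup0 (incAt p t) p ≡ suc (lookup0 t p)
lookup0-incAt-same zero (x ∷ t) _ = refl
lookup0-incAt-same (suc p) (x ∷ t) (s≤s q) = lookup0-incAt-same p t q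

lookup0-incAt-other : ∀ p q t → p ≢ q → lookup0 (incAt p t) q ≡ lookup0 t q
lookup0-incAt-other p q [] ne = refl
lookup0-incAt-other zero zero (x ∷ t) ne = ⊥-elim (ne refl)
lookup0-incAt-other zero (suc q) (x ∷ t) ne = refl
lookup0-incAt-other (suc p) zero (x ∷ t) ne = refl
lookup0-incAt-other (suc p) (suc q) (x ∷ t) ne = lookup0-incAt-other p q t (λ e → ne (cong suc e))

All≤-decAt : ∀ {m} p t → All (_≤ m) t → All (_≤ m) (decAt p t)
All≤-decAt p [] a = a
All≤-decAt zero (x ∷ t) (q ∷ a) = ≤-trans pred-≤ q ∷ a
  where pred-≤ : ℕ.pred x ≤ x
        pred-≤ = pred[n]≤n
All≤-decAt (suc p) (x ∷ t) (q ∷ a) = q ∷ All≤-decAt p t a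

+-rotate : ∀ a ax r → a + ax + r ≡ ax + r + a
+-rotate = ℕSolver.solve-∀

zDeg-incAt : ∀ ws p t → p < length t → length t ≡ length ws
    → zDeg ws (incAt p t) ≡ zDeg ws t + proj₁ (lookupWeight ws p)
zDeg-incAt ((a , b) ∷ ws) zero (x ∷ t) _ _
    = trans (cong (_+ zDeg ws t) (*-suc a x)) (+-rotate a (a * x) (zDeg ws t))
zDeg-incAt ((a , b) ∷ ws) (suc p) (x ∷ t) (s≤s q) e
    = trans (cong (a * x +_) (zDeg-incAt ws p t q (suc-injective e))) (sym (+-assoc (a * x) _ _))

qDeg-incAt : ∀ ws p t → p < length t → length t ≡ length ws
    → qDeg ws (incAt p t) ≡ qDeg ws t + proj₂ (lookupWeight ws p)
qDeg-incAt ((a , b) ∷ ws) zero (x ∷ t) _ _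
    = trans (cong (_+ qDeg ws t) (*-suc b x)) (+-rotate b (b * x) (qDeg ws t))
qDeg-incAt ((a , b) ∷ ws) (suc p) (x ∷ t) (s≤s q) e
    = trans (cong (b * x +_) (qDeg-incAt ws p t q (suc-injective e))) (sym (+-assoc (b * x) _ _))

+-shift : ∀ x x' A a → x ≡ x' + a → x + A ≡ x' + (A + a)
+-shift x x' A a e = trans (cong (_+ A) e) (sh x' a A)
  where sh : ∀ x a A → x + a + A ≡ x + (A + a)
        sh = ℕSolver.solve-∀

not≡ᵇ0 : ∀ k → not (k ≡ᵇ 0) ≡ true → (k ≡ᵇ 0) ≡ false
not≡ᵇ0 (suc k) e = refl

module _ (ws : List (ℕ × ℕ)) (p : ℕ) (R : List ℕ → Bool) (A B : ℕ) (j : ℤ) (m : ℕ)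
         (p< : p < length ws) (pw : QPositive ws) where

  private
    L = length ws
    a = proj₁ (lookupWeight ws p)
    b = proj₂ (lookupWeight ws p)
    P = λ t → not (lookup0 t p ≡ᵇ 0) ∧ (R t ∧ IsShiftedSolution ws A B j m t)
    Q = λ t → R (incAt p t) ∧ IsShiftedSolution ws (A + a) (B + b) j m t
    decAt-ok : ∀ t → InBox L m t → P t ≡ true
        → InBox L m (decAt p t) × Q (decAt p t) ≡ true × incAt p (decAt p t) ≡ t
    decAt-ok t (lt , at') pt = (trans (length-decAt p t) lt , All≤-decAt p t at') , qd , itd
      where
      nzt = not≡ᵇ0 (lookup0 t p) (proj₁ (∧≡true {not (lookup0 t p ≡ᵇ 0)} pt))
      itd = incAt-decAt p t nzt
      ld : p < length (decAt p t)
      ld = subst (p <_) (sym (trans (length-decAt p t) lt)) p<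
      ldw : length (decAt p t) ≡ length ws
      ldw = trans (length-decAt p t) lt
      eA : zDeg ws t ≡ zDeg ws (decAt p t) + a
      eA = trans (cong (zDeg ws) (sym itd)) (zDeg-incAt ws p (decAt p t) ld ldw)
      eB : qDeg ws t ≡ qDeg ws (decAt p t) + b
      eB = trans (cong (qDeg ws) (sym itd)) (qDeg-incAt ws p (decAt p t) ld ldw)
      qd : Q (decAt p t) ≡ true
      qd = trans (cong₂ _∧_ (cong R itd)
          (cong₂ (λ u v → ℕ≡ᵇℤ u j ∧ (v ≡ᵇ m)) (sym (+-shift _ _ A a eA)) (sym (+-shift _ _ B b eB))))
                 (proj₂ (∧≡true {not (lookup0 t p ≡ᵇ 0)} pt))
    incAt-ok : ∀ t → InBox L m t → Q t ≡ true
        → InBox L m (incAt p t) × P (incAt p t) ≡ true × decAt p (incAt p t) ≡ t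
    incAt-ok t (lt , at') qt = (li , alli) , pi , decAt-incAt p t
      where
      li : length (incAt p t) ≡ L
      li = trans (length-incAt p t) lt
      lp : p < length t
      lp = subst (p <_) (sym lt) p<
      eA : zDeg ws (incAt p t) ≡ zDeg ws t + a
      eA = zDeg-incAt ws p t lp lt
      eB : qDeg ws (incAt p t) ≡ qDeg ws t + b
      eB = qDeg-incAt ws p t lp lt
      psq = proj₂ (∧≡true {R (incAt p t)} qt)
      wm : qDeg ws t + (B + b) ≡ m
      wm = ≡ᵇ⇒≡ᵗ _ m (proj₂ (∧≡true {ℕ≡ᵇℤ (zDeg ws t + (A + a)) j} psq))
      bnd : qDeg ws (incAt p t) ≤ m
      bnd = subst (_≤ m) (sym eB) (≤-trans (+-monoʳ-≤ (qDeg ws t) (m≤n+m b B)) (≤-reflexive wm))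
      alli : All (_≤ m) (incAt p t)
      alli = All-≤-weaken bnd (All≤qDeg ws (incAt p t) pw li)
      zi : (lookup0 (incAt p t) p ≡ᵇ 0) ≡ false
      zi = cong (_≡ᵇ 0) (lookup0-incAt-same p t lp)
      pi : P (incAt p t) ≡ true
      pi = trans (cong₂ _∧_ (cong not zi)
          (cong (R (incAt p t) ∧_) (cong₂ (λ u v → ℕ≡ᵇℤ u j ∧ (v ≡ᵇ m)) (+-shift _ _ A a eA)
          (+-shift _ _ B b eB)))) qt

  -- Lowering a nonzero entry at position p by one shifts the degrees by the weight at p.
  countB-nonzeroAt≡shifted :
    countB (λ t → not (lookup0 t p ≡ᵇ 0) ∧ (R t ∧ IsShiftedSolution ws A B j m t)) (tuples (length ws) m)
    ≡ countB (λ t → R (incAt p t) ∧ IsShiftedSolution ws (A + proj₁ (lookupWeight ws p))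
        (B + proj₂ (lookupWeight ws p)) j m t)
             (tuples (length ws) m)
  countB-nonzeroAt≡shifted = countB-tuples-bijection P Q L m L m (decAt p) (incAt p) decAt-ok incAt-ok

countDiffsWith≡countFreeSolutions : ∀ Y m j → isBinary Y ≡ true → sumℕ Y ≡ 2 → countOnes Y ≡ 2 →
  countB (IsCountedDiffsWith m j Y) (tuples (suc (3 * length Y)) m)
      ≡ countB (IsFreeSolution Y m j) (tuples (length (pochWeights (length Y))) m)
countDiffsWith≡countFreeSolutions Y m j bY sY cY
    = trans (countDiffsWith≡countFree Y m j bY)
    (trans (countB-cong-tuples (suc n + n) m _ _
    (λ t (lt , _) → IsCountedDiffsWith-fromFree Y t lt m j bY sY cY))
    (cong (λ L → countB (IsFreeSolution Y m j) (tuples L m)) (sym (length-pochWeights n))))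
  where n = length Y

separatedCount≡shiftedCount : ∀ r1 r2 r3 m j → let Y = twoOnes r1 (suc r2) r3 in
  countB (IsCountedDiffsWith m j Y) (tuples (suc (3 * length Y)) m)
      ≡ shiftedCount (pochWeights (length Y)) (zOffset Y) (qOffset Y) j (ℤ.+ m)
separatedCount≡shiftedCount r1 r2 r3 m j
    = trans (countDiffsWith≡countFreeSolutions Y m j (isBinary-twoOnes r1 (suc r2) r3)
    (sum-twoOnes r1 (suc r2) r3) (countOnes-twoOnes r1 (suc r2) r3))
   (countB-cong-tuples (length (pochWeights (length Y))) m (IsFreeSolution Y m j)
       (IsShiftedSolution (pochWeights (length Y)) (zOffset Y) (qOffset Y) j m)
       (λ t _ → cong (_∧ IsShiftedSolution (pochWeights (length Y)) (zOffset Y) (qOffset Y) j m t)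
       (noAdjacentOnes⇒adjacencyOK (zipWith _+_ (take (suc (length Y)) t) (lowerFirsts Y)) Y
       (zipWith _+_ (drop (suc (length Y)) t) (lowerThirds Y)) (noAdjacentOnes-twoOnes r1 r2 r3))))
  where Y = twoOnes r1 (suc r2) r3

lookupWeight-applyUpTo : ∀ (h : ℕ → ℕ × ℕ) (f : ℕ → ℕ) N i → i < N
    → lookupWeight (map h (applyUpTo f N)) i ≡ h (f i)
lookupWeight-applyUpTo h f (suc N) zero _ = refl
lookupWeight-applyUpTo h f (suc N) (suc i) (s≤s p) = lookupWeight-applyUpTo h (λ x → f (suc x)) N i p

lookupWeight-++ˡ : ∀ U V i → i < length U → lookupWeight (U ++ V) i ≡ lookupWeight U i
lookupWeight-++ˡ (u ∷ U) V zero _ = refl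
lookupWeight-++ˡ (u ∷ U) V (suc i) (s≤s p) = lookupWeight-++ˡ U V i p

lookupWeight-++ʳ : ∀ U V i → lookupWeight (U ++ V) (length U + i) ≡ lookupWeight V i
lookupWeight-++ʳ [] V i = refl
lookupWeight-++ʳ (u ∷ U) V i = lookupWeight-++ʳ U V i

lookupWeight-pochZ : ∀ n r → r < n → lookupWeight (pochWeights n) (suc r) ≡ (1 , 3 * suc r + 1)
lookupWeight-pochZ n r r<n = trans (lookupWeight-++ˡ (pochZWeights n) (pochQWeights n) (suc r)
    (subst (suc r <_) (sym (length-pochZWeights n)) (s≤s r<n)))
                      (lookupWeight-applyUpTo (λ i → (1 , 3 * i + 1)) (λ i → i) (suc n) (suc r) (s≤s r<n))

lookupWeight-pochQ : ∀ n r → r < n → lookupWeight (pochWeights n) (suc n + r) ≡ (0 , 3 * r + 3)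
lookupWeight-pochQ n r r<n = trans (cong (lookupWeight (pochWeights n))
    (cong (_+ r) (sym (length-pochZWeights n)))) (trans (lookupWeight-++ʳ (pochZWeights n) (pochQWeights n) r)
                      (lookupWeight-applyUpTo (λ i → (0 , 3 * i + 3)) (λ i → i) n r r<n))

adjacent-length-arith : ∀ r1 r3 → r1 + 0 + r3 + 2 ≡ suc (r1 + suc r3)
adjacent-length-arith = ℕSolver.solve-∀

IsFreeSolution-adjacent : ∀ r1 r3 m j t
    → let Y = twoOnes r1 0 r3 ; n = length Y in length t ≡ length (pochWeights n) →
  IsFreeSolution Y m j t ≡ not ((lookup0 t (suc n + r1) ≡ᵇ 0) ∧ (lookup0 t (suc r1) ≡ᵇ 0))
      ∧ IsShiftedSolution (pochWeights n) (zOffset Y) (qOffset Y) j m t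
IsFreeSolution-adjacent r1 r3 m j t lt0
    = cong (_∧ IsShiftedSolution (pochWeights n) (zOffset Y) (qOffset Y) j m t)
    (trans (adjacencyOK-adjacent r1 r3 X W lX lW) (cong not (cong₂ _∧_ (cong (_≡ᵇ 0) eW) (cong (_≡ᵇ 0) eX))))
  where
  Y = twoOnes r1 0 r3
  n = length Y
  lt : length t ≡ suc n + n
  lt = trans lt0 (length-pochWeights n)
  u = take (suc n) t
  v = drop (suc n) t
  lu : length u ≡ suc n
  lu = length-take′ (suc n) n t lt
  lv : length v ≡ n
  lv = length-drop′ (suc n) n t lt
  luL : length u ≡ length (lowerFirsts Y)
  luL = trans lu (sym (length-lowerFirsts Y))
  lvL : length v ≡ length (lowerThirds Y)
  lvL = trans lv (sym (length-lowerThirds Y))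
  X = zipWith _+_ u (lowerFirsts Y)
  W = zipWith _+_ v (lowerThirds Y)
  lX : length X ≡ suc (length Y)
  lX = trans (length-zipWith′ _+_ u (lowerFirsts Y) luL) lu
  lW : length W ≡ length Y
  lW = trans (length-zipWith′ _+_ v (lowerThirds Y) lvL) lv
  r1<n : r1 < n
  r1<n = subst (r1 <_) (sym (trans (length-twoOnes r1 0 r3) (adjacent-length-arith r1 r3)))
      (s≤s (m≤m+n r1 (suc r3)))
  eW : lookup0 W r1 ≡ lookup0 t (suc n + r1)
  eW = trans (lookup0-zipWith-+ v (lowerThirds Y) r1 lvL)
      (trans (cong (lookup0 v r1 +_) (lookup0-lowerThirds-adjacent r1 r3))
      (trans (+-identityʳ _) (lookup0-drop (suc n) t r1)))
  eX : lookup0 X (suc r1) ≡ lookup0 t (suc r1)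
  eX = trans (lookup0-zipWith-+ u (lowerFirsts Y) (suc r1) luL)
      (trans (cong (lookup0 u (suc r1) +_) (lookup0-lowerFirsts-adjacent r1 r3))
      (trans (+-identityʳ _) (lookup0-take (suc n) t (suc r1) (s≤s r1<n))))

𝟙-inclusion-exclusion : ∀ v u p → 𝟙 (not (v ∧ u) ∧ p) + 𝟙 (not v ∧ (not u ∧ p))
    ≡ 𝟙 (not v ∧ (true ∧ p)) + 𝟙 (not u ∧ (true ∧ p))
𝟙-inclusion-exclusion true true p = refl
𝟙-inclusion-exclusion true false true = refl
𝟙-inclusion-exclusion true false false = refl
𝟙-inclusion-exclusion false true true = refl
𝟙-inclusion-exclusion false true false = refl
𝟙-inclusion-exclusion false false true = refl
𝟙-inclusion-exclusion false false false = refl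

countB-+ : {X : Set} (P Q P' Q' : X → Bool) (l : List X) → (∀ x → 𝟙 (P x) + 𝟙 (Q x) ≡ 𝟙 (P' x) + 𝟙 (Q' x)) →
  countB P l + countB Q l ≡ countB P' l + countB Q' l
countB-+ P Q P' Q' l h = trans (cong₂ _+_ (countB≡∑𝟙 P l) (countB≡∑𝟙 Q l)) (trans (sym (∑-+ l _ _))
  (trans (∑-cong l h) (trans (∑-+ l _ _) (sym (cong₂ _+_ (countB≡∑𝟙 P' l) (countB≡∑𝟙 Q' l))))))

module _ (r1 r3 m : ℕ) (j : ℤ) where

  private
    Y = twoOnes r1 0 r3
    n = length Y
    ws = pochWeights n
    A0 = zOffset Y
    B0 = qOffset Y
    L = length ws
    T = tuples L m
    p = suc r1
    q = suc n + r1
    V = λ t → lookup0 t q ≡ᵇ 0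
    U = λ t → lookup0 t p ≡ᵇ 0
    P0 = IsShiftedSolution ws A0 B0 j m
    r1<n : r1 < n
    r1<n = subst (r1 <_) (sym (trans (length-twoOnes r1 0 r3) (adjacent-length-arith r1 r3)))
        (s≤s (m≤m+n r1 (suc r3)))
    pw = QPositive-pochWeights n
    p< : p < L
    p< = subst (p <_) (sym (length-pochWeights n)) (≤-trans (s≤s r1<n) (m≤m+n (suc n) n))
    q< : q < L
    q< = subst (q <_) (sym (length-pochWeights n))
        (≤-trans (≤-reflexive (sym (+-suc (suc n) r1))) (+-monoʳ-≤ (suc n) r1<n))
    ap = lookupWeight-pochZ n r1 r1<n
    aq = lookupWeight-pochQ n r1 r1<n
    p≢q : p ≢ q
    p≢q e = <-irrefl (suc-injective e) (≤-trans r1<n (m≤m+n n r1) )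
    nonzeroAt-q : countB (λ t → not (V t) ∧ (true ∧ P0 t)) T
        ≡ shiftedCount ws (A0 + 0) (B0 + (3 * r1 + 3)) j (ℤ.+ m)
    nonzeroAt-q = trans (countB-nonzeroAt≡shifted ws q (λ _ → true) A0 B0 j m q< pw)
         (cong₂ (λ a b → countB (IsShiftedSolution ws (A0 + a) (B0 + b) j m) T) (cong proj₁ aq) (cong proj₂ aq))
    nonzeroAt-p : countB (λ t → not (U t) ∧ (true ∧ P0 t)) T
        ≡ shiftedCount ws (A0 + 1) (B0 + (3 * suc r1 + 1)) j (ℤ.+ m)
    nonzeroAt-p = trans (countB-nonzeroAt≡shifted ws p (λ _ → true) A0 B0 j m p< pw)
         (cong₂ (λ a b → countB (IsShiftedSolution ws (A0 + a) (B0 + b) j m) T) (cong proj₁ ap) (cong proj₂ ap))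
    nonzeroAt-both : countB (λ t → not (V t) ∧ (not (U t) ∧ P0 t)) T
        ≡ shiftedCount ws (A0 + 0 + 1) (B0 + (3 * r1 + 3) + (3 * suc r1 + 1)) j (ℤ.+ m)
    nonzeroAt-both = trans (countB-nonzeroAt≡shifted ws q (λ t → not (U t)) A0 B0 j m q< pw)
           (trans (cong₂ (λ a b → countB
               (λ t → not (U (incAt q t)) ∧ IsShiftedSolution ws (A0 + a) (B0 + b) j m t) T) (cong proj₁ aq)
               (cong proj₂ aq))
           (trans (countB-cong-tuples L m _ _
               (λ t _ → cong (λ z → not (z ≡ᵇ 0) ∧ IsShiftedSolution ws (A0 + 0) (B0 + (3 * r1 + 3)) j m t)
               (lookup0-incAt-other q p t (λ e → p≢q (sym e)))))
           (trans (countB-nonzeroAt≡shifted ws p (λ _ → true) (A0 + 0) (B0 + (3 * r1 + 3)) j m p< pw)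
                  (cong₂ (λ a b → countB (IsShiftedSolution ws (A0 + 0 + a) (B0 + (3 * r1 + 3) + b) j m) T)
                      (cong proj₁ ap) (cong proj₂ ap)))))

  -- For Y = 0^{r1} 1 1 0^{r3} the only coupling is that the free entries at positions p and q are not both zero.
  adjacentCount-inclusion-exclusion :
    countB (IsCountedDiffsWith m j Y) (tuples (suc (3 * n)) m)
        + shiftedCount ws (A0 + 0 + 1) (B0 + (3 * r1 + 3) + (3 * suc r1 + 1)) j (ℤ.+ m)
    ≡ shiftedCount ws (A0 + 0) (B0 + (3 * r1 + 3)) j (ℤ.+ m)
        + shiftedCount ws (A0 + 1) (B0 + (3 * suc r1 + 1)) j (ℤ.+ m)
  adjacentCount-inclusion-exclusion =
    trans (cong (_+ shiftedCount ws (A0 + 0 + 1) (B0 + (3 * r1 + 3) + (3 * suc r1 + 1)) j (ℤ.+ m))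
                (trans (countDiffsWith≡countFreeSolutions Y m j (isBinary-twoOnes r1 0 r3) (sum-twoOnes r1 0 r3)
                    (countOnes-twoOnes r1 0 r3))
                       (countB-cong-tuples L m (IsFreeSolution Y m j) (λ t → not (V t ∧ U t) ∧ P0 t)
                           (λ t (lt , _) → IsFreeSolution-adjacent r1 r3 m j t lt))))
    (trans (cong (countB (λ t → not (V t ∧ U t) ∧ P0 t) T +_) (sym nonzeroAt-both))
    (trans (countB-+ (λ t → not (V t ∧ U t) ∧ P0 t) (λ t → not (V t) ∧ (not (U t) ∧ P0 t))
                     (λ t → not (V t) ∧ (true ∧ P0 t)) (λ t → not (U t) ∧ (true ∧ P0 t)) T
                         (λ t → 𝟙-inclusion-exclusion (V t) (U t) (P0 t)))
    (cong₂ _+_ nonzeroAt-q nonzeroAt-p)))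

countOnes≤sum : ∀ Y → countOnes Y ≤ sumℕ Y
countOnes≤sum [] = z≤n
countOnes≤sum (zero ∷ Y) = countOnes≤sum Y
countOnes≤sum (suc zero ∷ Y) = s≤s (countOnes≤sum Y)
countOnes≤sum (suc (suc y) ∷ Y) = ≤-trans (countOnes≤sum Y) (m≤n+m _ (suc (suc y)))

sum≡0⇒zeros : ∀ Y → sumℕ Y ≡ 0 → Y ≡ zeros (length Y)
sum≡0⇒zeros [] e = refl
sum≡0⇒zeros (zero ∷ Y) e = cong (0 ∷_) (sum≡0⇒zeros Y e)

oneOne⇒pattern : ∀ Y → sumℕ Y ≡ 1 → countOnes Y ≡ 1 → Σ ℕ (λ a → Σ ℕ (λ b → Y ≡ zeros a ++ 1 ∷ zeros b))
oneOne⇒pattern (zero ∷ Y) s c with oneOne⇒pattern Y s c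
... | a , b , e = suc a , b , cong (0 ∷_) e
oneOne⇒pattern (suc zero ∷ Y) s c = 0 , length Y , cong (1 ∷_) (sum≡0⇒zeros Y (suc-injective s))
oneOne⇒pattern (suc (suc y) ∷ Y) () c

twoOnes-pattern : ∀ Y → sumℕ Y ≡ 2 → countOnes Y ≡ 2 → Σ ℕ (λ a → Σ ℕ (λ b → Σ ℕ (λ c → Y ≡ twoOnes a b c)))
twoOnes-pattern (zero ∷ Y) s c with twoOnes-pattern Y s c
... | a , b , c' , e = suc a , b , c' , cong (0 ∷_) e
twoOnes-pattern (suc zero ∷ Y) s c with oneOne⇒pattern Y (suc-injective s) (suc-injective c)
... | a , b , e = 0 , a , b , cong (1 ∷_) e
twoOnes-pattern (suc (suc zero) ∷ Y) s c
    = ⊥-elim (n≮0 (subst (_≤ 0) c (subst (countOnes Y ≤_) (+-cancelˡ-≡ 2 (sumℕ Y) 0 s) (countOnes≤sum Y))))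
twoOnes-pattern (suc (suc (suc y)) ∷ Y) () c

≡ᵇ-refl³ : ∀ a b c → ((a ≡ᵇ a) ∧ (b ≡ᵇ b) ∧ (c ≡ᵇ c)) ≡ true
≡ᵇ-refl³ a b c rewrite ≡ᵇ-refl a | ≡ᵇ-refl b | ≡ᵇ-refl c = refl

eqListᵇ-twoOnes : ∀ a b c a' b' c' → eqListᵇ (twoOnes a b c) (twoOnes a' b' c')
    ≡ ((a ≡ᵇ a') ∧ (b ≡ᵇ b') ∧ (c ≡ᵇ c'))
eqListᵇ-twoOnes a b c a' b' c' with (a ≡ᵇ a') ∧ (b ≡ᵇ b') ∧ (c ≡ᵇ c') in e
... | true with ∧≡true {a ≡ᵇ a'} e
...   | e1 , e23 with ∧≡true {b ≡ᵇ b'} e23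
...     | e2 , e3 rewrite ≡ᵇ⇒≡ᵗ a a' e1 | ≡ᵇ⇒≡ᵗ b b' e2 | ≡ᵇ⇒≡ᵗ c c' e3 = eqListᵇ-refl (twoOnes a' b' c')
eqListᵇ-twoOnes a b c a' b' c' | false = eqListᵇ-≢ _ _ ne
  where ne : twoOnes a b c ≢ twoOnes a' b' c' 
        ne q with twoOnes-injective a b c a' b' c' q
        ... | refl , refl , refl = false≢true (trans (sym e) (≡ᵇ-refl³ a b c))

-- The middle entries with ones at units k, k + 1, resp. k, k + d + 1: the index pairs of the two sums of the bracket.
adjacentPattern : ℕ → ℕ → List ℕ
adjacentPattern n k = twoOnes (k ∸ 1) 0 (n ∸ 1 ∸ k)

separatedPattern : ℕ → ℕ → ℕ → List ℕ
separatedPattern n dd k = twoOnes (k ∸ 1) dd (n ∸ dd ∸ 1 ∸ k)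

adjacentPattern-arith : ∀ r1 r3 → r1 + 0 + r3 + 2 ≡ suc (suc r1 + r3)
adjacentPattern-arith = ℕSolver.solve-∀

separatedPattern-arith : ∀ r1 e r3 → r1 + suc e + r3 + 2 ≡ suc e + suc (suc r1 + r3)
separatedPattern-arith = ℕSolver.solve-∀

adjacentPattern-last : ∀ r1 r3 → (r1 + 0 + r3 + 2) ∸ 1 ∸ suc r1 ≡ r3
adjacentPattern-last r1 r3 rewrite adjacentPattern-arith r1 r3 = m+n∸m≡n (suc r1) r3

separatedPattern-last : ∀ r1 e r3 → (r1 + suc e + r3 + 2) ∸ suc e ∸ 1 ∸ suc r1 ≡ r3
separatedPattern-last r1 e r3 rewrite separatedPattern-arith r1 e r3 | m+n∸m≡n (suc e) (suc (suc r1 + r3))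
    = m+n∸m≡n (suc r1) r3

𝟙-adjacentPattern : ∀ r1 r2 r3 n i → n ≡ r1 + r2 + r3 + 2
    → 𝟙 (eqListᵇ (twoOnes r1 r2 r3) (twoOnes i 0 (n ∸ 1 ∸ suc i))) ≡ 𝟙 (i ≡ᵇ r1) * 𝟙 (r2 ≡ᵇ 0)
𝟙-adjacentPattern r1 r2 r3 n i en rewrite eqListᵇ-twoOnes r1 r2 r3 i 0 (n ∸ 1 ∸ suc i) | ≡ᵇ-sym i r1 with r1 ≡ᵇ
    i in e1
... | false = refl
... | true with ≡ᵇ⇒≡ᵗ r1 i e1 | r2 ≡ᵇ 0 in e2
...   | refl | false = refl
...   | refl | true with ≡ᵇ⇒≡ᵗ r2 0 e2
...     | refl rewrite en | adjacentPattern-last r1 r3 | ≡ᵇ-refl r3 = refl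

𝟙-separatedPattern : ∀ r1 r2 r3 n e i → n ≡ r1 + r2 + r3 + 2
    → 𝟙 (eqListᵇ (twoOnes r1 r2 r3) (twoOnes i (suc e) (n ∸ suc e ∸ 1 ∸ suc i))) ≡ 𝟙 (i ≡ᵇ r1) * 𝟙 (suc e ≡ᵇ r2)
𝟙-separatedPattern r1 r2 r3 n e i en rewrite eqListᵇ-twoOnes r1 r2 r3 i (suc e) (n ∸ suc e ∸ 1 ∸ suc i) | ≡ᵇ-sym
    i r1 | ≡ᵇ-sym (suc e) r2 with r1 ≡ᵇ i in e1
... | false = refl
... | true with ≡ᵇ⇒≡ᵗ r1 i e1 | r2 ≡ᵇ suc e in e2
...   | refl | false = refl
...   | refl | true with ≡ᵇ⇒≡ᵗ r2 (suc e) e2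
...     | refl rewrite en | separatedPattern-last r1 e r3 | ≡ᵇ-refl r3 = refl

∑-adjacentPatterns : ∀ r1 r2 r3 n → n ≡ r1 + r2 + r3 + 2
    → ∑ (oneTo (n ∸ 1)) (λ k → 𝟙 (eqListᵇ (twoOnes r1 r2 r3) (adjacentPattern n k))) ≡ 𝟙 (r2 ≡ᵇ 0)
∑-adjacentPatterns r1 r2 r3 n en =
  trans (∑-oneTo (n ∸ 1) _)
  (trans (∑-cong (upTo (n ∸ 1)) (λ i → 𝟙-adjacentPattern r1 r2 r3 n i en))
  (trans (∑-*ʳ (upTo (n ∸ 1)) (𝟙 (r2 ≡ᵇ 0)) (λ i → 𝟙 (i ≡ᵇ r1)))
  (trans (cong (_* 𝟙 (r2 ≡ᵇ 0)) (∑-upTo-𝟙≡ᵇ (n ∸ 1) r1 r1<)) (+-identityʳ _))))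
  where
  r1< : r1 < n ∸ 1
  r1< = subst (r1 <_) (sym (cong (_∸ 1) (trans en (ar r1 r2 r3)))) (s≤s (m≤m+n r1 (r2 + r3)))
    where ar : ∀ r1 r2 r3 → r1 + r2 + r3 + 2 ≡ suc (suc (r1 + (r2 + r3)))
          ar = ℕSolver.solve-∀

∑-separatedPatterns-inner : ∀ r1 r2 r3 n e → n ≡ r1 + r2 + r3 + 2
    → ∑ (upTo (n ∸ suc e ∸ 1)) (λ i → 𝟙 (i ≡ᵇ r1) * 𝟙 (suc e ≡ᵇ r2)) ≡ 𝟙 (suc e ≡ᵇ r2)
∑-separatedPatterns-inner r1 r2 r3 n e en with suc e ≡ᵇ r2 in e2
... | false = trans (∑-cong (upTo (n ∸ suc e ∸ 1)) (λ i → *-zeroʳ (𝟙 (i ≡ᵇ r1)))) (∑-0 (upTo (n ∸ suc e ∸ 1)))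
... | true with ≡ᵇ⇒≡ᵗ (suc e) r2 e2
...   | refl = trans (∑-cong (upTo (n ∸ suc e ∸ 1)) (λ i → *-identityʳ (𝟙 (i ≡ᵇ r1))))
      (∑-upTo-𝟙≡ᵇ (n ∸ suc e ∸ 1) r1 r1<)
  where
  r1< : r1 < n ∸ suc e ∸ 1
  r1< = subst (r1 <_) (sym (trans (cong (λ z → z ∸ suc e ∸ 1) (trans en (separatedPattern-arith r1 e r3)))
      (trans (cong (_∸ 1) (m+n∸m≡n (suc e) (suc (suc r1 + r3)))) refl))) (s≤s (m≤m+n r1 r3))

∑-separatedPatterns : ∀ r1 r2 r3 n → n ≡ r1 + r2 + r3 + 2 →
  ∑ (oneTo (n ∸ 2)) (λ dd → ∑ (oneTo (n ∸ dd ∸ 1))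
      (λ k → 𝟙 (eqListᵇ (twoOnes r1 r2 r3) (separatedPattern n dd k)))) ≡ 𝟙 (not (r2 ≡ᵇ 0))
∑-separatedPatterns r1 r2 r3 n en =
  trans (∑-oneTo (n ∸ 2) _)
  (trans (∑-cong (upTo (n ∸ 2)) (λ e → trans (∑-oneTo (n ∸ suc e ∸ 1) _)
      (trans (∑-cong (upTo (n ∸ suc e ∸ 1)) (λ i → 𝟙-separatedPattern r1 r2 r3 n e i en))
      (∑-separatedPatterns-inner r1 r2 r3 n e en))))
  (outer r2 en))
  where
  outer : ∀ r2 → n ≡ r1 + r2 + r3 + 2 → ∑ (upTo (n ∸ 2)) (λ e → 𝟙 (suc e ≡ᵇ r2)) ≡ 𝟙 (not (r2 ≡ᵇ 0))
  outer zero _ = ∑-0 (upTo (n ∸ 2))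
  outer (suc e0) en' = ∑-upTo-𝟙≡ᵇ (n ∸ 2) e0 e0<
    where
    e0< : e0 < n ∸ 2
    e0< = subst (e0 <_) (sym (cong (_∸ 2) (trans en' (ar r1 e0 r3)))) (m≤n+m (suc e0) (r1 + r3))
      where ar : ∀ r1 e0 r3 → r1 + suc e0 + r3 + 2 ≡ suc (suc (r1 + r3 + suc e0))
            ar = ℕSolver.solve-∀

IsCountedDiffs⇒Σ₂ᵈ : ∀ m j d → IsCountedDiffs m j d ≡ true → Σ₂ᵈ d ≡ 2
IsCountedDiffs⇒Σ₂ᵈ m j d e = ≡ᵇ⇒≡ᵗ (Σ₂ᵈ d) 2
    (proj₁ (∧≡true {Σ₂ᵈ d ≡ᵇ 2} (proj₂
    (∧≡true {noTwoZeros d} (proj₁ (∧≡true {noTwoZeros d ∧ (Σ₂ᵈ d ≡ᵇ 2) ∧ (onesᵈ d ≡ᵇ 2)}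
    (proj₂ (∧≡true {weight d ≡ᵇ m} (proj₂ (∧≡true {lastPositive d} e))))))))))

IsCountedDiffs⇒onesᵈ : ∀ m j d → IsCountedDiffs m j d ≡ true → onesᵈ d ≡ 2
IsCountedDiffs⇒onesᵈ m j d e = ≡ᵇ⇒≡ᵗ (onesᵈ d) 2
    (proj₂ (∧≡true {Σ₂ᵈ d ≡ᵇ 2} (proj₂
    (∧≡true {noTwoZeros d} (proj₁ (∧≡true {noTwoZeros d ∧ (Σ₂ᵈ d ≡ᵇ 2) ∧ (onesᵈ d ≡ᵇ 2)}
    (proj₂ (∧≡true {weight d ≡ᵇ m} (proj₂ (∧≡true {lastPositive d} e))))))))))

IsCountedDiffs⇒twoOnes : ∀ n m j d → length d ≡ suc (3 * n) → IsCountedDiffs m j d ≡ true →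
  Σ ℕ (λ r₁ → Σ ℕ (λ r₂ → Σ ℕ (λ r₃ → unitSeconds d ≡ twoOnes r₁ r₂ r₃ × n ≡ r₁ + r₂ + r₃ + 2)))
IsCountedDiffs⇒twoOnes n m j d ld pd = with-length (twoOnes-pattern Y sY cY)
  where
  decomposition = unitDecomposition n d ld
  X = unitFirsts d
  Y = unitSeconds d
  W = unitThirds d
  lY = proj₁ (proj₂ (proj₂ decomposition))
  lX : length X ≡ suc (length Y)
  lX = trans (proj₁ (proj₂ decomposition)) (cong suc (sym lY))
  lW : length W ≡ length Y
  lW = trans (proj₂ (proj₂ (proj₂ decomposition))) (sym lY)
  sY : sumℕ Y ≡ 2
  sY = trans (sym (Σ₂ᵈ-interleave X Y W lX lW))
      (trans (cong Σ₂ᵈ (proj₁ decomposition)) (IsCountedDiffs⇒Σ₂ᵈ m j d pd))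
  cY : countOnes Y ≡ 2
  cY = trans (sym (onesᵈ-interleave X Y W lX lW))
      (trans (cong onesᵈ (proj₁ decomposition)) (IsCountedDiffs⇒onesᵈ m j d pd))
  with-length : Σ ℕ (λ r₁ → Σ ℕ (λ r₂ → Σ ℕ (λ r₃ → Y ≡ twoOnes r₁ r₂ r₃))) →
    Σ ℕ (λ r₁ → Σ ℕ (λ r₂ → Σ ℕ (λ r₃ → Y ≡ twoOnes r₁ r₂ r₃ × n ≡ r₁ + r₂ + r₃ + 2)))
  with-length (r₁ , r₂ , r₃ , Y≡) = r₁ , r₂ , r₃ , Y≡
      , trans (sym lY) (trans (cong length Y≡) (length-twoOnes r₁ r₂ r₃))

-- Each counted d has its middle entries of units equal to exactly one of the patterns:
-- an adjacent one (r₂ = 0) or a separated one (r₂ ≥ 1).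
𝟙-IsCountedDiffs-patterns : ∀ n m j d → InBox (suc (3 * n)) m d →
  𝟙 (IsCountedDiffs m j d) ≡ ∑ (oneTo (n ∸ 1)) (λ k → 𝟙 (IsCountedDiffsWith m j (adjacentPattern n k) d))
                             + ∑ (oneTo (n ∸ 2))
                                 (λ d′ → ∑ (oneTo (n ∸ d′ ∸ 1))
                                 (λ k → 𝟙 (IsCountedDiffsWith m j (separatedPattern n d′ k) d)))
𝟙-IsCountedDiffs-patterns n m j d (ld , _) with IsCountedDiffs m j d in pd
... | false = sym (cong₂ _+_ (∑-0 (oneTo (n ∸ 1)))
      (trans (∑-cong (oneTo (n ∸ 2)) (λ d′ → ∑-0 (oneTo (n ∸ d′ ∸ 1)))) (∑-0 (oneTo (n ∸ 2)))))
... | true with IsCountedDiffs⇒twoOnes n m j d ld pd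
...   | r₁ , r₂ , r₃ , Y≡ , n≡ = sym (begin
  ∑ (oneTo (n ∸ 1)) (λ k → 𝟙 (eqListᵇ (unitSeconds d) (adjacentPattern n k)))
  + ∑ (oneTo (n ∸ 2)) (λ d′ → ∑ (oneTo (n ∸ d′ ∸ 1))
      (λ k → 𝟙 (eqListᵇ (unitSeconds d) (separatedPattern n d′ k))))
    ≡⟨ cong (λ Y → ∑ (oneTo (n ∸ 1)) (λ k → 𝟙 (eqListᵇ Y (adjacentPattern n k)))
                   + ∑ (oneTo (n ∸ 2))
                       (λ d′ → ∑ (oneTo (n ∸ d′ ∸ 1)) (λ k → 𝟙 (eqListᵇ Y (separatedPattern n d′ k))))) Y≡ ⟩
  ∑ (oneTo (n ∸ 1)) (λ k → 𝟙 (eqListᵇ (twoOnes r₁ r₂ r₃) (adjacentPattern n k)))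
  + ∑ (oneTo (n ∸ 2)) (λ d′ → ∑ (oneTo (n ∸ d′ ∸ 1))
      (λ k → 𝟙 (eqListᵇ (twoOnes r₁ r₂ r₃) (separatedPattern n d′ k))))
    ≡⟨ cong₂ _+_ (∑-adjacentPatterns r₁ r₂ r₃ n n≡) (∑-separatedPatterns r₁ r₂ r₃ n n≡) ⟩
  𝟙 (r₂ ≡ᵇ 0) + 𝟙 (not (r₂ ≡ᵇ 0))
    ≡⟨ 𝟙-split (r₂ ≡ᵇ 0) ⟩
  1 ∎)
  where open ≡-Reasoning

countDiffs-patterns : ∀ n m j → countB (IsCountedDiffs m j) (tuples (suc (3 * n)) m) ≡
  ∑ (oneTo (n ∸ 1)) (λ k → countB (IsCountedDiffsWith m j (adjacentPattern n k)) (tuples (suc (3 * n)) m))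
  + ∑ (oneTo (n ∸ 2)) (λ dd → ∑ (oneTo (n ∸ dd ∸ 1))
      (λ k → countB (IsCountedDiffsWith m j (separatedPattern n dd k)) (tuples (suc (3 * n)) m)))
countDiffs-patterns n m j =
  trans (countB≡∑𝟙 (IsCountedDiffs m j) T)
  (trans (∑-cong-tuples (suc (3 * n)) m (𝟙-IsCountedDiffs-patterns n m j))
  (trans (∑-+ T _ _)
  (cong₂ _+_
    (trans (∑-swap T (oneTo (n ∸ 1)) (λ d k → 𝟙 (IsCountedDiffsWith m j (adjacentPattern n k) d)))
        (∑-cong (oneTo (n ∸ 1)) (λ k → sym (countB≡∑𝟙 (IsCountedDiffsWith m j (adjacentPattern n k)) T))))
    (trans (∑-swap T (oneTo (n ∸ 2)) (λ d dd
        → ∑ (oneTo (n ∸ dd ∸ 1)) (λ k → 𝟙 (IsCountedDiffsWith m j (separatedPattern n dd k) d))))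
      (∑-cong (oneTo (n ∸ 2)) (λ dd → trans
          (∑-swap T (oneTo (n ∸ dd ∸ 1)) (λ d k → 𝟙 (IsCountedDiffsWith m j (separatedPattern n dd k) d)))
                                            (∑-cong (oneTo (n ∸ dd ∸ 1))
                                                (λ k → sym (countB≡∑𝟙
                                                (IsCountedDiffsWith m j (separatedPattern n dd k)) T)))))))))
  where T = tuples (suc (3 * n)) m




adjacentCount : ℕ → ℤ → ℕ → ℤ → ℕ
adjacentCount n j k (ℤ.+ m) = countB (IsCountedDiffsWith m j (adjacentPattern n k)) (tuples (suc (3 * n)) m)
adjacentCount n j k -[1+ m ] = 0

separatedCount : ℕ → ℤ → ℕ → ℕ → ℤ → ℕ
separatedCount n j dd k (ℤ.+ m) = countB (IsCountedDiffsWith m j (separatedPattern n dd k))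
    (tuples (suc (3 * n)) m)
separatedCount n j dd k -[1+ m ] = 0

ℤ-inclusion-exclusion : ∀ a b c d → a + b ≡ c + d → ℤ.+ c ℤ.+ (ℤ.+ d ℤ.- ℤ.+ b) ≡ ℤ.+ a
ℤ-inclusion-exclusion a b c d e = begin
  ℤ.+ c ℤ.+ (ℤ.+ d ℤ.- ℤ.+ b)   ≡⟨ reassoc (ℤ.+ c) (ℤ.+ d) (ℤ.+ b) ⟩
  ℤ.+ (c + d) ℤ.- ℤ.+ b         ≡⟨ cong (λ x → ℤ.+ x ℤ.- ℤ.+ b) e ⟨
  ℤ.+ (a + b) ℤ.- ℤ.+ b         ≡⟨ cancel (ℤ.+ a) (ℤ.+ b) ⟩
  ℤ.+ a                          ∎
  where
  open ≡-Reasoning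
  reassoc : ∀ (x y z : ℤ) → x ℤ.+ (y ℤ.- z) ≡ (x ℤ.+ y) ℤ.- z
  reassoc = ℤSolver.solve-∀
  cancel : ∀ (x y : ℤ) → (x ℤ.+ y) ℤ.- y ≡ x
  cancel = ℤSolver.solve-∀

twoOnes-shape : ∀ r₁ r₂ r₃ n → r₁ + r₂ + r₃ + 2 ≡ suc n →
  length (twoOnes r₁ r₂ r₃) ≡ suc n × zOffset (twoOnes r₁ r₂ r₃) ≡ n
twoOnes-shape r₁ r₂ r₃ n e =
  trans (length-twoOnes r₁ r₂ r₃) e ,
  trans (zOffset-twoOnes r₁ r₂ r₃) (suc-injective (trans (cong suc (+-comm _ 1)) (trans (+-comm 2 _) e)))

adjacentPattern-length : ∀ n i → i < n → i + 0 + (n ∸ suc i) + 2 ≡ suc n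
adjacentPattern-length n i i<n = trans (regroup i (n ∸ suc i)) (cong suc (m+[n∸m]≡n i<n))
  where
  regroup : ∀ i r → i + 0 + r + 2 ≡ suc (suc i + r)
  regroup = ℕSolver.solve-∀

adjacentSummand≡adjacentCount : ∀ n i j m → i < n →
  coeffG (suc n) (adjacentSummand (suc i)) j m ≡ ℤ.+ adjacentCount (suc n) j (suc i) m
adjacentSummand≡adjacentCount n i j m i<n =
  trans (adjacentSummand-coeff n (suc i) j m (B + (3 * i + 3)) (B + (3 * suc i + 1))
                               (trans (sym exponent) (split₁ B i)) (trans (sym exponent) (split₂ B i)))
        (by-sign m)
  where
  r₃ = n ∸ suc i
  Y = twoOnes i 0 r₃
  B = qOffset Y
  ws = pochWeights (suc n)
  exponent : B + (6 * i + 3 * 0 + 7) ≡ gExponent (suc n)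
  exponent = trans (qOffset-twoOnes i 0 r₃) (cong gExponent (adjacentPattern-length n i i<n))
  split₁ : ∀ B i → B + (6 * i + 3 * 0 + 7) ≡ B + (3 * i + 3) + (3 * suc i + 1)
  split₁ = ℕSolver.solve-∀
  split₂ : ∀ B i → B + (6 * i + 3 * 0 + 7) ≡ B + (3 * suc i + 1) + 3 * suc i
  split₂ = ℕSolver.solve-∀
  at-shape : ∀ m N → length Y ≡ N → ∀ A → zOffset Y ≡ A →
    countB (IsCountedDiffsWith m j Y) (tuples (suc (3 * N)) m)
      + shiftedCount (pochWeights N) (A + 0 + 1) (B + (3 * i + 3) + (3 * suc i + 1)) j (ℤ.+ m)
    ≡ shiftedCount (pochWeights N) (A + 0) (B + (3 * i + 3)) j (ℤ.+ m)
      + shiftedCount (pochWeights N) (A + 1) (B + (3 * suc i + 1)) j (ℤ.+ m)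
  at-shape m N refl A refl = adjacentCount-inclusion-exclusion i r₃ m j
  by-sign : ∀ m →
    ℤ.+ shiftedCount ws n (B + (3 * i + 3)) j m
      ℤ.+ (ℤ.+ shiftedCount ws (suc n) (B + (3 * suc i + 1)) j m ℤ.-
          ℤ.+ shiftedCount ws (suc n) (gExponent (suc n)) j m)
    ≡ ℤ.+ adjacentCount (suc n) j (suc i) m
  by-sign -[1+ m ] = refl
  by-sign (ℤ.+ m) = ℤ-inclusion-exclusion _ _ _ _ (begin
    adjacentCount (suc n) j (suc i) (ℤ.+ m) + shiftedCount ws (suc n) (gExponent (suc n)) j (ℤ.+ m)
      ≡⟨ cong₂ (λ a b → adjacentCount (suc n) j (suc i) (ℤ.+ m) + shiftedCount ws a b j (ℤ.+ m))
               (sym (trans (+-comm (n + 0) 1) (cong suc (+-identityʳ n)))) (trans (sym exponent) (split₁ B i)) ⟩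
    adjacentCount (suc n) j (suc i) (ℤ.+ m)
        + shiftedCount ws (n + 0 + 1) (B + (3 * i + 3) + (3 * suc i + 1)) j (ℤ.+ m)
      ≡⟨ at-shape m (suc n) (proj₁ shape) n (proj₂ shape) ⟩
    shiftedCount ws (n + 0) (B + (3 * i + 3)) j (ℤ.+ m)
        + shiftedCount ws (n + 1) (B + (3 * suc i + 1)) j (ℤ.+ m)
      ≡⟨ cong₂ (λ a b → shiftedCount ws a (B + (3 * i + 3)) j (ℤ.+ m)
          + shiftedCount ws b (B + (3 * suc i + 1)) j (ℤ.+ m))
               (+-identityʳ n) (+-comm n 1) ⟩
    shiftedCount ws n (B + (3 * i + 3)) j (ℤ.+ m) + shiftedCount ws (suc n) (B + (3 * suc i + 1)) j (ℤ.+ m) ∎)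
    where
    open ≡-Reasoning
    shape = twoOnes-shape i 0 r₃ n (adjacentPattern-length n i i<n)

0<∸⇒≤ : ∀ a b → 0 < a ∸ b → b ≤ a
0<∸⇒≤ a zero _ = z≤n
0<∸⇒≤ (suc a) (suc b) p = s≤s (0<∸⇒≤ a b p)

separatedPattern-length : ∀ n e i → i < n ∸ suc e ∸ 1 → i + suc e + (n ∸ suc e ∸ 1 ∸ suc i) + 2 ≡ n
separatedPattern-length n e i i<K = begin
  i + suc e + (K ∸ suc i) + 2   ≡⟨ regroup i (suc e) (K ∸ suc i) ⟩
  K ∸ suc i + suc i + suc e + 1 ≡⟨ cong (λ z → z + suc e + 1) (m∸n+n≡m i<K) ⟩
  K + suc e + 1                 ≡⟨ +-comm-last K (suc e) ⟩
  K + 1 + suc e                 ≡⟨ cong (_+ suc e) (m∸n+n≡m 1≤n∸e) ⟩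
  n ∸ suc e + suc e             ≡⟨ m∸n+n≡m (0<∸⇒≤ n (suc e) 1≤n∸e) ⟩
  n                             ∎
  where
  open ≡-Reasoning
  K = n ∸ suc e ∸ 1
  regroup : ∀ i se r → i + se + r + 2 ≡ r + suc i + se + 1
  regroup = ℕSolver.solve-∀
  +-comm-last : ∀ K se → K + se + 1 ≡ K + 1 + se
  +-comm-last = ℕSolver.solve-∀
  1≤n∸e : 1 ≤ n ∸ suc e
  1≤n∸e = 0<∸⇒≤ (n ∸ suc e) 1 (≤-trans (s≤s z≤n) i<K)

separatedSummand≡separatedCount : ∀ n e i j m → i < suc n ∸ suc e ∸ 1 →
  coeffG (suc n) (separatedSummand (suc e) (suc i)) j m ≡ ℤ.+ separatedCount (suc n) j (suc e) (suc i) m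
separatedSummand≡separatedCount n e i j m i<K
    = trans (separatedSummand-coeff n (suc e) (suc i) j m B exponent) (by-sign m)
  where
  r₃ = suc n ∸ suc e ∸ 1 ∸ suc i
  Y = twoOnes i (suc e) r₃
  B = qOffset Y
  length≡ = separatedPattern-length (suc n) e i i<K
  exponent : gExponent (suc n) ≡ B + (6 * suc i + 3 * suc e + 1)
  exponent = trans (sym (trans (qOffset-twoOnes i (suc e) r₃) (cong gExponent length≡))) (split B i e)
    where
    split : ∀ B i e → B + (6 * i + 3 * suc e + 7) ≡ B + (6 * suc i + 3 * suc e + 1)
    split = ℕSolver.solve-∀
  at-shape : ∀ m N → length Y ≡ N → ∀ A → zOffset Y ≡ A →
    countB (IsCountedDiffsWith m j Y) (tuples (suc (3 * N)) m) ≡ shiftedCount (pochWeights N) A B j (ℤ.+ m)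
  at-shape m N refl A refl = separatedCount≡shiftedCount i e r₃ m j
  by-sign : ∀ m → ℤ.+ shiftedCount (pochWeights (suc n)) n B j m
      ≡ ℤ.+ separatedCount (suc n) j (suc e) (suc i) m
  by-sign -[1+ m ] = refl
  by-sign (ℤ.+ m) = cong ℤ.+_ (sym (at-shape m (suc n) (proj₁ shape) n (proj₂ shape)))
    where shape = twoOnes-shape i (suc e) r₃ n length≡

sumℤ-cong-applyUpTo : ∀ (F G : ℕ → ℤ) (f : ℕ → ℕ) N → (∀ i → i < N → F (f i) ≡ G (f i)) →
  sumℤ (map F (applyUpTo f N)) ≡ sumℤ (map G (applyUpTo f N))
sumℤ-cong-applyUpTo F G f zero h = refl
sumℤ-cong-applyUpTo F G f (suc N) h =
  cong₂ ℤ._+_ (h 0 (s≤s z≤n)) (sumℤ-cong-applyUpTo F G (f ∘ suc) N (λ i i<N → h (suc i) (s≤s i<N)))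

sumℤ-cong-oneTo : ∀ N (F G : ℕ → ℤ) → (∀ i → i < N → F (suc i) ≡ G (suc i)) →
  sumℤ (map F (oneTo N)) ≡ sumℤ (map G (oneTo N))
sumℤ-cong-oneTo N F G h =
  trans (cong (λ l → sumℤ (map F l)) (List.map-upTo suc N))
  (trans (sumℤ-cong-applyUpTo F G suc N h) (cong (λ l → sumℤ (map G l)) (sym (List.map-upTo suc N))))

lhsSeries-patterns : ∀ n j m → lhsSeries n j m ≡
  ℤ.+ (∑ (oneTo (n ∸ 1)) (λ k → adjacentCount n j k m)
       + ∑ (oneTo (n ∸ 2)) (λ d → ∑ (oneTo (n ∸ d ∸ 1)) (λ k → separatedCount n j d k m)))
lhsSeries-patterns n j (ℤ.+ m) = cong ℤ.+_
    (trans (countPartitions≡countDiffs (suc (3 * n)) m j) (countDiffs-patterns n m j))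
lhsSeries-patterns n j -[1+ m ] =
  sym (cong ℤ.+_ (cong₂ _+_ (∑-0 (oneTo (n ∸ 1)))
      (trans (∑-cong (oneTo (n ∸ 2)) (λ d → ∑-0 (oneTo (n ∸ d ∸ 1)))) (∑-0 (oneTo (n ∸ 2))))))

sumℤ-adjacentSummands : ∀ n j m →
  sumℤ (map (λ k → coeffG (suc n) (adjacentSummand k) j m) (oneTo n))
      ≡ ℤ.+ ∑ (oneTo n) (λ k → adjacentCount (suc n) j k m)
sumℤ-adjacentSummands n j m =
  trans (sumℤ-cong-oneTo n _ (λ k → ℤ.+ adjacentCount (suc n) j k m)
      (λ i i<n → adjacentSummand≡adjacentCount n i j m i<n))
        (sumℤ-map-+ (oneTo n) _ (λ k → adjacentCount (suc n) j k m) (λ _ → refl))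

sumℤ-separatedSummands : ∀ n j m →
  sumℤ (map (λ d → sumℤ (map (λ k → coeffG (suc n) (separatedSummand d k) j m) (oneTo (suc n ∸ d ∸ 1))))
      (oneTo (suc n ∸ 2)))
  ≡ ℤ.+ ∑ (oneTo (suc n ∸ 2)) (λ d → ∑ (oneTo (suc n ∸ d ∸ 1)) (λ k → separatedCount (suc n) j d k m))
sumℤ-separatedSummands n j m =
  trans (sumℤ-cong-oneTo (suc n ∸ 2) _ (ℤ.+_ ∘ separated) (λ d _ →
          trans (sumℤ-cong-oneTo (suc n ∸ suc d ∸ 1) _ (λ k → ℤ.+ separatedCount (suc n) j (suc d) k m)
                                 (λ i i< → separatedSummand≡separatedCount n d i j m i<))
                (sumℤ-map-+ (oneTo (suc n ∸ suc d ∸ 1)) _ (λ k → separatedCount (suc n) j (suc d) k m)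
                    (λ _ → refl))))
        (sumℤ-map-+ (oneTo (suc n ∸ 2)) (ℤ.+_ ∘ separated) separated (λ _ → refl))
  where
  separated : ℕ → ℕ
  separated d = ∑ (oneTo (suc n ∸ d ∸ 1)) (λ k → separatedCount (suc n) j d k m)

lemma3p6 : (n : ℕ) → 1 ≤ n → (j m : ℤ) → lhsSeries n j m ≡ rhsSeries n j m
lemma3p6 (suc n) _ j m =
  trans (lhsSeries-patterns (suc n) j m)
  (trans (ℤP.pos-+ (∑ (oneTo n) (λ k → adjacentCount (suc n) j k m))
                   (∑ (oneTo (suc n ∸ 2))
                       (λ d → ∑ (oneTo (suc n ∸ d ∸ 1)) (λ k → separatedCount (suc n) j d k m))))
  (trans (sym (cong₂ ℤ._+_ (sumℤ-adjacentSummands n j m) (sumℤ-separatedSummands n j m)))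
         (sym (rhsSeries-split (suc n) j m))))
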